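{- Let $F_2$ be the graph with vertex set $\{1,2,3,4,5\}$ and edge set $\{12,15,23,24,34,35,45\}$. If a graph $G$ contains $F_2$ as an induced minor, then $G$ has an $F_2$-model $\mathcal X=\{X_1,\dots,X_5\}$ such that: (i) $X_1=\{u\}$ for some $u\in V(G)$; (ii) $X_2=\{r\}$ for some $r\in V(G)$; (iii) $u$ has at most two neighbours in $X_5$; (iv) $r$ has at most two neighbours in $X_3$ and at most two neighbours in $X_4$.
   Context: All graphs are finite and simple. A graph $G$ contains $H$ as an induced minor if $H$ can be obtained from $G$ by vertex deletions and edge contractions. For a graph $H$, an $H$-model in $G$ is a family $\{X_y: y\in V(H)\}$ of nonempty, pairwise disjoint, connected vertex subsets of $G$ such that for distinct $y,z$, $X_y$ and $X_z$ are joined by some edge of $G$ if and only if $yz\in E(H)$. -}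

module Defs where

open import Data.Nat using (ℕ; zero; suc; _≤_)
open import Data.Bool using (Bool; true; false; _∨_; _∧_; if_then_else_)
open import Data.Fin using (Fin; zero; suc; punchIn)
open import Data.Fin.Subset using (Subset; _∈_; _∩_; ∣_∣)
open import Data.Vec using (tabulate)
open import Data.Product using (Σ; ∃; _×_; _,_)
open import Relation.Binary.PropositionalEquality using (_≡_; _≢_)
open import Relation.Nullary using (¬_)
open import Relation.Nullary.Decidable using (⌊_⌋)
open import Function.Bundles using (_↔_; Inverse)

Graph : ℕ → Set
Graph n = Fin n → Fin n → Bool

record IsSimple {n : ℕ} (G : Graph n) : Set where
  field
    sym     : ∀ a b → G a b ≡ G b a
    irrefl  : ∀ a → G a a ≡ false

deleteV : ∀ {m} → Graph (suc m) → Fin (suc m) → Graph m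
deleteV G v i j = G (punchIn v i) (punchIn v j)

-- Contracting the edge uv: v is removed and u (now punchIn v ⁻¹ u) inherits
-- the neighbours of v.
contract : ∀ {m} → Graph (suc m) → Fin (suc m) → Fin (suc m) → Graph m
contract G u v i j =
  if ⌊ i Data.Fin.≟ j ⌋ then false
  else (G a b ∨ ((⌊ a Data.Fin.≟ u ⌋ ∧ G v b) ∨ (⌊ b Data.Fin.≟ u ⌋ ∧ G v a)))
  where
    a = punchIn v i
    b = punchIn v j

Iso : ∀ {k n} → Graph k → Graph n → Set
Iso {k} {n} H G =
  Σ (Fin k ↔ Fin n) λ f → ∀ i j → H i j ≡ G (Inverse.to f i) (Inverse.to f j)

data IsInducedMinor {k : ℕ} (H : Graph k) : ∀ {n} → Graph n → Set where
  iso  : ∀ {n} {G : Graph n} → Iso H G → IsInducedMinor H G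
  del  : ∀ {m} {G : Graph (suc m)} (v : Fin (suc m)) →
         IsInducedMinor H (deleteV G v) → IsInducedMinor H G
  con  : ∀ {m} {G : Graph (suc m)} (u v : Fin (suc m)) →
         u ≢ v → G u v ≡ true →
         IsInducedMinor H (contract G u v) → IsInducedMinor H G

-- Walks inside the vertex set X (all vertices after the start lie in X).
data Reach {n} (G : Graph n) (X : Subset n) : Fin n → Fin n → Set where
  here : ∀ {a} → Reach G X a a
  step : ∀ {a b c} → G a b ≡ true → b ∈ X → Reach G X b c → Reach G X a c

Connected : ∀ {n} → Graph n → Subset n → Set
Connected G X = ∀ a b → a ∈ X → b ∈ X → Reach G X a b

Touch : ∀ {n} → Graph n → Subset n → Subset n → Set
Touch G X Y = ∃ λ a → ∃ λ b → a ∈ X × b ∈ Y × G a b ≡ true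

record IsModel {k n} (H : Graph k) (G : Graph n) (X : Fin k → Subset n) : Set where
  field
    nonempty  : ∀ y → ∃ λ a → a ∈ X y
    disjoint  : ∀ y z → y ≢ z → ∀ a → a ∈ X y → ¬ (a ∈ X z)
    connected : ∀ y → Connected G (X y)
    touch⇒edge : ∀ y z → y ≢ z → Touch G (X y) (X z) → H y z ≡ true
    edge⇒touch : ∀ y z → y ≢ z → H y z ≡ true → Touch G (X y) (X z)

N : ∀ {n} → Graph n → Fin n → Subset n
N G u = tabulate (G u)

degIn : ∀ {n} → Graph n → Fin n → Subset n → ℕ
degIn G u X = ∣ X ∩ N G u ∣

-- F₂: vertices 1..5 are encoded as 0..4; edges 12,15,23,24,34,35,45.
v1 v2 v3 v4 v5 : Fin 5
v1 = zero
v2 = suc zero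
v3 = suc (suc zero)
v4 = suc (suc (suc zero))
v5 = suc (suc (suc (suc zero)))

F₂ : Graph 5
F₂ zero (suc zero) = true
F₂ zero (suc (suc (suc (suc zero)))) = true
F₂ (suc zero) zero = true
F₂ (suc zero) (suc (suc zero)) = true
F₂ (suc zero) (suc (suc (suc zero))) = true
F₂ (suc (suc zero)) (suc zero) = true
F₂ (suc (suc zero)) (suc (suc (suc zero))) = true
F₂ (suc (suc zero)) (suc (suc (suc (suc zero)))) = true
F₂ (suc (suc (suc zero))) (suc zero) = true
F₂ (suc (suc (suc zero))) (suc (suc zero)) = true
F₂ (suc (suc (suc zero))) (suc (suc (suc (suc zero)))) = true
F₂ (suc (suc (suc (suc zero)))) zero = true
F₂ (suc (suc (suc (suc zero)))) (suc (suc zero)) = true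
F₂ (suc (suc (suc (suc zero)))) (suc (suc (suc zero))) = true
F₂ _ _ = false

{-# OPTIONS --safe #-}
module Submission where

-- An induced minor yields an F₂-model X = (X₁,…,X₅) of G (F₂ is the triangle 345 with 2 joined
-- to 3, 4 and 1 joined to 2, 5).  We induct on the number of vertices used by X: a model either
-- has all the required properties, or can be replaced by one using strictly fewer vertices.
--
-- First X₂, then X₁, is cut down to one vertex without using new vertices.  Take a path P in
-- X₂ from a neighbour of X₃ to a neighbour of X₄.  If exactly one vertex c of P sees X₁,
-- set X₂ = {c} and hand the two sides of P to X₃ and X₄.  If two vertices of P see X₁, look at
-- the analogous path in X₅ (2 ↔ 5 is an automorphism of F₂); if it has two such vertices too,
-- reassigning the pieces gives a model avoiding one of them.  If no vertex of P sees X₁, take a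
-- path R in X₂ from P to a neighbour of X₁ that touches P only at its first vertex h and sees X₁
-- only at its last.  If a vertex of R other than the last sees X₄ (or X₃), reroute P through R
-- and shorten R; otherwise X₂ becomes the last vertex of R (if it sees X₄ or X₃), or h (if h
-- has two neighbours on P), or the unique neighbour of h on P, the remaining pieces going to X₁,
-- X₃ and X₄.  Finally X₁ shrinks to the last vertex that sees X₂ on an X₂–X₅ path in X₁, the
-- rest of the path joining X₅.
--
-- With X₁ = {u} and X₂ = {r}, suppose u has three neighbours in X₅.  A path Q in X₅
-- between X₃ and X₄, extended if necessary by a path to one neighbour of u, is a connected
-- proper subset of X₅ touching X₁, X₃, X₄ unless Q itself carries three neighbours of u; in that
-- case Q has a chord skipping the second one, or a reassignment of {u}, {r} and pieces of Q, X₃,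
-- X₄ gives a smaller model.  The same argument applies to r and X₃, and to r and X₄ by the
-- automorphism 3 ↔ 4.

open import Data.Nat using (ℕ; zero; suc; _≤_; _<_; z≤n; s≤s; _+_; _≤?_)
open import Data.Nat.Properties using (≤-refl; ≤-reflexive; ≤-trans; ≤-pred; +-monoʳ-≤; +-suc; n≤1+n)
open import Data.Bool using (Bool; true; false; _∨_; _∧_; not; if_then_else_)
open import Data.Bool.Properties using (∨-assoc; ∨-comm; ∨-identityʳ) renaming (_≟_ to _≟ᵇ_)
open import Data.Fin using (Fin; zero; suc; punchIn; punchOut; _≟_)
open import Data.Fin.Properties using (punchIn-injective; punchInᵢ≢i; punchOut-cong; punchOut-punchIn; punchIn-punchOut; all?)
open import Data.Fin.Subset using (Subset; _∈_; _∩_; ∣_∣)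
import Data.Fin.Subset as Subset
import Data.Fin.Subset.Properties as Subsetₚ
open import Data.Vec using (tabulate)
import Data.Vec as Vec
open import Data.Vec.Properties using (lookup∘tabulate; []=⇒lookup; lookup⇒[]=)
open import Data.List using (List; []; _∷_; _++_; length; reverse)
open import Data.List.Properties using (++-assoc; unfold-reverse; ∷-injective)
open import Data.Product using (Σ; ∃; _×_; _,_; proj₁; proj₂)
open import Data.Sum using (_⊎_; inj₁; inj₂)
open import Data.Empty using (⊥; ⊥-elim)
open import Data.Unit using (⊤; tt)
open import Data.Fin.Permutation.Components using (transpose)
open import Function using (_∘_)
open import Function.Bundles using (Inverse)
open import Relation.Binary.PropositionalEquality using (_≡_; _≢_; refl; sym; trans; cong; cong₂; subst; subst₂)
open import Relation.Nullary using (does; yes; no; ¬_)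
open import Relation.Nullary.Decidable using (⌊_⌋; dec-true; dec-false; from-yes)

open import Defs

true≢false : ∀ {b} → b ≡ true → b ≡ false → ⊥
true≢false refl ()

≢true⇒false : ∀ {b} → ¬ (b ≡ true) → b ≡ false
≢true⇒false {true} h = ⊥-elim (h refl)
≢true⇒false {false} h = refl

true⊎false : ∀ b → (b ≡ true) ⊎ (b ≡ false)
true⊎false true = inj₁ refl
true⊎false false = inj₂ refl

∨-introˡ : ∀ {a} b → a ≡ true → a ∨ b ≡ true
∨-introˡ b refl = refl

∨-introʳ : ∀ a {b} → b ≡ true → a ∨ b ≡ true
∨-introʳ true refl = refl
∨-introʳ false refl = refl

∨-elim : ∀ a {b} → a ∨ b ≡ true → (a ≡ true) ⊎ (b ≡ true)
∨-elim true _ = inj₁ refl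
∨-elim false p = inj₂ p

∨-false : ∀ a {b} → a ≡ false → b ≡ false → a ∨ b ≡ false
∨-false false refl refl = refl

∧-intro : ∀ {a b} → a ≡ true → b ≡ true → a ∧ b ≡ true
∧-intro refl refl = refl

∧-elimˡ : ∀ a {b} → a ∧ b ≡ true → a ≡ true
∧-elimˡ true _ = refl

∧-elimʳ : ∀ a {b} → a ∧ b ≡ true → b ≡ true
∧-elimʳ true p = p

-- Vertex sets are Boolean predicates; `toSubset` turns them into the `Subset`s of the statement.
FinPred : ℕ → Set
FinPred n = Fin n → Bool

infixr 6 _∪_
infix 4 _⊆_

_∪_ : ∀ {n} → FinPred n → FinPred n → FinPred n
(f ∪ g) x = f x ∨ g x

⁅_⁆ : ∀ {n} → Fin n → FinPred n
⁅ c ⁆ x = does (x ≟ c)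

_⊆_ : ∀ {n} → FinPred n → FinPred n → Set
f ⊆ g = ∀ x → f x ≡ true → g x ≡ true

Disjoint : ∀ {n} → FinPred n → FinPred n → Set
Disjoint f g = ∀ x → f x ≡ true → g x ≡ true → ⊥

∪-elim : ∀ {n} (f g : FinPred n) x → (f ∪ g) x ≡ true → (f x ≡ true) ⊎ (g x ≡ true)
∪-elim f g x p = ∨-elim (f x) p

∪-introˡ : ∀ {n} {f : FinPred n} (g : FinPred n) {x} → f x ≡ true → (f ∪ g) x ≡ true
∪-introˡ g {x} p = ∨-introˡ (g x) p

∪-introʳ : ∀ {n} (f : FinPred n) {g : FinPred n} {x} → g x ≡ true → (f ∪ g) x ≡ true
∪-introʳ f {x = x} p = ∨-introʳ (f x) p

x∈⁅y⁆⇒x≡y : ∀ {n} {c x : Fin n} → ⁅ c ⁆ x ≡ true → x ≡ c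
x∈⁅y⁆⇒x≡y {c = c} {x} p with x ≟ c
x∈⁅y⁆⇒x≡y p | yes e = e
x∈⁅y⁆⇒x≡y () | no _

x∈⁅x⁆ : ∀ {n} (c : Fin n) → ⁅ c ⁆ c ≡ true
x∈⁅x⁆ c = dec-true (c ≟ c) refl

x≢y⇒x∉⁅y⁆ : ∀ {n} {x y : Fin n} → x ≢ y → ⁅ y ⁆ x ≡ false
x≢y⇒x∉⁅y⁆ {x = x} {y} = dec-false (x ≟ y)

⊆-refl : ∀ {n} {S : FinPred n} → S ⊆ S
⊆-refl x p = p

⊆-trans : ∀ {n} {f g h : FinPred n} → f ⊆ g → g ⊆ h → f ⊆ h
⊆-trans a b x p = b x (a x p)

∪-least : ∀ {n} {f g h : FinPred n} → f ⊆ h → g ⊆ h → f ∪ g ⊆ h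
∪-least {f = f} {g} a b x p with ∪-elim f g x p
... | inj₁ q = a x q
... | inj₂ q = b x q

p⊆p∪q : ∀ {n} {f : FinPred n} (g : FinPred n) → f ⊆ f ∪ g
p⊆p∪q {f = f} g x p = ∪-introˡ {f = f} g p

q⊆p∪q : ∀ {n} (f : FinPred n) {g : FinPred n} → g ⊆ f ∪ g
q⊆p∪q f {g} x p = ∪-introʳ f {g = g} p

⁅x⁆⊆p : ∀ {n} {c : Fin n} {f : FinPred n} → f c ≡ true → ⁅ c ⁆ ⊆ f
⁅x⁆⊆p {c = c} p x q with x∈⁅y⁆⇒x≡y {c = c} {x} q
... | refl = p

Disjoint-sym : ∀ {n} {f g : FinPred n} → Disjoint f g → Disjoint g f
Disjoint-sym d x p q = d x q p

Disjoint-∪ˡ : ∀ {n} {f g h : FinPred n} → Disjoint f h → Disjoint g h → Disjoint (f ∪ g) h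
Disjoint-∪ˡ {f = f} {g} a b x p q with ∪-elim f g x p
... | inj₁ r = a x r q
... | inj₂ r = b x r q

Disjoint-∪ʳ : ∀ {n} {f g h : FinPred n} → Disjoint h f → Disjoint h g → Disjoint h (f ∪ g)
Disjoint-∪ʳ {f = f} {g} {h} a b x p q with ∪-elim f g x q
... | inj₁ r = a x p r
... | inj₂ r = b x p r

Disjoint-mono : ∀ {n} {f f' g g' : FinPred n} → f ⊆ f' → g ⊆ g' → Disjoint f' g' → Disjoint f g
Disjoint-mono a b d x p q = d x (a x p) (b x q)

Disjoint-⁅⁆ : ∀ {n} {c : Fin n} {f : FinPred n} → f c ≡ false → Disjoint ⁅ c ⁆ f
Disjoint-⁅⁆ {c = c} h x p q with x∈⁅y⁆⇒x≡y {c = c} {x} p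
... | refl = true≢false q h

∉-Disjoint : ∀ {n} {A B : FinPred n} {x} → Disjoint A B → A x ≡ true → B x ≡ false
∉-Disjoint d p = ≢true⇒false (λ q → d _ p q)

IsSingleton : ∀ {n} → FinPred n → Fin n → Set
IsSingleton S c = (∀ w → S w ≡ true → w ≡ c) × (S c ≡ true)

⁅⁆-IsSingleton : ∀ {n} (c : Fin n) → IsSingleton ⁅ c ⁆ c
⁅⁆-IsSingleton c = (λ w p → x∈⁅y⁆⇒x≡y {c = c} {w} p) , x∈⁅x⁆ c

anyᶠ : ∀ {n} → FinPred n → Bool
anyᶠ {zero} f = false
anyᶠ {suc n} f = f zero ∨ anyᶠ (λ x → f (suc x))

anyᶠ-intro : ∀ {n} (f : FinPred n) x → f x ≡ true → anyᶠ f ≡ true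
anyᶠ-intro {suc n} f zero p = ∨-introˡ _ p
anyᶠ-intro {suc n} f (suc x) p = ∨-introʳ (f zero) (anyᶠ-intro (λ y → f (suc y)) x p)

anyᶠ-elim : ∀ {n} (f : FinPred n) → anyᶠ f ≡ true → ∃ λ x → f x ≡ true
anyᶠ-elim {suc n} f p with ∨-elim (f zero) p
... | inj₁ q = zero , q
... | inj₂ q with anyᶠ-elim (λ y → f (suc y)) q
... | x , r = suc x , r

anyᶠ-false : ∀ {n} (f : FinPred n) → anyᶠ f ≡ false → ∀ x → f x ≡ false
anyᶠ-false f p x = ≢true⇒false (λ q → true≢false (anyᶠ-intro f x q) p)

anyᶠ-none : ∀ {k} (f : FinPred k) → (∀ z → f z ≡ false) → anyᶠ f ≡ false
anyᶠ-none {zero} f h = refl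
anyᶠ-none {suc k} f h rewrite h zero = anyᶠ-none (λ z → f (suc z)) (λ z → h (suc z))

⋃ : ∀ {n k} → (Fin k → FinPred n) → FinPred n
⋃ X x = anyᶠ (λ y → X y x)

⋃-intro : ∀ {n k} (X : Fin k → FinPred n) y x → X y x ≡ true → ⋃ X x ≡ true
⋃-intro X y x p = anyᶠ-intro (λ y → X y x) y p

⋃-elim : ∀ {n k} (X : Fin k → FinPred n) x → ⋃ X x ≡ true → ∃ λ y → X y x ≡ true
⋃-elim X x p = anyᶠ-elim (λ y → X y x) p

⊆-⋃ : ∀ {n k} (X : Fin k → FinPred n) y → X y ⊆ ⋃ X
⊆-⋃ X y x p = ⋃-intro X y x p

Within : ∀ {n k} → (Fin k → FinPred n) → (Fin k → FinPred n) → Set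
Within X′ X = ⋃ X′ ⊆ ⋃ X

StrictlyWithin : ∀ {n k} → (Fin k → FinPred n) → (Fin k → FinPred n) → Set
StrictlyWithin X′ X = Within X′ X × (∃ λ x → (⋃ X x ≡ true) × (⋃ X′ x ≡ false))

StrictlyWithin-Within : ∀ {n k} {X″ X′ X : Fin k → FinPred n} → StrictlyWithin X″ X′ → Within X′ X →
  StrictlyWithin X″ X
StrictlyWithin-Within (X″⊆X′ , x , x∈X′ , x∉X″) X′⊆X = ⊆-trans X″⊆X′ X′⊆X , x , X′⊆X x x∈X′ , x∉X″

replace : ∀ {n k} → (Fin k → FinPred n) → Fin k → FinPred n → Fin k → FinPred n
replace X y Y z = if does (z ≟ y) then Y else X z

replace-cases : ∀ {n k} (X : Fin k → FinPred n) y Y z →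
  ((z ≡ y) × (replace X y Y z ≡ Y)) ⊎ ((z ≢ y) × (replace X y Y z ≡ X z))
replace-cases X y Y z with z ≟ y
... | yes z≡y = inj₁ (z≡y , refl)
... | no z≢y = inj₂ (z≢y , refl)

replace-⊆ : ∀ {n k} (X : Fin k → FinPred n) y Y → Y ⊆ X y → ∀ z → replace X y Y z ⊆ X z
replace-⊆ X y Y s z with replace-cases X y Y z
... | inj₁ (refl , e) = subst (λ S → S ⊆ X z) (sym e) s
... | inj₂ (_ , e) = subst (λ S → S ⊆ X z) (sym e) ⊆-refl

toSubset : ∀ {n} → FinPred n → Subset n
toSubset = tabulate

∈-toSubset⁺ : ∀ {n} {f : FinPred n} {x} → f x ≡ true → x ∈ toSubset f
∈-toSubset⁺ {f = f} {x} p = lookup⇒[]= x (tabulate f) (trans (lookup∘tabulate f x) p)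

∈-toSubset⁻ : ∀ {n} {f : FinPred n} {x} → x ∈ toSubset f → f x ≡ true
∈-toSubset⁻ {f = f} {x} p = trans (sym (lookup∘tabulate f x)) ([]=⇒lookup p)

∣toSubset∣-strict-mono : ∀ {n} {f g : FinPred n} → f ⊆ g → ∀ x → g x ≡ true → f x ≡ false →
  ∣ toSubset f ∣ < ∣ toSubset g ∣
∣toSubset∣-strict-mono {f = f} {g} s x gx fx = Subsetₚ.p⊂q⇒∣p∣<∣q∣ {p = toSubset f} {toSubset g}
  ((λ p → ∈-toSubset⁺ (s _ (∈-toSubset⁻ p))) , x , ∈-toSubset⁺ gx , λ p → true≢false (∈-toSubset⁻ p) fx)

IsSingleton-toSubset : ∀ {n} {S : FinPred n} {c} → IsSingleton S c →
  ∀ w → (w ∈ toSubset S → w ≡ c) × (w ≡ c → w ∈ toSubset S)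
IsSingleton-toSubset (only , c∈S) w = (λ p → only w (∈-toSubset⁻ p)) , λ { refl → ∈-toSubset⁺ c∈S }

∣p∪q∣≤∣p∣+∣q∣ : ∀ {n} (p q : Subset n) → ∣ p Subset.∪ q ∣ ≤ ∣ p ∣ + ∣ q ∣
∣p∪q∣≤∣p∣+∣q∣ Vec.[] Vec.[] = z≤n
∣p∪q∣≤∣p∣+∣q∣ (true Vec.∷ p) (t Vec.∷ q) = s≤s
    (≤-trans (∣p∪q∣≤∣p∣+∣q∣ p q) (+-monoʳ-≤ ∣ p ∣ (Subsetₚ.∣p∣≤∣x∷p∣ t q)))
∣p∪q∣≤∣p∣+∣q∣ (false Vec.∷ p) (true Vec.∷ q) = ≤-trans (s≤s (∣p∪q∣≤∣p∣+∣q∣ p q))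
    (≤-reflexive (sym (+-suc ∣ p ∣ ∣ q ∣)))
∣p∪q∣≤∣p∣+∣q∣ (false Vec.∷ p) (false Vec.∷ q) = ∣p∪q∣≤∣p∣+∣q∣ p q

degIn-≤2 : ∀ {n} (G : Graph n) v (S : FinPred n) a b →
  (∀ w → S w ≡ true → G v w ≡ true → (w ≡ a) ⊎ (w ≡ b)) → degIn G v (toSubset S) ≤ 2
degIn-≤2 G v S a b two = ≤-trans (Subsetₚ.p⊆q⇒∣p∣≤∣q∣ ⊆⁅a,b⁆)
  (≤-trans (∣p∪q∣≤∣p∣+∣q∣ Subset.⁅ a ⁆ Subset.⁅ b ⁆)
    (≤-reflexive (cong₂ _+_ (Subsetₚ.∣⁅x⁆∣≡1 a) (Subsetₚ.∣⁅x⁆∣≡1 b))))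
  where
  ⊆⁅a,b⁆ : toSubset S ∩ N G v Subset.⊆ Subset.⁅ a ⁆ Subset.∪ Subset.⁅ b ⁆
  ⊆⁅a,b⁆ {w} w∈ with Subsetₚ.x∈p∩q⁻ (toSubset S) (N G v) w∈
  ... | w∈S , w∈N with two w (∈-toSubset⁻ w∈S) (∈-toSubset⁻ {f = G v} w∈N)
  ... | inj₁ refl = Subsetₚ.x∈p∪q⁺ (inj₁ (Subsetₚ.x∈⁅x⁆ w))
  ... | inj₂ refl = Subsetₚ.x∈p∪q⁺ (inj₂ (Subsetₚ.x∈⁅x⁆ w))

module _ {n : ℕ} where
  elem : Fin n → List (Fin n) → Bool
  elem x [] = false
  elem x (y ∷ L) = ⁅ y ⁆ x ∨ elem x L

  elems : List (Fin n) → FinPred n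
  elems L x = elem x L

  elem-head : ∀ x L → elem x (x ∷ L) ≡ true
  elem-head x L = ∨-introˡ (elem x L) (x∈⁅x⁆ x)

  elem-tail : ∀ x y L → elem x L ≡ true → elem x (y ∷ L) ≡ true
  elem-tail x y L p = ∨-introʳ (⁅ y ⁆ x) p

  elem-∷-elim : ∀ x y L → elem x (y ∷ L) ≡ true → (x ≡ y) ⊎ (elem x L ≡ true)
  elem-∷-elim x y L p with ∨-elim (⁅ y ⁆ x) p
  ... | inj₁ q = inj₁ (x∈⁅y⁆⇒x≡y q)
  ... | inj₂ q = inj₂ q

  elem-++ˡ : ∀ x A B → elem x A ≡ true → elem x (A ++ B) ≡ true
  elem-++ˡ x (y ∷ A) B p with elem-∷-elim x y A p
  ... | inj₁ refl = elem-head x (A ++ B)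
  ... | inj₂ q = elem-tail x y (A ++ B) (elem-++ˡ x A B q)

  elem-++ʳ : ∀ x A B → elem x B ≡ true → elem x (A ++ B) ≡ true
  elem-++ʳ x [] B p = p
  elem-++ʳ x (y ∷ A) B p = elem-tail x y (A ++ B) (elem-++ʳ x A B p)

  elem-++-elim : ∀ x A B → elem x (A ++ B) ≡ true → (elem x A ≡ true) ⊎ (elem x B ≡ true)
  elem-++-elim x [] B p = inj₂ p
  elem-++-elim x (y ∷ A) B p with elem-∷-elim x y (A ++ B) p
  ... | inj₁ refl = inj₁ (elem-head x A)
  ... | inj₂ q with elem-++-elim x A B q
  ... | inj₁ r = inj₁ (elem-tail x y A r)
  ... | inj₂ r = inj₂ r

  ⊆-++ˡ : ∀ A B → elems A ⊆ elems (A ++ B)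
  ⊆-++ˡ A B x p = elem-++ˡ x A B p

  ⊆-++ʳ : ∀ A B → elems B ⊆ elems (A ++ B)
  ⊆-++ʳ A B x p = elem-++ʳ x A B p

  ++-⊆ : ∀ {S : FinPred n} A B → elems A ⊆ S → elems B ⊆ S → elems (A ++ B) ⊆ S
  ++-⊆ A B a b x p with elem-++-elim x A B p
  ... | inj₁ q = a x q
  ... | inj₂ q = b x q

  ∷-⊆ : ∀ {S : FinPred n} x L → S x ≡ true → elems L ⊆ S → elems (x ∷ L) ⊆ S
  ∷-⊆ x L p s y q with elem-∷-elim y x L q
  ... | inj₁ refl = p
  ... | inj₂ r = s y r

  ⊆-tail : ∀ x L → elems L ⊆ elems (x ∷ L)
  ⊆-tail x L y q = elem-tail y x L q

  anyᴸ : FinPred n → List (Fin n) → Bool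
  anyᴸ p [] = false
  anyᴸ p (x ∷ L) = p x ∨ anyᴸ p L

  None : FinPred n → List (Fin n) → Set
  None p L = ∀ x → elem x L ≡ true → p x ≡ false

  anyᴸ-intro : ∀ p x L → elem x L ≡ true → p x ≡ true → anyᴸ p L ≡ true
  anyᴸ-intro p x (y ∷ L) m q with elem-∷-elim x y L m
  ... | inj₁ refl = ∨-introˡ (anyᴸ p L) q
  ... | inj₂ r = ∨-introʳ (p y) (anyᴸ-intro p x L r q)

  anyᴸ-elim : ∀ p L → anyᴸ p L ≡ true → ∃ λ x → (elem x L ≡ true) × (p x ≡ true)
  anyᴸ-elim p (y ∷ L) q with ∨-elim (p y) q
  ... | inj₁ r = y , elem-head y L , r
  ... | inj₂ r with anyᴸ-elim p L r
  ... | x , m , s = x , elem-tail x y L m , s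

  anyᴸ-false : ∀ p L → anyᴸ p L ≡ false → None p L
  anyᴸ-false p L q x m = ≢true⇒false (λ r → true≢false (anyᴸ-intro p x L m r) q)

  None-++ : ∀ p A B → None p A → None p B → None p (A ++ B)
  None-++ p A B a b x m with elem-++-elim x A B m
  ... | inj₁ q = a x q
  ... | inj₂ q = b x q

  None-⊆ : ∀ p A B → elems A ⊆ elems B → None p B → None p A
  None-⊆ p A B s h x m = h x (s x m)

  None-∷ : ∀ p x L → p x ≡ false → None p L → None p (x ∷ L)
  None-∷ p x L a b y m with elem-∷-elim y x L m
  ... | inj₁ refl = a
  ... | inj₂ q = b y q

  None-[] : ∀ p → None p []
  None-[] p x ()

  first-split : ∀ p L → anyᴸ p L ≡ true →
    Σ (List (Fin n)) λ A → Σ (Fin n) λ x → Σ (List (Fin n)) λ B → (L ≡ A ++ x ∷ B) × None p A × (p x ≡ true)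
  first-split p (y ∷ L) q with true⊎false (p y)
  ... | inj₁ r = [] , y , L , refl , None-[] p , r
  ... | inj₂ r with first-split p L (subst (λ b → b ∨ anyᴸ p L ≡ true) r q)
  ... | A , x , B , refl , h , s = y ∷ A , x , B , refl , None-∷ p y A r h , s

  last-split : ∀ p L → anyᴸ p L ≡ true →
    Σ (List (Fin n)) λ A → Σ (Fin n) λ x → Σ (List (Fin n)) λ B → (L ≡ A ++ x ∷ B) × (p x ≡ true) × None p B
  last-split p (y ∷ L) q with true⊎false (anyᴸ p L)
  ... | inj₁ r with last-split p L r
  ... | A , x , B , refl , s , h = y ∷ A , x , B , refl , s , h
  last-split p (y ∷ L) q | inj₂ r = [] , y , L , refl , lem , anyᴸ-false p L r
    where
    lem : p y ≡ true
    lem with ∨-elim (p y) q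
    ... | inj₁ s = s
    ... | inj₂ s = ⊥-elim (true≢false s r)

  Distinct : List (Fin n) → Set
  Distinct [] = ⊤
  Distinct (x ∷ L) = (elem x L ≡ false) × Distinct L

  Distinct-++⁻ : ∀ A B → Distinct (A ++ B) → Distinct A × Distinct B × Disjoint (elems A) (elems B)
  Distinct-++⁻ [] B h = tt , h , (λ x ())
  Distinct-++⁻ (y ∷ A) B (h1 , h2) with Distinct-++⁻ A B h2
  ... | a , b , d = (≢true⇒false (λ q → true≢false (elem-++ˡ y A B q) h1) , a) , b , dd
    where
    dd : Disjoint (elems (y ∷ A)) (elems B)
    dd x p q with elem-∷-elim x y A p
    ... | inj₁ refl = true≢false (elem-++ʳ x A B q) h1
    ... | inj₂ r = d x r q

  Distinct-++⁺ : ∀ A B → Distinct A → Distinct B → Disjoint (elems A) (elems B) → Distinct (A ++ B)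
  Distinct-++⁺ [] B a b d = b
  Distinct-++⁺ (y ∷ A) B (a1 , a2) b d = ≢true⇒false lem , Distinct-++⁺ A B a2 b
      (λ x p q → d x (elem-tail x y A p) q)
    where
    lem : elem y (A ++ B) ≡ true → ⊥
    lem q with elem-++-elim y A B q
    ... | inj₁ r = true≢false r a1
    ... | inj₂ r = d y (elem-head y A) r

  record DistinctSplit (A : List (Fin n)) (x : Fin n) (B : List (Fin n)) : Set where
    constructor distinctSplit
    field
      x∉prefix : elem x A ≡ false
      x∉suffix : elem x B ≡ false
      prefix#suffix : Disjoint (elems A) (elems B)
      prefix-distinct : Distinct A
      suffix-distinct : Distinct B

  open DistinctSplit public

  Distinct-split : ∀ A x B → Distinct (A ++ x ∷ B) → DistinctSplit A x B
  Distinct-split A x B h with Distinct-++⁻ A (x ∷ B) h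
  ... | a , (b1 , b2) , d =
    distinctSplit (≢true⇒false (λ q → d x q (elem-head x B))) b1 (λ y p q → d y p (elem-tail y x B q)) a b2

  HeadIn : FinPred n → List (Fin n) → Set
  HeadIn p [] = ⊥
  HeadIn p (x ∷ L) = p x ≡ true

  LastIn : FinPred n → List (Fin n) → Set
  LastIn p [] = ⊥
  LastIn p (x ∷ []) = p x ≡ true
  LastIn p (x ∷ y ∷ L) = LastIn p (y ∷ L)

  HeadIn-elem : ∀ p L → HeadIn p L → ∃ λ x → (elem x L ≡ true) × (p x ≡ true)
  HeadIn-elem p (x ∷ L) h = x , elem-head x L , h

  LastIn-elem : ∀ p L → LastIn p L → ∃ λ x → (elem x L ≡ true) × (p x ≡ true)
  LastIn-elem p (x ∷ []) h = x , elem-head x [] , h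
  LastIn-elem p (x ∷ y ∷ L) h with LastIn-elem p (y ∷ L) h
  ... | z , m , q = z , elem-tail z x (y ∷ L) m , q

  HeadIn-retail : ∀ p A x B C → HeadIn p (A ++ x ∷ B) → HeadIn p (A ++ x ∷ C)
  HeadIn-retail p [] x B C h = h
  HeadIn-retail p (y ∷ A) x B C h = h

  HeadIn-++ : ∀ p A B → HeadIn p A → HeadIn p (A ++ B)
  HeadIn-++ p (x ∷ A) B h = h

  LastIn-++⁻ : ∀ p A B → LastIn p (A ++ B) → B ≢ [] → LastIn p B
  LastIn-++⁻ p [] B h ne = h
  LastIn-++⁻ p (x ∷ []) [] h ne = ⊥-elim (ne refl)
  LastIn-++⁻ p (x ∷ []) (y ∷ B) h ne = h
  LastIn-++⁻ p (x ∷ z ∷ A) B h ne = LastIn-++⁻ p (z ∷ A) B h ne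

  LastIn-++⁺ : ∀ p A B → LastIn p B → LastIn p (A ++ B)
  LastIn-++⁺ p [] B h = h
  LastIn-++⁺ p (x ∷ []) (y ∷ B) h = h
  LastIn-++⁺ p (x ∷ z ∷ A) B h = LastIn-++⁺ p (z ∷ A) B h

  LastIn-∷⁻ : ∀ p x L → LastIn p (x ∷ L) → ((L ≡ []) × (p x ≡ true)) ⊎ LastIn p L
  LastIn-∷⁻ p x [] h = inj₁ (refl , h)
  LastIn-∷⁻ p x (y ∷ L) h = inj₂ h

  LastIn-snoc : ∀ p A x → p x ≡ true → LastIn p (A ++ x ∷ [])
  LastIn-snoc p A x h = LastIn-++⁺ p A (x ∷ []) h

  length-snoc-prefix< : ∀ A (x : Fin n) B → B ≢ [] → length (A ++ x ∷ []) < length (A ++ x ∷ B)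
  length-snoc-prefix< [] x [] ne = ⊥-elim (ne refl)
  length-snoc-prefix< [] x (y ∷ B) ne = s≤s (s≤s z≤n)
  length-snoc-prefix< (z ∷ A) x B ne = s≤s (length-snoc-prefix< A x B ne)

  length-suffix< : ∀ A (x : Fin n) B → A ≢ [] → length (x ∷ B) < length (A ++ x ∷ B)
  length-suffix< [] x B ne = ⊥-elim (ne refl)
  length-suffix< (z ∷ A) x B ne = s≤s (lem A)
    where
    lem : ∀ A → length (x ∷ B) ≤ length (A ++ x ∷ B)
    lem [] = ≤-refl
    lem (w ∷ A) = ≤-trans (lem A) (n≤1+n _)

  elem-reverse⁻ : ∀ x L → elem x (reverse L) ≡ true → elem x L ≡ true
  elem-reverse⁻ x [] p = p
  elem-reverse⁻ x (y ∷ L) p rewrite unfold-reverse y L with elem-++-elim x (reverse L) (y ∷ []) p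
  ... | inj₁ q = elem-tail x y L (elem-reverse⁻ x L q)
  ... | inj₂ q with elem-∷-elim x y [] q
  ... | inj₁ refl = elem-head x L
  ... | inj₂ ()

  elem-reverse⁺ : ∀ x L → elem x L ≡ true → elem x (reverse L) ≡ true
  elem-reverse⁺ x (y ∷ L) p rewrite unfold-reverse y L with elem-∷-elim x y L p
  ... | inj₁ refl = elem-++ʳ x (reverse L) (x ∷ []) (elem-head x [])
  ... | inj₂ q = elem-++ˡ x (reverse L) (y ∷ []) (elem-reverse⁺ x L q)

  Distinct-reverse : ∀ L → Distinct L → Distinct (reverse L)
  Distinct-reverse [] h = tt
  Distinct-reverse (y ∷ L) (h1 , h2) rewrite unfold-reverse y L =
    Distinct-++⁺ (reverse L) (y ∷ []) (Distinct-reverse L h2) (refl , tt)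
      (λ x p q → lem x p q)
    where
    lem : ∀ x → elem x (reverse L) ≡ true → elem x (y ∷ []) ≡ true → ⊥
    lem x p q with elem-∷-elim x y [] q
    ... | inj₁ refl = true≢false (elem-reverse⁻ x L p) h1
    ... | inj₂ ()

  HeadIn-reverse : ∀ p L → LastIn p L → HeadIn p (reverse L)
  HeadIn-reverse p (x ∷ []) h = h
  HeadIn-reverse p (x ∷ y ∷ L) h = subst (HeadIn p) (sym (unfold-reverse x (y ∷ L)))
      (HeadIn-++ p (reverse (y ∷ L)) (x ∷ []) (HeadIn-reverse p (y ∷ L) h))

  LastIn-reverse : ∀ p L → HeadIn p L → LastIn p (reverse L)
  LastIn-reverse p (x ∷ L) h rewrite unfold-reverse x L = LastIn-snoc p (reverse L) x h

  elem-middle : ∀ A (c : Fin n) B → elem c (A ++ c ∷ B) ≡ true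
  elem-middle A c B = elem-++ʳ c A (c ∷ B) (elem-head c B)

  prefix-⊆ : ∀ A (c : Fin n) B → elems A ⊆ elems (A ++ c ∷ B)
  prefix-⊆ A c B = ⊆-++ˡ A (c ∷ B)

  suffix-⊆ : ∀ A (c : Fin n) B → elems B ⊆ elems (A ++ c ∷ B)
  suffix-⊆ A c B x p = elem-++ʳ x A (c ∷ B) (elem-tail x c B p)

  snoc-prefix-⊆ : ∀ A (w : Fin n) B → elems (A ++ w ∷ []) ⊆ elems (A ++ w ∷ B)
  snoc-prefix-⊆ A w B x m with elem-++-elim x A (w ∷ []) m
  ... | inj₁ q = elem-++ˡ x A (w ∷ B) q
  ... | inj₂ q with elem-∷-elim x w [] q
  ... | inj₁ refl = elem-middle A x B
  ... | inj₂ ()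

  None⇒∉ : ∀ (p : FinPred n) c B → p c ≡ true → None p B → elem c B ≡ false
  None⇒∉ p c B q h = ≢true⇒false (λ m → true≢false q (h c m))

  ∉-⊆ : ∀ {S : FinPred n} L x → elems L ⊆ S → S x ≡ false → elem x L ≡ false
  ∉-⊆ L x s h = ≢true⇒false (λ m → true≢false (s x m) h)

  anyᴸ-HeadIn : ∀ (p : FinPred n) L → HeadIn p L → anyᴸ p L ≡ true
  anyᴸ-HeadIn p L h with HeadIn-elem p L h
  ... | x , m , q = anyᴸ-intro p x L m q

  anyᴸ-LastIn : ∀ (p : FinPred n) L → LastIn p L → anyᴸ p L ≡ true
  anyᴸ-LastIn p L h with LastIn-elem p L h
  ... | x , m , q = anyᴸ-intro p x L m q

  anyᴸ-++ : ∀ (p : FinPred n) A B → anyᴸ p (A ++ B) ≡ anyᴸ p A ∨ anyᴸ p B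
  anyᴸ-++ p [] B = refl
  anyᴸ-++ p (x ∷ A) B = trans (cong (p x ∨_) (anyᴸ-++ p A B)) (sym (∨-assoc (p x) (anyᴸ p A) (anyᴸ p B)))

  anyᴸ-reverse : ∀ (p : FinPred n) L → anyᴸ p (reverse L) ≡ anyᴸ p L
  anyᴸ-reverse p [] = refl
  anyᴸ-reverse p (x ∷ L) rewrite unfold-reverse x L | anyᴸ-++ p (reverse L) (x ∷ []) | anyᴸ-reverse p L |
      ∨-identityʳ (p x) = ∨-comm (anyᴸ p L) (p x)

  init : List (Fin n) → List (Fin n)
  init [] = []
  init (x ∷ []) = []
  init (x ∷ y ∷ L) = x ∷ init (y ∷ L)

  init-snoc : ∀ A (w : Fin n) → init (A ++ w ∷ []) ≡ A
  init-snoc [] w = refl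
  init-snoc (x ∷ []) w = refl
  init-snoc (x ∷ y ∷ A) w = cong (x ∷_) (init-snoc (y ∷ A) w)

  init-app : ∀ A (y z : Fin n) B → init (A ++ y ∷ z ∷ B) ≡ A ++ y ∷ init (z ∷ B)
  init-app [] y z B = refl
  init-app (a ∷ []) y z B = refl
  init-app (a ∷ a' ∷ A) y z B = cong (a ∷_) (init-app (a' ∷ A) y z B)

  init-prefix-⊆ : ∀ E (x : Fin n) F → F ≢ [] → elems (E ++ x ∷ []) ⊆ elems (init (E ++ x ∷ F))
  init-prefix-⊆ E x [] ne = ⊥-elim (ne refl)
  init-prefix-⊆ E x (f ∷ F) _ y m rewrite init-app E x f F with elem-++-elim y E (x ∷ []) m
  ... | inj₁ q = elem-++ˡ y E (x ∷ init (f ∷ F)) q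
  ... | inj₂ q with elem-∷-elim y x [] q
  ... | inj₁ refl = elem-middle E x (init (f ∷ F))
  ... | inj₂ ()

  pre-init : ∀ Pre (y : Fin n) Post → elems Pre ⊆ elems (init (Pre ++ y ∷ Post))
  pre-init Pre y [] rewrite init-snoc Pre y = ⊆-refl
  pre-init Pre y (q ∷ Post) rewrite init-app Pre y q Post = ⊆-++ˡ Pre (y ∷ init (q ∷ Post))

  Distinct-snoc-prefix : ∀ E (w : Fin n) F → Distinct (E ++ w ∷ F) → Distinct (E ++ w ∷ [])
  Distinct-snoc-prefix E w F h with Distinct-split E w F h
  ... | distinctSplit a _ _ d _ = Distinct-++⁺ E (w ∷ []) d (refl , tt) (λ x p q → lem x p q)
    where
    lem : ∀ x → elem x E ≡ true → elem x (w ∷ []) ≡ true → ⊥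
    lem x p q with elem-∷-elim x w [] q
    ... | inj₁ refl = true≢false p a
    ... | inj₂ ()

  uncons : ∀ (Q : List (Fin n)) → Q ≢ [] → Σ (Fin n) λ hq → Σ (List (Fin n)) λ Q' → Q ≡ hq ∷ Q'
  uncons [] ne = ⊥-elim (ne refl)
  uncons (x ∷ Q) ne = x , Q , refl

  ∷ʳ≢[] : ∀ E (w : Fin n) → E ++ w ∷ [] ≢ []
  ∷ʳ≢[] [] w ()
  ∷ʳ≢[] (x ∷ E) w ()

  head-elem-snoc-prefix : ∀ (x : Fin n) M' A c B → x ∷ M' ≡ A ++ c ∷ B → elem x (A ++ c ∷ []) ≡ true
  head-elem-snoc-prefix x M' [] c B e with ∷-injective e
  ... | refl , _ = elem-head x []
  head-elem-snoc-prefix x M' (a ∷ A) c B e with ∷-injective e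
  ... | refl , _ = elem-head x (A ++ c ∷ [])

  length-tail< : ∀ E (w : Fin n) F → suc (length F) ≤ length (E ++ w ∷ F)
  length-tail< [] w F = ≤-refl
  length-tail< (x ∷ E) w F = ≤-trans (length-tail< E w F) (n≤1+n _)

  length-shortcut< : ∀ Pre (x y : Fin n) m1 z m2 →
    suc (length (Pre ++ x ∷ z ∷ m2)) ≤ length (Pre ++ x ∷ y ∷ (m1 ++ z ∷ m2))
  length-shortcut< [] x y m1 z m2 = s≤s (s≤s (length-tail< m1 z m2))
  length-shortcut< (p ∷ Pre) x y m1 z m2 = s≤s (length-shortcut< Pre x y m1 z m2)

-- Paths and loop erasure
module Paths {n : ℕ} (G : Fin n → Fin n → Bool) where
  PathFrom : Fin n → List (Fin n) → Set
  PathFrom x [] = ⊤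
  PathFrom x (y ∷ L) = (G x y ≡ true) × PathFrom y L

  IsPath : List (Fin n) → Set
  IsPath [] = ⊤
  IsPath (x ∷ L) = PathFrom x L

  LastAdj : List (Fin n) → Fin n → Set
  LastAdj [] c = ⊤
  LastAdj (z ∷ []) c = G z c ≡ true
  LastAdj (z ∷ y ∷ A) c = LastAdj (y ∷ A) c

  record PathSplit (A : List (Fin n)) (c : Fin n) (B : List (Fin n)) : Set where
    constructor pathSplit
    field
      prefix-path : IsPath A
      last-adj : LastAdj A c
      suffix-path : PathFrom c B

  open PathSplit public

  IsPath-split : ∀ A c B → IsPath (A ++ c ∷ B) → PathSplit A c B
  IsPath-split [] c B h = pathSplit tt tt h
  IsPath-split (z ∷ []) c B (h1 , h2) = pathSplit tt h1 h2
  IsPath-split (z ∷ y ∷ A) c B (h1 , h2) with IsPath-split (y ∷ A) c B h2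
  ... | pathSplit a b d = pathSplit (h1 , a) b d

  IsPath-join : ∀ A c B → IsPath A → LastAdj A c → PathFrom c B → IsPath (A ++ c ∷ B)
  IsPath-join [] c B a b d = d
  IsPath-join (z ∷ []) c B a b d = b , d
  IsPath-join (z ∷ y ∷ A) c B (a1 , a2) b d = a1 , IsPath-join (y ∷ A) c B a2 b d

  LastAdj-elem : ∀ A c → LastAdj A c → (A ≡ []) ⊎ (∃ λ z → (elem z A ≡ true) × (G z c ≡ true))
  LastAdj-elem [] c h = inj₁ refl
  LastAdj-elem (z ∷ []) c h = inj₂ (z , elem-head z [] , h)
  LastAdj-elem (z ∷ y ∷ A) c h with LastAdj-elem (y ∷ A) c h
  ... | inj₁ ()
  ... | inj₂ (w , m , q) = inj₂ (w , elem-tail w z (y ∷ A) m , q)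

  PathFrom-head : ∀ c B → PathFrom c B → (B ≡ []) ⊎ (∃ λ z → (elem z B ≡ true) × (G c z ≡ true))
  PathFrom-head c [] h = inj₁ refl
  PathFrom-head c (y ∷ B) (h1 , h2) = inj₂ (y , elem-head y B , h1)

  LastAdj-snoc : ∀ A z c → G z c ≡ true → LastAdj (A ++ z ∷ []) c
  LastAdj-snoc [] z c h = h
  LastAdj-snoc (w ∷ []) z c h = h
  LastAdj-snoc (w ∷ y ∷ A) z c h = LastAdj-snoc (y ∷ A) z c h

  IsPath-snoc : ∀ A c → IsPath A → LastAdj A c → IsPath (A ++ c ∷ [])
  IsPath-snoc A c a b = IsPath-join A c [] a b tt

  IsPath-reverse : (∀ a b → G a b ≡ G b a) → ∀ L → IsPath L → IsPath (reverse L)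
  IsPath-reverse s [] h = tt
  IsPath-reverse s (x ∷ L) h rewrite unfold-reverse x L =
    IsPath-snoc (reverse L) x (IsPath-reverse s L (chtail x L h)) (lem L h)
    where
    chtail : ∀ x L → PathFrom x L → IsPath L
    chtail x [] h = tt
    chtail x (y ∷ L) (h1 , h2) = h2
    lem : ∀ L → PathFrom x L → LastAdj (reverse L) x
    lem [] h = tt
    lem (y ∷ L) (h1 , h2) rewrite unfold-reverse y L = LastAdj-snoc (reverse L) y x (trans (s y x) h1)

  IsPath-snoc-prefix : ∀ E (w : Fin n) F → IsPath (E ++ w ∷ F) → IsPath (E ++ w ∷ [])
  IsPath-snoc-prefix E w F ch with IsPath-split E w F ch
  ... | pathSplit a b _ = IsPath-snoc E w a b

  PathFrom⇒IsPath : ∀ (c : Fin n) B → PathFrom c B → IsPath B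
  PathFrom⇒IsPath c [] h = tt
  PathFrom⇒IsPath c (x ∷ B) (_ , h) = h

  dropThrough : Fin n → List (Fin n) → List (Fin n)
  dropThrough x [] = []
  dropThrough x (y ∷ M) with ⁅ y ⁆ x
  ... | true = M
  ... | false = dropThrough x M

  dropThrough-spec : ∀ x M → elem x M ≡ true → Σ (List (Fin n)) λ A → (M ≡ A ++ x ∷ dropThrough x M)
  dropThrough-spec x (y ∷ M) p with ⁅ y ⁆ x in e
  ... | true = [] , cong (_∷ M) (sym (x∈⁅y⁆⇒x≡y {c = y} {x} e))
  ... | false with dropThrough-spec x M p
  ... | A , q = y ∷ A , cong (y ∷_) q

  eraseLoops : List (Fin n) → List (Fin n)
  eraseLoops [] = []
  eraseLoops (x ∷ L) with elem x (eraseLoops L)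
  ... | true = x ∷ dropThrough x (eraseLoops L)
  ... | false = x ∷ eraseLoops L

  eraseLoops-⊆ : ∀ L → elems (eraseLoops L) ⊆ elems L
  eraseLoops-⊆ [] x ()
  eraseLoops-⊆ (y ∷ L) x p with elem y (eraseLoops L) in e
  ... | true with elem-∷-elim x y (dropThrough y (eraseLoops L)) p
  ... | inj₁ refl = elem-head x L
  ... | inj₂ q with dropThrough-spec y (eraseLoops L) e
  ... | A , eq = elem-tail x y L
      (eraseLoops-⊆ L x (subst (λ Z → elem x Z ≡ true) (sym eq)
      (elem-++ʳ x A (y ∷ dropThrough y (eraseLoops L)) (elem-tail x y (dropThrough y (eraseLoops L)) q))))
  eraseLoops-⊆ (y ∷ L) x p | false with elem-∷-elim x y (eraseLoops L) p
  ... | inj₁ refl = elem-head x L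
  ... | inj₂ q = elem-tail x y L (eraseLoops-⊆ L x q)

  eraseLoops-distinct : ∀ L → Distinct (eraseLoops L)
  eraseLoops-distinct [] = tt
  eraseLoops-distinct (y ∷ L) with elem y (eraseLoops L) in e
  ... | true with dropThrough-spec y (eraseLoops L) e
  ... | A , eq with Distinct-split A y (dropThrough y (eraseLoops L))
      (subst Distinct eq (eraseLoops-distinct L))
  ... | distinctSplit _ b _ _ d = b , d
  eraseLoops-distinct (y ∷ L) | false = e , eraseLoops-distinct L

  eraseLoops-head : ∀ p L → HeadIn p L → HeadIn p (eraseLoops L)
  eraseLoops-head p (y ∷ L) h with elem y (eraseLoops L)
  ... | true = h
  ... | false = h

  eraseLoops-last : ∀ p L → LastIn p L → LastIn p (eraseLoops L)
  eraseLoops-last p (y ∷ []) h = h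
  eraseLoops-last p (y ∷ z ∷ L) h = aux (eraseLoops-last p (z ∷ L) h)
    where
    lem : ∀ M → LastIn p M → LastIn p (y ∷ M)
    lem (w ∷ M) q = q
    aux : LastIn p (eraseLoops (z ∷ L)) → LastIn p (eraseLoops (y ∷ z ∷ L))
    aux q with elem y (eraseLoops (z ∷ L)) in e
    ... | true with dropThrough-spec y (eraseLoops (z ∷ L)) e
    ... | A , eq = LastIn-++⁻ p A (y ∷ dropThrough y (eraseLoops (z ∷ L))) (subst (LastIn p) eq q) (λ ())
    aux q | false = lem (eraseLoops (z ∷ L)) q

  eraseLoops-path : ∀ L → IsPath L → IsPath (eraseLoops L)
  eraseLoops-path [] h = tt
  eraseLoops-path (y ∷ L) h with elem y (eraseLoops L) in e
  ... | true with dropThrough-spec y (eraseLoops L) e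
  ... | A , eq = suffix-path
      (IsPath-split A y (dropThrough y (eraseLoops L)) (subst IsPath eq (eraseLoops-path L (tl y L h))))
    where
    tl : ∀ y L → PathFrom y L → IsPath L
    tl y [] h = tt
    tl y (z ∷ L) (_ , h) = h
  eraseLoops-path (y ∷ L) h | false = lem L h
    where
    lem : ∀ L → PathFrom y L → PathFrom y (eraseLoops L)
    lem [] h = tt
    lem (z ∷ L) (h1 , h2) with eraseLoops-head (G y) (z ∷ L) h1 | eraseLoops-path (z ∷ L) h2
    ... | a | b = hd (eraseLoops (z ∷ L)) a b
      where
      hd : ∀ M → HeadIn (G y) M → IsPath M → PathFrom y M
      hd (w ∷ M) a b = a , b

module GraphNotions {n : ℕ} (G : Graph n) (G-sym : ∀ a b → G a b ≡ G b a) where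
  open Paths G public

  data ReachIn (S : FinPred n) : Fin n → Fin n → Set where
    here : ∀ {a} → ReachIn S a a
    step : ∀ {a b c} → G a b ≡ true → S b ≡ true → ReachIn S b c → ReachIn S a c

  IsConnected : FinPred n → Set
  IsConnected S = ∀ a b → S a ≡ true → S b ≡ true → ReachIn S a b

  Touches : FinPred n → FinPred n → Set
  Touches A B = ∃ λ a → ∃ λ b → (A a ≡ true) × (B b ≡ true) × (G a b ≡ true)

  NoEdge : FinPred n → FinPred n → Set
  NoEdge A B = ∀ a b → A a ≡ true → B b ≡ true → G a b ≡ true → ⊥

  ReachIn-mono : ∀ {S T : FinPred n} {a b} → S ⊆ T → ReachIn S a b → ReachIn T a b
  ReachIn-mono s here = here
  ReachIn-mono s (step e m r) = step e (s _ m) (ReachIn-mono s r)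

  ReachIn-trans : ∀ {S : FinPred n} {a b c} → ReachIn S a b → ReachIn S b c → ReachIn S a c
  ReachIn-trans here r = r
  ReachIn-trans (step e m r) r' = step e m (ReachIn-trans r r')

  connected-∪ : ∀ {A B : FinPred n} → IsConnected A → IsConnected B → Touches A B → IsConnected (A ∪ B)
  connected-∪ {A} {B} cA cB (a0 , b0 , ma , mb , e) a b p q with ∪-elim A B a p | ∪-elim A B b q
  ... | inj₁ pa | inj₁ qb = ReachIn-mono (p⊆p∪q {f = A} B) (cA a b pa qb)
  ... | inj₂ pa | inj₂ qb = ReachIn-mono (q⊆p∪q A {B}) (cB a b pa qb)
  ... | inj₁ pa | inj₂ qb = ReachIn-trans (ReachIn-mono (p⊆p∪q {f = A} B) (cA a a0 pa ma))
      (step e (∪-introʳ A {B} mb) (ReachIn-mono (q⊆p∪q A {B}) (cB b0 b mb qb)))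
  ... | inj₂ pa | inj₁ qb = ReachIn-trans (ReachIn-mono (q⊆p∪q A {B}) (cB a b0 pa mb))
      (step (trans (G-sym b0 a0) e) (∪-introˡ {f = A} B ma) (ReachIn-mono (p⊆p∪q {f = A} B) (cA a0 b ma qb)))

  connected-∪-overlap : ∀ {A B : FinPred n} → IsConnected A → IsConnected B →
    (∃ λ x → (A x ≡ true) × (B x ≡ true)) → IsConnected (A ∪ B)
  connected-∪-overlap {A} {B} cA cB (x , ma , mb) a b p q with ∪-elim A B a p | ∪-elim A B b q
  ... | inj₁ pa | inj₁ qb = ReachIn-mono (p⊆p∪q {f = A} B) (cA a b pa qb)
  ... | inj₂ pa | inj₂ qb = ReachIn-mono (q⊆p∪q A {B}) (cB a b pa qb)
  ... | inj₁ pa | inj₂ qb = ReachIn-trans (ReachIn-mono (p⊆p∪q {f = A} B) (cA a x pa ma))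
      (ReachIn-mono (q⊆p∪q A {B}) (cB x b mb qb))
  ... | inj₂ pa | inj₁ qb = ReachIn-trans (ReachIn-mono (q⊆p∪q A {B}) (cB a x pa mb))
      (ReachIn-mono (p⊆p∪q {f = A} B) (cA x b ma qb))

  connected-⁅⁆ : ∀ c → IsConnected ⁅ c ⁆
  connected-⁅⁆ c a b p q with x∈⁅y⁆⇒x≡y {c = c} {a} p | x∈⁅y⁆⇒x≡y {c = c} {b} q
  ... | refl | refl = here

  connected-⊇ : ∀ {A B : FinPred n} → IsConnected A → A ⊆ B → B ⊆ A → IsConnected B
  connected-⊇ cA s t a b p q = ReachIn-mono s (cA a b (t a p) (t b q))

  path-connected : ∀ L → IsPath L → L ≢ [] → IsConnected (elems L)
  path-connected [] h ne = ⊥-elim (ne refl)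
  path-connected (x ∷ []) h ne a b p q with elem-∷-elim a x [] p | elem-∷-elim b x [] q
  ... | inj₁ refl | inj₁ refl = here
  ... | inj₂ () | _
  ... | inj₁ _ | inj₂ ()
  path-connected (x ∷ y ∷ L) (h1 , h2) ne = connected-∪ {A = ⁅ x ⁆} {B = elems (y ∷ L)} (connected-⁅⁆ x)
      (path-connected (y ∷ L) h2 (λ ())) (x , y , x∈⁅x⁆ x , elem-head y L , h1)

  ∪-[]-⊆ : ∀ (A : FinPred n) → A ∪ elems [] ⊆ A
  ∪-[]-⊆ A x p with ∪-elim A (elems []) x p
  ... | inj₁ q = q
  ... | inj₂ ()

  connected-∪-path : ∀ {A : FinPred n} L → IsConnected A → IsPath L → (L ≡ []) ⊎ Touches A (elems L) →
    IsConnected (A ∪ elems L)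
  connected-∪-path {A} L cA ch (inj₁ refl) = connected-⊇ cA (p⊆p∪q {f = A} (elems [])) (∪-[]-⊆ A)
  connected-∪-path {A} [] cA ch (inj₂ t) = connected-⊇ cA (p⊆p∪q {f = A} (elems [])) (∪-[]-⊆ A)
  connected-∪-path {A} (x ∷ L) cA ch (inj₂ t) = connected-∪ {A = A} {B = elems (x ∷ L)} cA
      (path-connected (x ∷ L) ch (λ ())) t

  Touches-sym : ∀ {A B : FinPred n} → Touches A B → Touches B A
  Touches-sym (a , b , p , q , e) = b , a , q , p , trans (G-sym b a) e

  Touches-mono : ∀ {A A' B B' : FinPred n} → A ⊆ A' → B ⊆ B' → Touches A B → Touches A' B'
  Touches-mono s t (a , b , p , q , e) = a , b , s a p , t b q , e

  NoEdge-sym : ∀ {A B : FinPred n} → NoEdge A B → NoEdge B A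
  NoEdge-sym h a b p q e = h b a q p (trans (G-sym b a) e)

  NoEdge-mono : ∀ {A A' B B' : FinPred n} → A ⊆ A' → B ⊆ B' → NoEdge A' B' → NoEdge A B
  NoEdge-mono s t h a b p q e = h a b (s a p) (t b q) e

  NoEdge-∪ˡ : ∀ {A A' B : FinPred n} → NoEdge A B → NoEdge A' B → NoEdge (A ∪ A') B
  NoEdge-∪ˡ {A} {A'} h h' a b p q e with ∪-elim A A' a p
  ... | inj₁ r = h a b r q e
  ... | inj₂ r = h' a b r q e

  NoEdge-∪ʳ : ∀ {A B B' : FinPred n} → NoEdge A B → NoEdge A B' → NoEdge A (B ∪ B')
  NoEdge-∪ʳ {A} {B} {B'} h h' a b p q e with ∪-elim B B' b q
  ... | inj₁ r = h a b p r e
  ... | inj₂ r = h' a b p r e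

  NbrOf : FinPred n → FinPred n
  NbrOf A x = anyᶠ (λ a → A a ∧ G a x)

  NbrOf-intro : ∀ (A : FinPred n) a x → A a ≡ true → G a x ≡ true → NbrOf A x ≡ true
  NbrOf-intro A a x p q = anyᶠ-intro (λ a → A a ∧ G a x) a (∧-intro p q)

  NbrOf-elim : ∀ (A : FinPred n) x → NbrOf A x ≡ true → ∃ λ a → (A a ≡ true) × (G a x ≡ true)
  NbrOf-elim A x p with anyᶠ-elim (λ a → A a ∧ G a x) p
  ... | a , q = a , ∧-elimˡ (A a) q , ∧-elimʳ (A a) q

  NbrOf⇒Touches : ∀ (A B : FinPred n) x → B x ≡ true → NbrOf A x ≡ true → Touches A B
  NbrOf⇒Touches A B x p q with NbrOf-elim A x q
  ... | a , r , e = a , x , r , p , e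

  Touches⇒NbrOf : ∀ (A B : FinPred n) → Touches A B → ∃ λ x → (B x ≡ true) × (NbrOf A x ≡ true)
  Touches⇒NbrOf A B (a , b , p , q , e) = b , q , NbrOf-intro A a b p e

  None-NbrOf⇒NoEdge : ∀ (A : FinPred n) L → None (NbrOf A) L → NoEdge A (elems L)
  None-NbrOf⇒NoEdge A L h a b p q e = true≢false (NbrOf-intro A a b p e) (h b q)

  None-adj⇒NoEdge : ∀ c L → None (G c) L → NoEdge ⁅ c ⁆ (elems L)
  None-adj⇒NoEdge c L h a b p q e with x∈⁅y⁆⇒x≡y {c = c} {a} p
  ... | refl = true≢false e (h b q)

  elem-NbrOf⇒Touches : ∀ (A : FinPred n) L → (∃ λ x → (elem x L ≡ true) × (NbrOf A x ≡ true)) →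
    Touches A (elems L)
  elem-NbrOf⇒Touches A L (x , m , q) = NbrOf⇒Touches A (elems L) x m q

  ReachIn⇒path : ∀ {S : FinPred n} {a b} → ReachIn S a b → Σ (List (Fin n)) λ L →
    PathFrom a L × elems L ⊆ S × LastIn ⁅ b ⁆ (a ∷ L)
  ReachIn⇒path {a = a} here = [] , tt , (λ x ()) , x∈⁅x⁆ a
  ReachIn⇒path (step {b = b'} e m r) with ReachIn⇒path r
  ... | L , ch , s , la = b' ∷ L , (e , ch) , ∷-⊆ b' L m s , la

  LastIn-mono : ∀ (p q : FinPred n) L → p ⊆ q → LastIn p L → LastIn q L
  LastIn-mono p q (x ∷ []) s h = s x h
  LastIn-mono p q (x ∷ y ∷ L) s h = LastIn-mono p q (y ∷ L) s h

  HeadIn-mono : ∀ (p q : FinPred n) L → p ⊆ q → HeadIn p L → HeadIn q L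
  HeadIn-mono p q (x ∷ L) s h = s x h

  record PathIn (S P Q : FinPred n) : Set where
    constructor mkPath
    field
      vertices : List (Fin n)
      isPath : IsPath vertices
      distinct : Distinct vertices
      ⊆S : elems vertices ⊆ S
      head∈P : HeadIn P vertices
      last∈Q : LastIn Q vertices

  path-between : ∀ {S P Q : FinPred n} → IsConnected S → ∀ x y → S x ≡ true → S y ≡ true → P x ≡ true →
    Q y ≡ true → PathIn S P Q
  path-between {S} {P} {Q} cS x y sx sy px qy with ReachIn⇒path (cS x y sx sy)
  ... | L , ch , s , la =
    mkPath (eraseLoops (x ∷ L)) (eraseLoops-path (x ∷ L) ch) (eraseLoops-distinct (x ∷ L))
      (⊆-trans (eraseLoops-⊆ (x ∷ L)) (∷-⊆ x L sx s))
      (eraseLoops-head P (x ∷ L) px)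
      (eraseLoops-last Q (x ∷ L) (LastIn-mono ⁅ y ⁆ Q (x ∷ L) (⁅x⁆⊆p {c = y} {f = Q} qy) la))

  NbrOf-mono : ∀ {A B : FinPred n} → A ⊆ B → NbrOf A ⊆ NbrOf B
  NbrOf-mono {A} {B} s x p with NbrOf-elim A x p
  ... | a , q , e = NbrOf-intro B a x (s a q) e

  AdjTo : List (Fin n) → FinPred n
  AdjTo L z = anyᴸ (G z) L

  None-AdjTo⇒NoEdge : ∀ L T → None (AdjTo L) T → NoEdge (elems T) (elems L)
  None-AdjTo⇒NoEdge L T h a b p q e = true≢false (anyᴸ-intro (G a) b L q e) (h a p)

  prefix-touches : ∀ {S : FinPred n} A c B → HeadIn (NbrOf S) (A ++ c ∷ B) → (A ≡ []) ⊎ Touches S (elems A)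
  prefix-touches [] c B h = inj₁ refl
  prefix-touches {S} (x ∷ A) c B h = inj₂ (elem-NbrOf⇒Touches S (x ∷ A) (x , elem-head x A , h))

  suffix-touches : ∀ {S : FinPred n} A c B → LastIn (NbrOf S) (A ++ c ∷ B) → (B ≡ []) ⊎ Touches S (elems B)
  suffix-touches {S} A c B h with LastIn-∷⁻ (NbrOf S) c B (LastIn-++⁻ (NbrOf S) A (c ∷ B) h (λ ()))
  ... | inj₁ (e , _) = inj₁ e
  ... | inj₂ l = inj₂ (elem-NbrOf⇒Touches S B (LastIn-elem (NbrOf S) B l))

  middle-touches-prefix : ∀ {S : FinPred n} A c B → IsPath (A ++ c ∷ B) → HeadIn (NbrOf S) (A ++ c ∷ B) →
    Touches ⁅ c ⁆ (S ∪ elems A)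
  middle-touches-prefix {S} [] c B ch h = Touches-mono (λ x p → p) (p⊆p∪q {f = S} (elems []))
      (Touches-sym (NbrOf⇒Touches S ⁅ c ⁆ c (x∈⁅x⁆ c) h))
  middle-touches-prefix {S} (x ∷ A) c B ch h with LastAdj-elem (x ∷ A) c
      (last-adj (IsPath-split (x ∷ A) c B ch))
  ... | inj₁ ()
  ... | inj₂ (z , m , e) = c , z , x∈⁅x⁆ c , ∪-introʳ S {elems (x ∷ A)} m , trans (G-sym c z) e

  middle-touches-suffix : ∀ {S : FinPred n} A c B → IsPath (A ++ c ∷ B) → LastIn (NbrOf S) (A ++ c ∷ B) →
    Touches ⁅ c ⁆ (S ∪ elems B)
  middle-touches-suffix {S} A c B ch h with LastIn-∷⁻ (NbrOf S) c B (LastIn-++⁻ (NbrOf S) A (c ∷ B) h (λ ()))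
  ... | inj₁ (refl , q) = Touches-mono (λ x p → p) (p⊆p∪q {f = S} (elems []))
      (Touches-sym (NbrOf⇒Touches S ⁅ c ⁆ c (x∈⁅x⁆ c) q))
  ... | inj₂ l with PathFrom-head c B (suffix-path (IsPath-split A c B ch))
  ... | inj₁ refl = ⊥-elim l
  ... | inj₂ (z , m , e) = c , z , x∈⁅x⁆ c , ∪-introʳ S {elems B} m , e

  connected-∪-prefix : ∀ {S : FinPred n} A c B → IsConnected S → IsPath (A ++ c ∷ B) →
    HeadIn (NbrOf S) (A ++ c ∷ B) → IsConnected (S ∪ elems A)
  connected-∪-prefix A c B cS ch h = connected-∪-path A cS (prefix-path (IsPath-split A c B ch))
      (prefix-touches A c B h)

  connected-∪-suffix : ∀ {S : FinPred n} A c B → IsConnected S → IsPath (A ++ c ∷ B) →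
    LastIn (NbrOf S) (A ++ c ∷ B) → IsConnected (S ∪ elems B)
  connected-∪-suffix A c B cS ch h = connected-∪-path B cS
      (PathFrom⇒IsPath c B (suffix-path (IsPath-split A c B ch))) (suffix-touches A c B h)

  PathIn-reverse : ∀ {S P Q : FinPred n} → PathIn S P Q → PathIn S Q P
  PathIn-reverse {S} {P} {Q} (mkPath L ch nd' sb hd ls) = mkPath (reverse L) (IsPath-reverse G-sym L ch)
      (Distinct-reverse L nd') (λ x m → sb x (elem-reverse⁻ x L m)) (HeadIn-reverse Q L ls)
      (LastIn-reverse P L hd)

  Touches-singleton : ∀ {S B : FinPred n} {c} → IsSingleton S c → Touches S B → Touches ⁅ c ⁆ B
  Touches-singleton {c = c} (h , _) (a , b , p , q , e) with h a p
  ... | refl = a , b , x∈⁅x⁆ a , q , e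

  NoEdge⇒¬Touches : ∀ {A B : FinPred n} → NoEdge A B → Touches A B → ⊥
  NoEdge⇒¬Touches h (a , b , p , q , e) = h a b p q e

  record ModelOf {k : ℕ} (H : Graph k) (X : Fin k → FinPred n) : Set where
    field
      nonempty   : ∀ y → ∃ λ a → X y a ≡ true
      disjoint   : ∀ y z → y ≢ z → Disjoint (X y) (X z)
      connected  : ∀ y → IsConnected (X y)
      touch⇒edge : ∀ y z → y ≢ z → Touches (X y) (X z) → H y z ≡ true
      edge⇒touch : ∀ y z → y ≢ z → H y z ≡ true → Touches (X y) (X z)

  iso-model : ∀ {k} {H : Graph k} ((f , H≡G) : Iso H G) → ModelOf H (λ y → ⁅ Inverse.to f y ⁆)
  iso-model {k} {H} (f , H≡G) = record
    { nonempty = λ y → to y , x∈⁅x⁆ (to y) ; disjoint = dj′ ; connected = λ y → connected-⁅⁆ (to y)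
    ; touch⇒edge = te′
    ; edge⇒touch = λ y z _ e → to y , to z , x∈⁅x⁆ (to y) , x∈⁅x⁆ (to z) , trans (sym (H≡G y z)) e
    }
    where
    to : Fin k → Fin n
    to = Inverse.to f
    to-injective : ∀ {y z} → to y ≡ to z → y ≡ z
    to-injective {y} {z} e =
      trans (sym (Inverse.strictlyInverseʳ f y))
          (trans (cong (Inverse.from f) e) (Inverse.strictlyInverseʳ f z))
    dj′ : ∀ y z → y ≢ z → Disjoint ⁅ to y ⁆ ⁅ to z ⁆
    dj′ y z y≢z x p q = y≢z
        (to-injective (trans (sym (x∈⁅y⁆⇒x≡y {c = to y} {x} p)) (x∈⁅y⁆⇒x≡y {c = to z} {x} q)))
    te′ : ∀ y z → y ≢ z → Touches ⁅ to y ⁆ ⁅ to z ⁆ → H y z ≡ true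
    te′ y z _ (a , b , p , q , e) with x∈⁅y⁆⇒x≡y {c = to y} {a} p | x∈⁅y⁆⇒x≡y {c = to z} {b} q
    ... | refl | refl = trans (H≡G y z) e

  reindex-model : ∀ {k} {H : Graph k} {X : Fin k → FinPred n} (σ : Fin k → Fin k) →
    (∀ y → σ (σ y) ≡ y) → (∀ y z → H (σ y) (σ z) ≡ H y z) → ModelOf H X → ModelOf H (λ y → X (σ y))
  reindex-model σ σσ≡id σ-aut M = record
    { nonempty   = λ y → nonempty (σ y)
    ; disjoint   = λ y z y≢z → disjoint (σ y) (σ z) (y≢z ∘ σ-injective)
    ; connected  = λ y → connected (σ y)
    ; touch⇒edge = λ y z y≢z t → trans (sym (σ-aut y z)) (touch⇒edge (σ y) (σ z) (y≢z ∘ σ-injective) t)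
    ; edge⇒touch = λ y z y≢z e → edge⇒touch (σ y) (σ z) (y≢z ∘ σ-injective) (trans (σ-aut y z) e)
    }
    where
    open ModelOf M
    σ-injective : ∀ {y z} → σ y ≡ σ z → y ≡ z
    σ-injective {y} {z} e = trans (sym (σσ≡id y)) (trans (cong σ e) (σσ≡id z))

  reindex-⋃ : ∀ {k} (X : Fin k → FinPred n) (σ : Fin k → Fin k) → ⋃ (λ y → X (σ y)) ⊆ ⋃ X
  reindex-⋃ X σ x p with ⋃-elim (λ y → X (σ y)) x p
  ... | y , q = ⋃-intro X (σ y) x q

  replace-model : ∀ {k} {H : Graph k} {X : Fin k → FinPred n} → (∀ y z → H y z ≡ H z y) → ModelOf H X →
    ∀ y (Y : FinPred n) → Y ⊆ X y → (∃ λ a → Y a ≡ true) → IsConnected Y →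
    (∀ z → z ≢ y → H y z ≡ true → Touches Y (X z)) → ModelOf H (replace X y Y)
  replace-model {H = H} {X} H-sym M y Y s neY cY tY = record
    { nonempty = ne′ ; disjoint = dj′ ; connected = cn′ ; touch⇒edge = te′ ; edge⇒touch = et′ }
    where
    open ModelOf M
    ne′ : ∀ z → ∃ λ a → replace X y Y z a ≡ true
    ne′ z with replace-cases X y Y z
    ... | inj₁ (_ , e) = subst (λ S → ∃ λ a → S a ≡ true) (sym e) neY
    ... | inj₂ (_ , e) = subst (λ S → ∃ λ a → S a ≡ true) (sym e) (nonempty z)
    dj′ : ∀ z z′ → z ≢ z′ → Disjoint (replace X y Y z) (replace X y Y z′)
    dj′ z z′ h = Disjoint-mono (replace-⊆ X y Y s z) (replace-⊆ X y Y s z′) (disjoint z z′ h)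
    cn′ : ∀ z → IsConnected (replace X y Y z)
    cn′ z with replace-cases X y Y z
    ... | inj₁ (_ , e) = subst IsConnected (sym e) cY
    ... | inj₂ (_ , e) = subst IsConnected (sym e) (connected z)
    te′ : ∀ z z′ → z ≢ z′ → Touches (replace X y Y z) (replace X y Y z′) → H z z′ ≡ true
    te′ z z′ h t = touch⇒edge z z′ h (Touches-mono (replace-⊆ X y Y s z) (replace-⊆ X y Y s z′) t)
    et′ : ∀ z z′ → z ≢ z′ → H z z′ ≡ true → Touches (replace X y Y z) (replace X y Y z′)
    et′ z z′ h e with replace-cases X y Y z | replace-cases X y Y z′
    ... | inj₁ (refl , e₁) | inj₁ (refl , e₂) = ⊥-elim (h refl)
    ... | inj₁ (refl , e₁) | inj₂ (h₂ , e₂) = subst₂ Touches (sym e₁) (sym e₂) (tY z′ h₂ e)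
    ... | inj₂ (h₁ , e₁) | inj₁ (refl , e₂) =
      subst₂ Touches (sym e₁) (sym e₂) (Touches-sym (tY z h₁ (trans (H-sym z′ z) e)))
    ... | inj₂ (h₁ , e₁) | inj₂ (h₂ , e₂) = subst₂ Touches (sym e₁) (sym e₂) (edge⇒touch z z′ h e)

  replace-strictly-within : ∀ {k} {H : Graph k} {X : Fin k → FinPred n} → ModelOf H X →
    ∀ y (Y : FinPred n) → Y ⊆ X y → ∀ w → X y w ≡ true → Y w ≡ false → StrictlyWithin (replace X y Y) X
  replace-strictly-within {X = X} M y Y s w p q =
    (λ x r → let (z , r′) = ⋃-elim (replace X y Y) x r in ⋃-intro X z x (replace-⊆ X y Y s z x r′)) ,
    w , ⋃-intro X y w p , anyᶠ-none (λ z → replace X y Y z w) w∉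
    where
    open ModelOf M
    w∉ : ∀ z → replace X y Y z w ≡ false
    w∉ z with replace-cases X y Y z
    ... | inj₁ (_ , e) rewrite e = q
    ... | inj₂ (h , e) rewrite e = ∉-Disjoint (disjoint y z (λ r → h (sym r))) p

-- Models from induced minors
lift : ∀ {m} → Bool → Fin (suc m) → FinPred m → FinPred (suc m)
lift d v S x with v ≟ x
... | yes _ = d
... | no v≢x = S (punchOut v≢x)

lift-punchIn : ∀ {m} d (v : Fin (suc m)) S i → lift d v S (punchIn v i) ≡ S i
lift-punchIn d v S i with v ≟ punchIn v i
... | yes e = ⊥-elim (punchInᵢ≢i v i (sym e))
... | no v≢ = cong S (trans (punchOut-cong v refl) (punchOut-punchIn v))

lift-pivot : ∀ {m} d (v : Fin (suc m)) S → lift d v S v ≡ d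
lift-pivot d v S with v ≟ v
... | yes _ = refl
... | no v≢v = ⊥-elim (v≢v refl)

lift-cases : ∀ {m} d (v : Fin (suc m)) S x → lift d v S x ≡ true →
  (x ≡ v × d ≡ true) ⊎ (∃ λ i → (x ≡ punchIn v i) × (S i ≡ true))
lift-cases d v S x p with v ≟ x
... | yes refl = inj₁ (refl , p)
... | no v≢x = inj₂ (punchOut v≢x , sym (punchIn-punchOut v≢x) , p)

deleteV-simple : ∀ {m} {G : Graph (suc m)} → IsSimple G → ∀ v → IsSimple (deleteV G v)
deleteV-simple s v = record
  { sym = λ a b → IsSimple.sym s (punchIn v a) (punchIn v b) ; irrefl = λ a →
      IsSimple.irrefl s (punchIn v a) }

contract-simple : ∀ {m} {G : Graph (suc m)} → IsSimple G → ∀ u v → IsSimple (contract G u v)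
contract-simple {m} {G} s u v = record { sym = sy ; irrefl = ir }
  where
  ir : ∀ a → contract G u v a a ≡ false
  ir a with a ≟ a
  ... | yes _ = refl
  ... | no h = ⊥-elim (h refl)
  sy : ∀ a b → contract G u v a b ≡ contract G u v b a
  sy a b with a ≟ b | b ≟ a
  ... | yes _ | yes _ = refl
  ... | yes e | no h = ⊥-elim (h (sym e))
  ... | no h | yes e = ⊥-elim (h (sym e))
  ... | no _ | no _ rewrite IsSimple.sym s (punchIn v a) (punchIn v b) =
    cong (G (punchIn v b) (punchIn v a) ∨_)
        (∨-comm (⌊ punchIn v a ≟ u ⌋ ∧ G v (punchIn v b)) (⌊ punchIn v b ≟ u ⌋ ∧ G v (punchIn v a)))

module LiftDelete {m : ℕ} (G : Graph (suc m)) (sG : IsSimple G) (v : Fin (suc m)) where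
  private
    module A = GraphNotions G (IsSimple.sym sG)
    module B = GraphNotions (deleteV G v) (IsSimple.sym (deleteV-simple sG v))

  lift-reach : ∀ {S : FinPred m} {i j} → B.ReachIn S i j →
    A.ReachIn (lift false v S) (punchIn v i) (punchIn v j)
  lift-reach B.here = A.here
  lift-reach {S} (B.step {b = k} e mk r) = A.step e (trans (lift-punchIn false v S k) mk) (lift-reach r)

  lift-model : ∀ {k} {H : Graph k} {X : Fin k → FinPred m} → B.ModelOf H X →
    A.ModelOf H (λ y → lift false v (X y))
  lift-model {k} {H} {X} M = record
      { nonempty = ne' ; disjoint = dj' ; connected = cn' ; touch⇒edge = te' ; edge⇒touch = et' }
    where
    open B.ModelOf M
    L : Fin k → FinPred (suc m)
    L y = lift false v (X y)
    lp : ∀ y i → L y (punchIn v i) ≡ X y i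
    lp y i = lift-punchIn false v (X y) i
    ne' : ∀ y → ∃ λ a → L y a ≡ true
    ne' y with nonempty y
    ... | i , p = punchIn v i , trans (lp y i) p
    dj' : ∀ y z → y ≢ z → Disjoint (L y) (L z)
    dj' y z h x p q with lift-cases false v (X y) x p
    ... | inj₁ (_ , ())
    ... | inj₂ (i , refl , p') = disjoint y z h i p' (trans (sym (lp z i)) q)
    cn' : ∀ y → A.IsConnected (L y)
    cn' y a b p q with lift-cases false v (X y) a p | lift-cases false v (X y) b q
    ... | inj₁ (_ , ()) | _
    ... | inj₂ _ | inj₁ (_ , ())
    ... | inj₂ (i , refl , p') | inj₂ (j , refl , q') = lift-reach (connected y i j p' q')
    te' : ∀ y z → y ≢ z → A.Touches (L y) (L z) → H y z ≡ true
    te' y z h (a , b , p , q , e) with lift-cases false v (X y) a p | lift-cases false v (X z) b q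
    ... | inj₁ (_ , ()) | _
    ... | inj₂ _ | inj₁ (_ , ())
    ... | inj₂ (i , refl , p') | inj₂ (j , refl , q') = touch⇒edge y z h (i , j , p' , q' , e)
    et' : ∀ y z → y ≢ z → H y z ≡ true → A.Touches (L y) (L z)
    et' y z h e with edge⇒touch y z h e
    ... | i , j , p , q , e' = punchIn v i , punchIn v j , trans (lp y i) p , trans (lp z j) q , e'

module LiftContract {m : ℕ} (G : Graph (suc m)) (sG : IsSimple G) (u v : Fin (suc m)) (neq : u ≢ v)
    (euv : G u v ≡ true) where
  private
    module A = GraphNotions G (IsSimple.sym sG)
    Gc : Graph m
    Gc = contract G u v
    module B = GraphNotions Gc (IsSimple.sym (contract-simple sG u v))

  w : Fin m
  w = punchOut (neq ∘ sym)

  uw : punchIn v w ≡ u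
  uw = punchIn-punchOut (neq ∘ sym)

  gvu : G v u ≡ true
  gvu = trans (IsSimple.sym sG v u) euv

  decode : ∀ i j → Gc i j ≡ true →
    (i ≢ j) × ((G (punchIn v i) (punchIn v j) ≡ true) ⊎ ((i ≡ w) × (G v (punchIn v j) ≡ true)) ⊎
    ((j ≡ w) × (G v (punchIn v i) ≡ true)))
  decode i j e with i ≟ j
  decode i j () | yes _
  ... | no h with ∨-elim (G (punchIn v i) (punchIn v j)) e
  ... | inj₁ g = h , inj₁ g
  ... | inj₂ e2 with punchIn v i ≟ u | punchIn v j ≟ u
  ... | yes a | yes b with ∨-elim (G v (punchIn v j)) e2
  ... | inj₁ g = h , inj₂ (inj₁ (punchIn-injective v i w (trans a (sym uw)) , g))
  ... | inj₂ g = h , inj₂ (inj₂ (punchIn-injective v j w (trans b (sym uw)) , g))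
  decode i j e | no h | inj₂ e2 | yes a | no b with ∨-elim (G v (punchIn v j)) e2
  ... | inj₁ g = h , inj₂ (inj₁ (punchIn-injective v i w (trans a (sym uw)) , g))
  ... | inj₂ ()
  decode i j e | no h | inj₂ e2 | no a | yes b = h , inj₂
      (inj₂ (punchIn-injective v j w (trans b (sym uw)) , e2))
  decode i j e | no h | inj₂ () | no a | no b

  encode1 : ∀ i j → i ≢ j → G (punchIn v i) (punchIn v j) ≡ true → Gc i j ≡ true
  encode1 i j h g with i ≟ j
  ... | yes e = ⊥-elim (h e)
  ... | no _ = ∨-introˡ _ g

  encode2 : ∀ i j → i ≢ j → i ≡ w → G v (punchIn v j) ≡ true → Gc i j ≡ true
  encode2 i j h iw g with i ≟ j
  ... | yes e = ⊥-elim (h e)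
  ... | no _ with punchIn v i ≟ u
  ... | yes _ = ∨-introʳ (G (punchIn v i) (punchIn v j)) (∨-introˡ _ g)
  ... | no k = ⊥-elim (k (trans (cong (punchIn v) iw) uw))

  -- The contracted vertex v joins the part containing w, the image of u.
  L : FinPred m → FinPred (suc m)
  L S = lift (S w) v S

  lift-reach : ∀ {S : FinPred m} {i j} → B.ReachIn S i j → S i ≡ true →
    A.ReachIn (L S) (punchIn v i) (punchIn v j)
  lift-reach B.here si = A.here
  lift-reach {S} {i} (B.step {b = k} e mk r) si with decode i k e
  ... | _ , inj₁ g = A.step g (trans (lift-punchIn (S w) v S k) mk) (lift-reach r mk)
  ... | _ , inj₂ (inj₁ (refl , g)) =
    A.step (subst (λ z → G z v ≡ true) (sym uw) euv) (trans (lift-pivot (S w) v S) si)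
        (A.step g (trans (lift-punchIn (S w) v S k) mk) (lift-reach r mk))
  ... | _ , inj₂ (inj₂ (refl , g)) =
    A.step (trans (IsSimple.sym sG (punchIn v i) v) g) (trans (lift-pivot (S w) v S) mk)
      (A.step (subst (λ z → G v z ≡ true) (sym uw) gvu) (trans (lift-punchIn (S w) v S w) mk)
          (lift-reach r mk))

  lift-model : ∀ {k} {H : Graph k} {X : Fin k → FinPred m} → B.ModelOf H X → A.ModelOf H (λ y → L (X y))
  lift-model {k} {H} {X} M = record
      { nonempty = ne' ; disjoint = dj' ; connected = cn' ; touch⇒edge = te' ; edge⇒touch = et' }
    where
    open B.ModelOf M
    lp : ∀ y i → L (X y) (punchIn v i) ≡ X y i
    lp y i = lift-punchIn (X y w) v (X y) i
    lv : ∀ y → L (X y) v ≡ X y w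
    lv y = lift-pivot (X y w) v (X y)
    ne' : ∀ y → ∃ λ a → L (X y) a ≡ true
    ne' y with nonempty y
    ... | i , p = punchIn v i , trans (lp y i) p
    dj' : ∀ y z → y ≢ z → Disjoint (L (X y)) (L (X z))
    dj' y z h x p q with lift-cases (X y w) v (X y) x p
    ... | inj₁ (refl , p') = disjoint y z h w p' (trans (sym (lv z)) q)
    ... | inj₂ (i , refl , p') = disjoint y z h i p' (trans (sym (lp z i)) q)
    cn' : ∀ y → A.IsConnected (L (X y))
    cn' y a b p q with lift-cases (X y w) v (X y) a p | lift-cases (X y w) v (X y) b q
    ... | inj₁ (refl , p') | inj₁ (refl , q') = A.here
    ... | inj₁ (refl , p') | inj₂ (j , refl , q') =
      A.step (subst (λ z → G v z ≡ true) (sym uw) gvu) (trans (lp y w) p')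
          (lift-reach (connected y w j p' q') p')
    ... | inj₂ (i , refl , p') | inj₁ (refl , q') =
      A.ReachIn-trans (lift-reach (connected y i w p' q') p')
          (A.step (subst (λ z → G z v ≡ true) (sym uw) euv) (trans (lv y) q') A.here)
    ... | inj₂ (i , refl , p') | inj₂ (j , refl , q') = lift-reach (connected y i j p' q') p'
    te' : ∀ y z → y ≢ z → A.Touches (L (X y)) (L (X z)) → H y z ≡ true
    te' y z h (a , b , p , q , e) with lift-cases (X y w) v (X y) a p | lift-cases (X z w) v (X z) b q
    ... | inj₁ (refl , p') | inj₁ (refl , q') = ⊥-elim (disjoint y z h w p' q')
    ... | inj₁ (refl , p') | inj₂ (j , refl , q') =
      touch⇒edge y z h (w , j , p' , q' , encode2 w j
          (λ e' → disjoint y z h w p' (subst (λ t → X z t ≡ true) (sym e') q')) refl e)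
    ... | inj₂ (i , refl , p') | inj₁ (refl , q') =
      touch⇒edge y z h (i , w , p' , q' , trans (IsSimple.sym (contract-simple sG u v) i w)
        (encode2 w i (λ e' → disjoint y z h i p' (subst (λ t → X z t ≡ true) e' q')) refl
            (trans (IsSimple.sym sG v (punchIn v i)) e)))
    ... | inj₂ (i , refl , p') | inj₂ (j , refl , q') =
      touch⇒edge y z h (i , j , p' , q' , encode1 i j
          (λ e' → disjoint y z h i p' (subst (λ t → X z t ≡ true) (sym e') q')) e)
    et' : ∀ y z → y ≢ z → H y z ≡ true → A.Touches (L (X y)) (L (X z))
    et' y z h e with edge⇒touch y z h e
    ... | i , j , p , q , e' with decode i j e'
    ... | _ , inj₁ g = punchIn v i , punchIn v j , trans (lp y i) p , trans (lp z j) q , g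
    ... | _ , inj₂ (inj₁ (refl , g)) = v , punchIn v j , trans (lv y) p , trans (lp z j) q , g
    ... | _ , inj₂ (inj₂ (refl , g)) = punchIn v i , v , trans (lp y i) p , trans (lv z) q , trans
        (IsSimple.sym sG (punchIn v i) v) g

minor-model : ∀ {k n} {H : Graph k} {G : Graph n} (sG : IsSimple G) → IsInducedMinor H G →
  Σ (Fin k → FinPred n) λ X → GraphNotions.ModelOf G (IsSimple.sym sG) H X
minor-model {G = G} sG (iso H≅G) = _ , GraphNotions.iso-model G (IsSimple.sym sG) H≅G
minor-model {k} {suc m} {H} {G} sG (del v D) with minor-model (deleteV-simple sG v) D
... | X , M = (λ y → lift false v (X y)) , LiftDelete.lift-model G sG v M
minor-model {k} {suc m} {H} {G} sG (con u v neq e D) with minor-model (contract-simple sG u v) D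
... | X , M = (λ y → LiftContract.L G sG u v neq e (X y)) , LiftContract.lift-model G sG u v neq e M

module ToSubsets {n : ℕ} (G : Graph n) (sG : IsSimple G) where
  open GraphNotions G (IsSimple.sym sG)

  toReach : ∀ {S : FinPred n} {a b} → ReachIn S a b → Reach G (toSubset S) a b
  toReach here = here
  toReach (step e m r) = step e (∈-toSubset⁺ m) (toReach r)

  toIsModel : ∀ {k} {H : Graph k} {X : Fin k → FinPred n} → ModelOf H X → IsModel H G (λ y → toSubset (X y))
  toIsModel {X = X} M = record
    { nonempty = λ y → proj₁ (nonempty y) , ∈-toSubset⁺ (proj₂ (nonempty y))
    ; disjoint = λ y z h a p q → disjoint y z h a (∈-toSubset⁻ p) (∈-toSubset⁻ q)
    ; connected = λ y a b p q → toReach (connected y a b (∈-toSubset⁻ p) (∈-toSubset⁻ q))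
    ; touch⇒edge = λ { y z h (a , b , p , q , e) →
        touch⇒edge y z h (a , b , ∈-toSubset⁻ p , ∈-toSubset⁻ q , e) }
    ; edge⇒touch = λ y z h e →
        let (a , b , p , q , e′) = edge⇒touch y z h e in a , b , ∈-toSubset⁺ p , ∈-toSubset⁺ q , e′
    }
    where
    open ModelOf M

-- Symmetries of F₂
swap₂₅ swap₃₄ : Fin 5 → Fin 5
swap₂₅ = transpose v2 v5
swap₃₄ = transpose v3 v4

F₂-sym : ∀ y z → F₂ y z ≡ F₂ z y
F₂-sym = from-yes (all? λ y → all? λ z → F₂ y z ≟ᵇ F₂ z y)

swap₂₅-involutive : ∀ y → swap₂₅ (swap₂₅ y) ≡ y
swap₂₅-involutive = from-yes (all? λ y → swap₂₅ (swap₂₅ y) ≟ y)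

swap₂₅-automorphism : ∀ y z → F₂ (swap₂₅ y) (swap₂₅ z) ≡ F₂ y z
swap₂₅-automorphism = from-yes (all? λ y → all? λ z → F₂ (swap₂₅ y) (swap₂₅ z) ≟ᵇ F₂ y z)

swap₃₄-involutive : ∀ y → swap₃₄ (swap₃₄ y) ≡ y
swap₃₄-involutive = from-yes (all? λ y → swap₃₄ (swap₃₄ y) ≟ y)

swap₃₄-automorphism : ∀ y z → F₂ (swap₃₄ y) (swap₃₄ z) ≡ F₂ y z
swap₃₄-automorphism = from-yes (all? λ y → all? λ z → F₂ (swap₃₄ y) (swap₃₄ z) ≟ᵇ F₂ y z)

module F₂-Models {n : ℕ} (G : Graph n) (G-sym : ∀ a b → G a b ≡ G b a) where
  open GraphNotions G G-sym

  F₂-Model : (Fin 5 → FinPred n) → Set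
  F₂-Model X = ModelOf F₂ X

  Smaller : (Fin 5 → FinPred n) → Set
  Smaller X = Σ (Fin 5 → FinPred n) λ X′ → F₂-Model X′ × StrictlyWithin X′ X

  WithSingletonX₂ : (Fin 5 → FinPred n) → Set
  WithSingletonX₂ X = Σ (Fin 5 → FinPred n) λ X′ → F₂-Model X′ × (∃ λ c → IsSingleton (X′ v2) c) × Within X′ X

  WithSingletons : (Fin 5 → FinPred n) → Set
  WithSingletons X = Σ (Fin 5 → FinPred n) λ X' →
      F₂-Model X' × (∃ λ u → IsSingleton (X' v1) u) × (∃ λ r → IsSingleton (X' v2) r) × Within X' X

  family₅ : FinPred n → FinPred n → FinPred n → FinPred n → FinPred n → Fin 5 → FinPred n
  family₅ A B C D E zero = A
  family₅ A B C D E (suc zero) = B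
  family₅ A B C D E (suc (suc zero)) = C
  family₅ A B C D E (suc (suc (suc zero))) = D
  family₅ A B C D E (suc (suc (suc (suc zero)))) = E

  record F₂-Conditions (A B C D E : FinPred n) : Set where
    field
      n1 : ∃ λ x → A x ≡ true
      n2 : ∃ λ x → B x ≡ true
      n3 : ∃ λ x → C x ≡ true
      n4 : ∃ λ x → D x ≡ true
      n5 : ∃ λ x → E x ≡ true
      c1 : IsConnected A
      c2 : IsConnected B
      c3 : IsConnected C
      c4 : IsConnected D
      c5 : IsConnected E
      d12 : Disjoint A B
      d13 : Disjoint A C
      d14 : Disjoint A D
      d15 : Disjoint A E
      d23 : Disjoint B C
      d24 : Disjoint B D
      d25 : Disjoint B E
      d34 : Disjoint C D
      d35 : Disjoint C E
      d45 : Disjoint D E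
      t12 : Touches A B
      t15 : Touches A E
      t23 : Touches B C
      t24 : Touches B D
      t34 : Touches C D
      t35 : Touches C E
      t45 : Touches D E
      x13 : NoEdge A C
      x14 : NoEdge A D
      x25 : NoEdge B E

  module _ {A B C D E : FinPred n} (c : F₂-Conditions A B C D E) where
    open F₂-Conditions c
    F₂-model : ModelOf F₂ (family₅ A B C D E)
    F₂-model = record { nonempty = ne' ; disjoint = dj' ; connected = cn' ; touch⇒edge = te'
        ; edge⇒touch = et' }
      where
      ne' : ∀ y → ∃ λ a → family₅ A B C D E y a ≡ true
      ne' zero = n1
      ne' (suc zero) = n2
      ne' (suc (suc zero)) = n3
      ne' (suc (suc (suc zero))) = n4
      ne' (suc (suc (suc (suc zero)))) = n5
      cn' : ∀ y → IsConnected (family₅ A B C D E y)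
      cn' zero = c1
      cn' (suc zero) = c2
      cn' (suc (suc zero)) = c3
      cn' (suc (suc (suc zero))) = c4
      cn' (suc (suc (suc (suc zero)))) = c5
      dj' : ∀ y z → y ≢ z → Disjoint (family₅ A B C D E y) (family₅ A B C D E z)
      dj' zero zero ne = ⊥-elim (ne refl)
      dj' zero (suc zero) ne = d12
      dj' zero (suc (suc zero)) ne = d13
      dj' zero (suc (suc (suc zero))) ne = d14
      dj' zero (suc (suc (suc (suc zero)))) ne = d15
      dj' (suc zero) zero ne = Disjoint-sym d12
      dj' (suc zero) (suc zero) ne = ⊥-elim (ne refl)
      dj' (suc zero) (suc (suc zero)) ne = d23
      dj' (suc zero) (suc (suc (suc zero))) ne = d24
      dj' (suc zero) (suc (suc (suc (suc zero)))) ne = d25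
      dj' (suc (suc zero)) zero ne = Disjoint-sym d13
      dj' (suc (suc zero)) (suc zero) ne = Disjoint-sym d23
      dj' (suc (suc zero)) (suc (suc zero)) ne = ⊥-elim (ne refl)
      dj' (suc (suc zero)) (suc (suc (suc zero))) ne = d34
      dj' (suc (suc zero)) (suc (suc (suc (suc zero)))) ne = d35
      dj' (suc (suc (suc zero))) zero ne = Disjoint-sym d14
      dj' (suc (suc (suc zero))) (suc zero) ne = Disjoint-sym d24
      dj' (suc (suc (suc zero))) (suc (suc zero)) ne = Disjoint-sym d34
      dj' (suc (suc (suc zero))) (suc (suc (suc zero))) ne = ⊥-elim (ne refl)
      dj' (suc (suc (suc zero))) (suc (suc (suc (suc zero)))) ne = d45
      dj' (suc (suc (suc (suc zero)))) zero ne = Disjoint-sym d15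
      dj' (suc (suc (suc (suc zero)))) (suc zero) ne = Disjoint-sym d25
      dj' (suc (suc (suc (suc zero)))) (suc (suc zero)) ne = Disjoint-sym d35
      dj' (suc (suc (suc (suc zero)))) (suc (suc (suc zero))) ne = Disjoint-sym d45
      dj' (suc (suc (suc (suc zero)))) (suc (suc (suc (suc zero)))) ne = ⊥-elim (ne refl)
      te' : ∀ y z → y ≢ z → Touches (family₅ A B C D E y) (family₅ A B C D E z) → F₂ y z ≡ true
      te' zero zero ne t = ⊥-elim (ne refl)
      te' zero (suc zero) ne t = refl
      te' zero (suc (suc zero)) ne t = ⊥-elim (NoEdge⇒¬Touches x13 t)
      te' zero (suc (suc (suc zero))) ne t = ⊥-elim (NoEdge⇒¬Touches x14 t)
      te' zero (suc (suc (suc (suc zero)))) ne t = refl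
      te' (suc zero) zero ne t = refl
      te' (suc zero) (suc zero) ne t = ⊥-elim (ne refl)
      te' (suc zero) (suc (suc zero)) ne t = refl
      te' (suc zero) (suc (suc (suc zero))) ne t = refl
      te' (suc zero) (suc (suc (suc (suc zero)))) ne t = ⊥-elim (NoEdge⇒¬Touches x25 t)
      te' (suc (suc zero)) zero ne t = ⊥-elim (NoEdge⇒¬Touches x13 (Touches-sym t))
      te' (suc (suc zero)) (suc zero) ne t = refl
      te' (suc (suc zero)) (suc (suc zero)) ne t = ⊥-elim (ne refl)
      te' (suc (suc zero)) (suc (suc (suc zero))) ne t = refl
      te' (suc (suc zero)) (suc (suc (suc (suc zero)))) ne t = refl
      te' (suc (suc (suc zero))) zero ne t = ⊥-elim (NoEdge⇒¬Touches x14 (Touches-sym t))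
      te' (suc (suc (suc zero))) (suc zero) ne t = refl
      te' (suc (suc (suc zero))) (suc (suc zero)) ne t = refl
      te' (suc (suc (suc zero))) (suc (suc (suc zero))) ne t = ⊥-elim (ne refl)
      te' (suc (suc (suc zero))) (suc (suc (suc (suc zero)))) ne t = refl
      te' (suc (suc (suc (suc zero)))) zero ne t = refl
      te' (suc (suc (suc (suc zero)))) (suc zero) ne t = ⊥-elim (NoEdge⇒¬Touches x25 (Touches-sym t))
      te' (suc (suc (suc (suc zero)))) (suc (suc zero)) ne t = refl
      te' (suc (suc (suc (suc zero)))) (suc (suc (suc zero))) ne t = refl
      te' (suc (suc (suc (suc zero)))) (suc (suc (suc (suc zero)))) ne t = ⊥-elim (ne refl)
      et' : ∀ y z → y ≢ z → F₂ y z ≡ true → Touches (family₅ A B C D E y) (family₅ A B C D E z)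
      et' zero zero ne ()
      et' zero (suc zero) ne e = t12
      et' zero (suc (suc zero)) ne ()
      et' zero (suc (suc (suc zero))) ne ()
      et' zero (suc (suc (suc (suc zero)))) ne e = t15
      et' (suc zero) zero ne e = Touches-sym t12
      et' (suc zero) (suc zero) ne ()
      et' (suc zero) (suc (suc zero)) ne e = t23
      et' (suc zero) (suc (suc (suc zero))) ne e = t24
      et' (suc zero) (suc (suc (suc (suc zero)))) ne ()
      et' (suc (suc zero)) zero ne ()
      et' (suc (suc zero)) (suc zero) ne e = Touches-sym t23
      et' (suc (suc zero)) (suc (suc zero)) ne ()
      et' (suc (suc zero)) (suc (suc (suc zero))) ne e = t34
      et' (suc (suc zero)) (suc (suc (suc (suc zero)))) ne e = t35
      et' (suc (suc (suc zero))) zero ne ()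
      et' (suc (suc (suc zero))) (suc zero) ne e = Touches-sym t24
      et' (suc (suc (suc zero))) (suc (suc zero)) ne e = Touches-sym t34
      et' (suc (suc (suc zero))) (suc (suc (suc zero))) ne ()
      et' (suc (suc (suc zero))) (suc (suc (suc (suc zero)))) ne e = t45
      et' (suc (suc (suc (suc zero)))) zero ne e = Touches-sym t15
      et' (suc (suc (suc (suc zero)))) (suc zero) ne ()
      et' (suc (suc (suc (suc zero)))) (suc (suc zero)) ne e = Touches-sym t35
      et' (suc (suc (suc (suc zero)))) (suc (suc (suc zero))) ne e = Touches-sym t45
      et' (suc (suc (suc (suc zero)))) (suc (suc (suc (suc zero)))) ne ()

  ⋃-family₅-⊆ : ∀ {X : Fin 5 → FinPred n} {A B C D E : FinPred n} → A ⊆ ⋃ X → B ⊆ ⋃ X → C ⊆ ⋃ X → D ⊆ ⋃ X →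
    E ⊆ ⋃ X → Within (family₅ A B C D E) X
  ⋃-family₅-⊆ {X} {A} {B} {C} {D} {E} a b c d e x p with ⋃-elim (family₅ A B C D E) x p
  ... | zero , q = a x q
  ... | suc zero , q = b x q
  ... | suc (suc zero) , q = c x q
  ... | suc (suc (suc zero)) , q = d x q
  ... | suc (suc (suc (suc zero))) , q = e x q

  ∉-⋃-family₅ : ∀ {A B C D E : FinPred n} x → A x ≡ false → B x ≡ false → C x ≡ false → D x ≡ false →
    E x ≡ false → ⋃ (family₅ A B C D E) x ≡ false
  ∉-⋃-family₅ x a b c d e rewrite a | b | c | d | e = refl

  model-swap₂₅ : ∀ {X : Fin 5 → FinPred n} → F₂-Model X → F₂-Model (λ y → X (swap₂₅ y))
  model-swap₂₅ = reindex-model swap₂₅ swap₂₅-involutive swap₂₅-automorphism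

  model-swap₃₄ : ∀ {X : Fin 5 → FinPred n} → F₂-Model X → F₂-Model (λ y → X (swap₃₄ y))
  model-swap₃₄ = reindex-model swap₃₄ swap₃₄-involutive swap₃₄-automorphism

  module Parts {X : Fin 5 → FinPred n} (M : F₂-Model X) where
    open ModelOf M public
    X1 : FinPred n
    X1 = X v1
    X2 : FinPred n
    X2 = X v2
    X3 : FinPred n
    X3 = X v3
    X4 : FinPred n
    X4 = X v4
    X5 : FinPred n
    X5 = X v5
    D12 : Disjoint (X v1) (X v2)
    D12 = disjoint v1 v2 (λ ())
    D13 : Disjoint (X v1) (X v3)
    D13 = disjoint v1 v3 (λ ())
    D14 : Disjoint (X v1) (X v4)
    D14 = disjoint v1 v4 (λ ())
    D15 : Disjoint (X v1) (X v5)
    D15 = disjoint v1 v5 (λ ())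
    D21 : Disjoint (X v2) (X v1)
    D21 = disjoint v2 v1 (λ ())
    D23 : Disjoint (X v2) (X v3)
    D23 = disjoint v2 v3 (λ ())
    D24 : Disjoint (X v2) (X v4)
    D24 = disjoint v2 v4 (λ ())
    D25 : Disjoint (X v2) (X v5)
    D25 = disjoint v2 v5 (λ ())
    D31 : Disjoint (X v3) (X v1)
    D31 = disjoint v3 v1 (λ ())
    D32 : Disjoint (X v3) (X v2)
    D32 = disjoint v3 v2 (λ ())
    D34 : Disjoint (X v3) (X v4)
    D34 = disjoint v3 v4 (λ ())
    D35 : Disjoint (X v3) (X v5)
    D35 = disjoint v3 v5 (λ ())
    D41 : Disjoint (X v4) (X v1)
    D41 = disjoint v4 v1 (λ ())
    D43 : Disjoint (X v4) (X v3)
    D43 = disjoint v4 v3 (λ ())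
    D45 : Disjoint (X v4) (X v5)
    D45 = disjoint v4 v5 (λ ())
    D51 : Disjoint (X v5) (X v1)
    D51 = disjoint v5 v1 (λ ())
    D52 : Disjoint (X v5) (X v2)
    D52 = disjoint v5 v2 (λ ())
    D53 : Disjoint (X v5) (X v3)
    D53 = disjoint v5 v3 (λ ())
    D54 : Disjoint (X v5) (X v4)
    D54 = disjoint v5 v4 (λ ())
    N13 : NoEdge (X v1) (X v3)
    N13 a b p q e with touch⇒edge v1 v3 (λ ()) (a , b , p , q , e)
    ... | ()
    N14 : NoEdge (X v1) (X v4)
    N14 a b p q e with touch⇒edge v1 v4 (λ ()) (a , b , p , q , e)
    ... | ()
    N25 : NoEdge (X v2) (X v5)
    N25 a b p q e with touch⇒edge v2 v5 (λ ()) (a , b , p , q , e)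
    ... | ()
    N52 : NoEdge (X v5) (X v2)
    N52 a b p q e with touch⇒edge v5 v2 (λ ()) (a , b , p , q , e)
    ... | ()
    T12 : Touches (X v1) (X v2)
    T12 = edge⇒touch v1 v2 (λ ()) refl
    T21 : Touches (X v2) (X v1)
    T21 = edge⇒touch v2 v1 (λ ()) refl
    T15 : Touches (X v1) (X v5)
    T15 = edge⇒touch v1 v5 (λ ()) refl
    T51 : Touches (X v5) (X v1)
    T51 = edge⇒touch v5 v1 (λ ()) refl
    T23 : Touches (X v2) (X v3)
    T23 = edge⇒touch v2 v3 (λ ()) refl
    T32 : Touches (X v3) (X v2)
    T32 = edge⇒touch v3 v2 (λ ()) refl
    T24 : Touches (X v2) (X v4)
    T24 = edge⇒touch v2 v4 (λ ()) refl
    T42 : Touches (X v4) (X v2)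
    T42 = edge⇒touch v4 v2 (λ ()) refl
    T34 : Touches (X v3) (X v4)
    T34 = edge⇒touch v3 v4 (λ ()) refl
    T43 : Touches (X v4) (X v3)
    T43 = edge⇒touch v4 v3 (λ ()) refl
    T35 : Touches (X v3) (X v5)
    T35 = edge⇒touch v3 v5 (λ ()) refl
    T53 : Touches (X v5) (X v3)
    T53 = edge⇒touch v5 v3 (λ ()) refl
    T45 : Touches (X v4) (X v5)
    T45 = edge⇒touch v4 v5 (λ ()) refl
    T54 : Touches (X v5) (X v4)
    T54 = edge⇒touch v5 v4 (λ ()) refl

  -- Making X₁ and X₂ single vertices
  singleton-X₁ : ∀ {X : Fin 5 → FinPred n} → F₂-Model X → Σ (Fin 5 → FinPred n) λ X' →
    F₂-Model X' × (∃ λ c → IsSingleton (X' v1) c) × (X' v2 ≡ X v2) × Within X' X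
  singleton-X₁ {X} M with Touches⇒NbrOf (X v2) (X v1) (Parts.T21 M) | Touches⇒NbrOf (X v5) (X v1)
      (Parts.T51 M)
  ... | x , px , nx | y , py , ny with path-between {S = X v1} {P = NbrOf (X v2)} {Q = NbrOf (X v5)}
      (ModelOf.connected M v1) x y px py nx ny
  ... | mkPath L ch nd' sb hd ls with last-split (NbrOf (X v2)) L (anyᴸ-HeadIn (NbrOf (X v2)) L hd)
  ... | A , c , B , refl , nbc , noneB = family₅ ⁅ c ⁆ (X v2) (X v3) (X v4) (X v5 ∪ elems B) , F₂-model cert ,
      (c , ⁅⁆-IsSingleton c) , refl , U
    where
    open Parts M
    cX1 : X1 c ≡ true
    cX1 = sb c (elem-middle A c B)
    subB : elems B ⊆ X1
    subB = ⊆-trans (suffix-⊆ A c B) sb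
    cert : F₂-Conditions ⁅ c ⁆ X2 X3 X4 (X5 ∪ elems B)
    cert = record
      { n1 = c , x∈⁅x⁆ c ; n2 = nonempty v2 ; n3 = nonempty v3 ; n4 = nonempty v4
      ; n5 = proj₁ (nonempty v5) , ∪-introˡ {f = X5} (elems B) (proj₂ (nonempty v5))
      ; c1 = connected-⁅⁆ c ; c2 = connected v2 ; c3 = connected v3 ; c4 = connected v4
      ; c5 = connected-∪-suffix A c B (connected v5) ch ls
      ; d12 = Disjoint-⁅⁆ (∉-Disjoint D12 cX1) ; d13 = Disjoint-⁅⁆ (∉-Disjoint D13 cX1)
      ; d14 = Disjoint-⁅⁆ (∉-Disjoint D14 cX1)
      ; d15 = Disjoint-⁅⁆ (∨-false (X5 c) (∉-Disjoint D15 cX1) (None⇒∉ (NbrOf X2) c B nbc noneB))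
      ; d23 = D23 ; d24 = D24 ; d25 = Disjoint-∪ʳ D25 (Disjoint-mono ⊆-refl subB D21)
      ; d34 = D34 ; d35 = Disjoint-∪ʳ D35 (Disjoint-mono ⊆-refl subB D31)
      ; d45 = Disjoint-∪ʳ D45 (Disjoint-mono ⊆-refl subB D41)
      ; t12 = Touches-sym (NbrOf⇒Touches X2 ⁅ c ⁆ c (x∈⁅x⁆ c) nbc)
      ; t15 = middle-touches-suffix A c B ch ls
      ; t23 = T23 ; t24 = T24 ; t34 = T34
      ; t35 = Touches-mono ⊆-refl (p⊆p∪q {f = X5} (elems B)) T35
      ; t45 = Touches-mono ⊆-refl (p⊆p∪q {f = X5} (elems B)) T45
      ; x13 = NoEdge-mono (⁅x⁆⊆p {f = X1} cX1) ⊆-refl N13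
      ; x14 = NoEdge-mono (⁅x⁆⊆p {f = X1} cX1) ⊆-refl N14
      ; x25 = NoEdge-∪ʳ N25 (None-NbrOf⇒NoEdge X2 B noneB)
      }
    U : Within (family₅ ⁅ c ⁆ X2 X3 X4 (X5 ∪ elems B)) X
    U = ⋃-family₅-⊆ {X = X} (⊆-trans (⁅x⁆⊆p {f = X1} cX1) (⊆-⋃ X v1)) (⊆-⋃ X v2) (⊆-⋃ X v3) (⊆-⋃ X v4)
        (∪-least (⊆-⋃ X v5) (⊆-trans subB (⊆-⋃ X v1)))

  singleton-X₂-unique-contact : ∀ {X : Fin 5 → FinPred n} → (M : F₂-Model X) →
    (W : PathIn (X v2) (NbrOf (X v3)) (NbrOf (X v4))) →
    ∀ A c B → PathIn.vertices W ≡ A ++ c ∷ B → None (NbrOf (X v1)) A → NbrOf (X v1) c ≡ true →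
        None (NbrOf (X v1)) B →
    WithSingletonX₂ X
  singleton-X₂-unique-contact {X} M (mkPath L ch nd' sb hd ls) A c B refl noneA nb1c noneB =
    family₅ (X v1) ⁅ c ⁆ (X v3 ∪ elems A) (X v4 ∪ elems B) (X v5) , F₂-model cert , (c , ⁅⁆-IsSingleton c) , U
    where
    open Parts M
    cX2 : X2 c ≡ true
    cX2 = sb c (elem-middle A c B)
    subA : elems A ⊆ X2
    subA = ⊆-trans (prefix-⊆ A c B) sb
    subB : elems B ⊆ X2
    subB = ⊆-trans (suffix-⊆ A c B) sb
    ndi : DistinctSplit A c B
    ndi = Distinct-split A c B nd'
    cA : elem c A ≡ false
    cA = x∉prefix ndi
    cB : elem c B ≡ false
    cB = x∉suffix ndi
    dAB : Disjoint (elems A) (elems B)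
    dAB = prefix#suffix ndi
    cert : F₂-Conditions X1 ⁅ c ⁆ (X3 ∪ elems A) (X4 ∪ elems B) X5
    cert = record
      { n1 = nonempty v1 ; n2 = c , x∈⁅x⁆ c
      ; n3 = proj₁ (nonempty v3) , ∪-introˡ {f = X3} (elems A) (proj₂ (nonempty v3))
      ; n4 = proj₁ (nonempty v4) , ∪-introˡ {f = X4} (elems B) (proj₂ (nonempty v4)) ; n5 = nonempty v5
      ; c1 = connected v1 ; c2 = connected-⁅⁆ c ; c3 = connected-∪-prefix A c B (connected v3) ch hd
      ; c4 = connected-∪-suffix A c B (connected v4) ch ls ; c5 = connected v5
      ; d12 = Disjoint-sym (Disjoint-⁅⁆ (∉-Disjoint D21 cX2))
      ; d13 = Disjoint-∪ʳ D13 (Disjoint-mono ⊆-refl subA D12)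
      ; d14 = Disjoint-∪ʳ D14 (Disjoint-mono ⊆-refl subB D12)
      ; d15 = D15
      ; d23 = Disjoint-⁅⁆ (∨-false (X3 c) (∉-Disjoint D23 cX2) cA)
      ; d24 = Disjoint-⁅⁆ (∨-false (X4 c) (∉-Disjoint D24 cX2) cB)
      ; d25 = Disjoint-⁅⁆ (∉-Disjoint D25 cX2)
      ; d34 = Disjoint-∪ˡ (Disjoint-∪ʳ D34 (Disjoint-mono ⊆-refl subB D32))
          (Disjoint-∪ʳ (Disjoint-mono subA ⊆-refl D24) dAB)
      ; d35 = Disjoint-∪ˡ D35 (Disjoint-mono subA ⊆-refl D25)
      ; d45 = Disjoint-∪ˡ D45 (Disjoint-mono subB ⊆-refl D25)
      ; t12 = NbrOf⇒Touches X1 ⁅ c ⁆ c (x∈⁅x⁆ c) nb1c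
      ; t15 = T15
      ; t23 = middle-touches-prefix A c B ch hd
      ; t24 = middle-touches-suffix A c B ch ls
      ; t34 = Touches-mono (p⊆p∪q {f = X3} (elems A)) (p⊆p∪q {f = X4} (elems B)) T34
      ; t35 = Touches-mono (p⊆p∪q {f = X3} (elems A)) ⊆-refl T35
      ; t45 = Touches-mono (p⊆p∪q {f = X4} (elems B)) ⊆-refl T45
      ; x13 = NoEdge-∪ʳ N13 (None-NbrOf⇒NoEdge X1 A noneA)
      ; x14 = NoEdge-∪ʳ N14 (None-NbrOf⇒NoEdge X1 B noneB)
      ; x25 = NoEdge-mono (⁅x⁆⊆p {f = X2} cX2) ⊆-refl N25
      }
    U : Within (family₅ X1 ⁅ c ⁆ (X3 ∪ elems A) (X4 ∪ elems B) X5) X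
    U = ⋃-family₅-⊆ {X = X} (⊆-⋃ X v1) (⊆-trans (⁅x⁆⊆p {f = X2} cX2) (⊆-⋃ X v2))
        (∪-least (⊆-⋃ X v3) (⊆-trans subA (⊆-⋃ X v2))) (∪-least (⊆-⋃ X v4) (⊆-trans subB (⊆-⋃ X v2)))
        (⊆-⋃ X v5)

  -- x, X₁, the two sides of the X₅-path and X₃ ∪ X₄ ∪ A take the roles 1–5; y is left unused.
  smaller-two-X₁-contacts : ∀ {X : Fin 5 → FinPred n} → (M : F₂-Model X) →
    (W : PathIn (X v2) (NbrOf (X v3)) (NbrOf (X v4))) → ∀ A x R → PathIn.vertices W ≡ A ++ x ∷ R →
        None (NbrOf (X v1)) A → NbrOf (X v1) x ≡ true → ∀ y → elem y R ≡ true → NbrOf (X v1) y ≡ true →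
    (W5 : PathIn (X v5) (NbrOf (X v3)) (NbrOf (X v4))) → ∀ A5 y5 B5 → PathIn.vertices W5 ≡ A5 ++ y5 ∷ B5 →
        NbrOf (X v1) y5 ≡ true → None (NbrOf (X v1)) B5 → ∀ z → elem z A5 ≡ true → NbrOf (X v1) z ≡ true →
    Smaller X
  smaller-two-X₁-contacts {X} M (mkPath L ch nd' sb hd ls) A x R refl noneA nbx y yR nby
      (mkPath L5 ch5 nd5 sb5 hd5 ls5) A5 y5 B5 refl nby5 noneB5 z zA5 nbz =
    family₅ ⁅ x ⁆ (X v1) (elems A5) (elems (y5 ∷ B5)) ((X v3 ∪ X v4) ∪ elems A) , F₂-model cert , U , y ,
        ⋃-intro X v2 y yX2 , Uf
    where
    open Parts M
    xX2 : X2 x ≡ true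
    xX2 = sb x (elem-middle A x R)
    yX2 : X2 y ≡ true
    yX2 = sb y (suffix-⊆ A x R y yR)
    subA : elems A ⊆ X2
    subA = ⊆-trans (prefix-⊆ A x R) sb
    subA5 : elems A5 ⊆ X5
    subA5 = ⊆-trans (prefix-⊆ A5 y5 B5) sb5
    subY5 : elems (y5 ∷ B5) ⊆ X5
    subY5 = ⊆-trans (⊆-++ʳ A5 (y5 ∷ B5)) sb5
    ndi : DistinctSplit A x R
    ndi = Distinct-split A x R nd'
    ndi5 : DistinctSplit A5 y5 B5
    ndi5 = Distinct-split A5 y5 B5 nd5
    X5' : FinPred n
    X5' = (X3 ∪ X4) ∪ elems A
    dX5 : Disjoint X5 X5'
    dX5 = Disjoint-∪ʳ (Disjoint-∪ʳ D53 D54) (Disjoint-mono ⊆-refl subA D52)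
    hd' : HeadIn (NbrOf (X3 ∪ X4)) (A ++ x ∷ R)
    hd' = HeadIn-mono (NbrOf X3) (NbrOf (X3 ∪ X4)) (A ++ x ∷ R) (NbrOf-mono (p⊆p∪q {f = X3} X4)) hd
    sub5' : X3 ∪ X4 ⊆ X5'
    sub5' = p⊆p∪q {f = X3 ∪ X4} (elems A)
    neA5 : A5 ≢ []
    neA5 e = lem e zA5
      where
      lem : A5 ≡ [] → elem z A5 ≡ true → ⊥
      lem refl ()
    t34' : Touches (elems A5) (elems (y5 ∷ B5))
    t34' with LastAdj-elem A5 y5 (last-adj (IsPath-split A5 y5 B5 ch5))
    ... | inj₁ e = ⊥-elim (neA5 e)
    ... | inj₂ (w , m , e) = w , y5 , m , elem-head y5 B5 , e
    t35' : Touches (elems A5) X5'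
    t35' with prefix-touches {S = X3} A5 y5 B5 hd5
    ... | inj₁ e = ⊥-elim (neA5 e)
    ... | inj₂ t = Touches-mono ⊆-refl (⊆-trans (p⊆p∪q {f = X3} X4) sub5') (Touches-sym t)
    t45' : Touches (elems (y5 ∷ B5)) X5'
    t45' = Touches-mono ⊆-refl (⊆-trans (q⊆p∪q X3 {X4}) sub5')
        (Touches-sym (elem-NbrOf⇒Touches X4 (y5 ∷ B5)
        (LastIn-elem (NbrOf X4) (y5 ∷ B5) (LastIn-++⁻ (NbrOf X4) A5 (y5 ∷ B5) ls5 (λ ())))))
    cert : F₂-Conditions ⁅ x ⁆ X1 (elems A5) (elems (y5 ∷ B5)) X5'
    cert = record
      { n1 = x , x∈⁅x⁆ x ; n2 = nonempty v1 ; n3 = z , zA5 ; n4 = y5 , elem-head y5 B5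
      ; n5 = proj₁ (nonempty v3) , sub5' _ (∪-introˡ {f = X3} X4 (proj₂ (nonempty v3)))
      ; c1 = connected-⁅⁆ x ; c2 = connected v1
      ; c3 = path-connected A5 (prefix-path (IsPath-split A5 y5 B5 ch5)) neA5
      ; c4 = path-connected (y5 ∷ B5) (suffix-path (IsPath-split A5 y5 B5 ch5)) (λ ())
      ; c5 = connected-∪-prefix A x R (connected-∪ (connected v3) (connected v4) T34) ch hd'
      ; d12 = Disjoint-⁅⁆ (∉-Disjoint D21 xX2)
      ; d13 = Disjoint-mono (⁅x⁆⊆p {f = X2} xX2) subA5 D25
      ; d14 = Disjoint-mono (⁅x⁆⊆p {f = X2} xX2) subY5 D25
      ; d15 = Disjoint-⁅⁆ (∨-false ((X3 ∪ X4) x) (∨-false (X3 x) (∉-Disjoint D23 xX2) (∉-Disjoint D24 xX2))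
          (x∉prefix ndi))
      ; d23 = Disjoint-mono ⊆-refl subA5 D15
      ; d24 = Disjoint-mono ⊆-refl subY5 D15
      ; d25 = Disjoint-∪ʳ (Disjoint-∪ʳ D13 D14) (Disjoint-mono ⊆-refl subA D12)
      ; d34 = Disjoint-∪ʳ (Disjoint-sym (Disjoint-⁅⁆ (x∉prefix ndi5))) (prefix#suffix ndi5)
      ; d35 = Disjoint-mono subA5 ⊆-refl dX5
      ; d45 = Disjoint-mono subY5 ⊆-refl dX5
      ; t12 = Touches-sym (NbrOf⇒Touches X1 ⁅ x ⁆ x (x∈⁅x⁆ x) nbx)
      ; t15 = middle-touches-prefix A x R ch hd'
      ; t23 = elem-NbrOf⇒Touches X1 A5 (z , zA5 , nbz)
      ; t24 = elem-NbrOf⇒Touches X1 (y5 ∷ B5) (y5 , elem-head y5 B5 , nby5)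
      ; t34 = t34'
      ; t35 = t35'
      ; t45 = t45'
      ; x13 = NoEdge-mono (⁅x⁆⊆p {f = X2} xX2) subA5 N25
      ; x14 = NoEdge-mono (⁅x⁆⊆p {f = X2} xX2) subY5 N25
      ; x25 = NoEdge-∪ʳ (NoEdge-∪ʳ N13 N14) (None-NbrOf⇒NoEdge X1 A noneA)
      }
    U : Within (family₅ ⁅ x ⁆ X1 (elems A5) (elems (y5 ∷ B5)) X5') X
    U = ⋃-family₅-⊆ {X = X} (⊆-trans (⁅x⁆⊆p {f = X2} xX2) (⊆-⋃ X v2)) (⊆-⋃ X v1) (⊆-trans subA5 (⊆-⋃ X v5))
        (⊆-trans subY5 (⊆-⋃ X v5))
          (∪-least (∪-least (⊆-⋃ X v3) (⊆-⋃ X v4)) (⊆-trans subA (⊆-⋃ X v2)))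
    yx : ⁅ x ⁆ y ≡ false
    yx = x≢y⇒x∉⁅y⁆ (λ e → true≢false (subst (λ w → elem w R ≡ true) e yR) (x∉suffix ndi))
    Uf : ⋃ (family₅ ⁅ x ⁆ X1 (elems A5) (elems (y5 ∷ B5)) X5') y ≡ false
    Uf = ∉-⋃-family₅ {A = ⁅ x ⁆} {B = X1} {C = elems A5} {D = elems (y5 ∷ B5)} {E = X5'} y yx
        (∉-Disjoint D21 yX2)
           (∉-⊆ A5 y subA5 (∉-Disjoint D25 yX2)) (∉-⊆ (y5 ∷ B5) y subY5 (∉-Disjoint D25 yX2))
           (∨-false ((X3 ∪ X4) y) (∨-false (X3 y) (∉-Disjoint D23 yX2) (∉-Disjoint D24 yX2))
               (≢true⇒false (λ m → prefix#suffix ndi y m yR)))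

  record Connector (X1 X2 : FinPred n) (L R : List (Fin n)) : Set where
    constructor mkConnector
    field
      R-path : IsPath R
      R-distinct : Distinct R
      R⊆X₂ : elems R ⊆ X2
      R-disjoint-P : Disjoint (elems R) (elems L)
      R-head-adj : HeadIn (AdjTo L) R
      R-last-nbr : LastIn (NbrOf X1) R

  singleton-X₂-at-X₄-contact : ∀ {X : Fin 5 → FinPred n} → (M : F₂-Model X) →
    (W : PathIn (X v2) (NbrOf (X v3)) (NbrOf (X v4))) → None (NbrOf (X v1)) (PathIn.vertices W) →
    ∀ E wm → Connector (X v1) (X v2) (PathIn.vertices W) (E ++ wm ∷ []) → None (NbrOf (X v1)) E →
        NbrOf (X v4) wm ≡ true → WithSingletonX₂ X
  singleton-X₂-at-X₄-contact {X} M (mkPath L ch nd' sb hd ls) noneP E wm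
      (mkConnector R-path R-distinct R⊆X₂ R-disjoint-P R-head-adj R-last-nbr) noneE nb4 =
    family₅ (X v1) ⁅ wm ⁆ ((X v3 ∪ elems L) ∪ elems E) (X v4) (X v5) , F₂-model cert ,
        (wm , ⁅⁆-IsSingleton wm) , U
    where
    open Parts M
    nb1 : NbrOf X1 wm ≡ true
    nb1 = LastIn-++⁻ (NbrOf X1) E (wm ∷ []) R-last-nbr (λ ())
    wmX2 : X2 wm ≡ true
    wmX2 = R⊆X₂ wm (elem-middle E wm [])
    wm∉L : elem wm L ≡ false
    wm∉L = ∉-Disjoint R-disjoint-P (elem-middle E wm [])
    wm∉E : elem wm E ≡ false
    wm∉E = x∉prefix (Distinct-split E wm [] R-distinct)
    subE : elems E ⊆ X2
    subE = ⊆-trans (prefix-⊆ E wm []) R⊆X₂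
    X3' : FinPred n
    X3' = (X3 ∪ elems L) ∪ elems E
    cXL : IsConnected (X3 ∪ elems L)
    cXL = connected-∪-path L (connected v3) ch (inj₂ (elem-NbrOf⇒Touches X3 L (HeadIn-elem (NbrOf X3) L hd)))
    tLE' : ∀ E → HeadIn (AdjTo L) (E ++ wm ∷ []) → (E ≡ []) ⊎ Touches (X3 ∪ elems L) (elems E)
    tLE' [] _ = inj₁ refl
    tLE' (e ∷ E') h' with anyᴸ-elim (G e) L h'
    ... | b , mb , geb = inj₂ (b , e , ∪-introʳ X3 {elems L} mb , elem-head e E' , trans (G-sym b e) geb)
    tLE : (E ≡ []) ⊎ Touches (X3 ∪ elems L) (elems E)
    tLE = tLE' E R-head-adj
    t23g : ∀ E → HeadIn (AdjTo L) (E ++ wm ∷ []) → IsPath (E ++ wm ∷ []) →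
      Touches ⁅ wm ⁆ ((X3 ∪ elems L) ∪ elems E)
    t23g [] h' _ with anyᴸ-elim (G wm) L h'
    ... | b , mb , gwb = wm , b , x∈⁅x⁆ wm , ∪-introˡ {f = X3 ∪ elems L} (elems []) (∪-introʳ X3 {elems L} mb)
        , gwb
    t23g (e ∷ E') _ ch' with LastAdj-elem (e ∷ E') wm (last-adj (IsPath-split (e ∷ E') wm [] ch'))
    ... | inj₁ ()
    ... | inj₂ (z , mz , gzw) = wm , z , x∈⁅x⁆ wm , ∪-introʳ (X3 ∪ elems L) {elems (e ∷ E')} mz , trans
        (G-sym wm z) gzw
    t23' : Touches ⁅ wm ⁆ ((X3 ∪ elems L) ∪ elems E)
    t23' = t23g E R-head-adj R-path
    s3 : X3 ⊆ X3'
    s3 = ⊆-trans (p⊆p∪q {f = X3} (elems L)) (p⊆p∪q {f = X3 ∪ elems L} (elems E))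
    cert : F₂-Conditions X1 ⁅ wm ⁆ X3' X4 X5
    cert = record
      { n1 = nonempty v1 ; n2 = wm , x∈⁅x⁆ wm ; n3 = proj₁ (nonempty v3) , s3 _ (proj₂ (nonempty v3))
      ; n4 = nonempty v4 ; n5 = nonempty v5
      ; c1 = connected v1 ; c2 = connected-⁅⁆ wm
      ; c3 = connected-∪-path E cXL (prefix-path (IsPath-split E wm [] R-path)) tLE ; c4 = connected v4
      ; c5 = connected v5
      ; d12 = Disjoint-sym (Disjoint-⁅⁆ (∉-Disjoint D21 wmX2))
      ; d13 = Disjoint-∪ʳ (Disjoint-∪ʳ D13 (Disjoint-mono ⊆-refl sb D12)) (Disjoint-mono ⊆-refl subE D12)
      ; d14 = D14 ; d15 = D15
      ; d23 = Disjoint-⁅⁆ (∨-false ((X3 ∪ elems L) wm) (∨-false (X3 wm) (∉-Disjoint D23 wmX2) wm∉L) wm∉E)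
      ; d24 = Disjoint-⁅⁆ (∉-Disjoint D24 wmX2) ; d25 = Disjoint-⁅⁆ (∉-Disjoint D25 wmX2)
      ; d34 = Disjoint-∪ˡ (Disjoint-∪ˡ D34 (Disjoint-mono sb ⊆-refl D24)) (Disjoint-mono subE ⊆-refl D24)
      ; d35 = Disjoint-∪ˡ (Disjoint-∪ˡ D35 (Disjoint-mono sb ⊆-refl D25)) (Disjoint-mono subE ⊆-refl D25)
      ; d45 = D45
      ; t12 = NbrOf⇒Touches X1 ⁅ wm ⁆ wm (x∈⁅x⁆ wm) nb1
      ; t15 = T15 ; t23 = t23'
      ; t24 = Touches-sym (NbrOf⇒Touches X4 ⁅ wm ⁆ wm (x∈⁅x⁆ wm) nb4)
      ; t34 = Touches-mono s3 ⊆-refl T34 ; t35 = Touches-mono s3 ⊆-refl T35 ; t45 = T45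
      ; x13 = NoEdge-∪ʳ (NoEdge-∪ʳ N13 (None-NbrOf⇒NoEdge X1 L noneP)) (None-NbrOf⇒NoEdge X1 E noneE)
      ; x14 = N14
      ; x25 = NoEdge-mono (⁅x⁆⊆p {f = X2} wmX2) ⊆-refl N25
      }
    U : Within (family₅ X1 ⁅ wm ⁆ X3' X4 X5) X
    U = ⋃-family₅-⊆ {X = X} (⊆-⋃ X v1) (⊆-trans (⁅x⁆⊆p {f = X2} wmX2) (⊆-⋃ X v2))
          (∪-least (∪-least (⊆-⋃ X v3) (⊆-trans sb (⊆-⋃ X v2))) (⊆-trans subE (⊆-⋃ X v2))) (⊆-⋃ X v4)
              (⊆-⋃ X v5)

  singleton-X₂-at-attachment : ∀ {X : Fin 5 → FinPred n} → (M : F₂-Model X) →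
    (W : PathIn (X v2) (NbrOf (X v3)) (NbrOf (X v4))) → None (NbrOf (X v1)) (PathIn.vertices W) →
    ∀ h T → Connector (X v1) (X v2) (PathIn.vertices W) (h ∷ T) → None (AdjTo (PathIn.vertices W)) T →
        None (NbrOf (X v3)) (h ∷ T) → None (NbrOf (X v4)) (h ∷ T) →
    ∀ Pa pa Pb → PathIn.vertices W ≡ Pa ++ pa ∷ Pb → None (G h) Pa → G h pa ≡ true → None (G h) Pb →
        WithSingletonX₂ X
  singleton-X₂-at-attachment {X} M (mkPath L ch nd' sb hd ls) noneP h T
      (mkConnector R-path R-distinct R⊆X₂ R-disjoint-P R-head-adj R-last-nbr) noneT none3 none4 Pa pa Pb refl
      nPa ghpa nPb =
    family₅ (X v1 ∪ elems (h ∷ T)) ⁅ pa ⁆ (X v3 ∪ elems Pa) (X v4 ∪ elems Pb) (X v5) , F₂-model cert ,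
        (pa , ⁅⁆-IsSingleton pa) , U
    where
    open Parts M
    R : List (Fin n)
    R = h ∷ T
    L' : List (Fin n)
    L' = Pa ++ pa ∷ Pb
    paX2 : X2 pa ≡ true
    paX2 = sb pa (elem-middle Pa pa Pb)
    pa∉R : elem pa R ≡ false
    pa∉R = ∉-Disjoint (Disjoint-sym R-disjoint-P) (elem-middle Pa pa Pb)
    subPaL : elems Pa ⊆ elems L'
    subPaL = prefix-⊆ Pa pa Pb
    subPbL : elems Pb ⊆ elems L'
    subPbL = suffix-⊆ Pa pa Pb
    subPa : elems Pa ⊆ X2
    subPa = ⊆-trans subPaL sb
    subPb : elems Pb ⊆ X2
    subPb = ⊆-trans subPbL sb
    ndi : DistinctSplit Pa pa Pb
    ndi = Distinct-split Pa pa Pb nd'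
    nRQ : ∀ Q → elems Q ⊆ elems L' → None (G h) Q → NoEdge (elems R) (elems Q)
    nRQ Q s nq = NoEdge-∪ˡ {A = ⁅ h ⁆} {A' = elems T} (None-adj⇒NoEdge h Q nq)
        (NoEdge-mono ⊆-refl s (None-AdjTo⇒NoEdge L' T noneT))
    nXL : NoEdge X1 (elems L')
    nXL = None-NbrOf⇒NoEdge X1 L' noneP
    cert : F₂-Conditions (X1 ∪ elems R) ⁅ pa ⁆ (X3 ∪ elems Pa) (X4 ∪ elems Pb) X5
    cert = record
      { n1 = proj₁ (nonempty v1) , ∪-introˡ {f = X1} (elems R) (proj₂ (nonempty v1)) ; n2 = pa , x∈⁅x⁆ pa
      ; n3 = proj₁ (nonempty v3) , ∪-introˡ {f = X3} (elems Pa) (proj₂ (nonempty v3))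
      ; n4 = proj₁ (nonempty v4) , ∪-introˡ {f = X4} (elems Pb) (proj₂ (nonempty v4)) ; n5 = nonempty v5
      ; c1 = connected-∪-path R (connected v1) R-path
          (inj₂ (elem-NbrOf⇒Touches X1 R (LastIn-elem (NbrOf X1) R R-last-nbr)))
      ; c2 = connected-⁅⁆ pa ; c3 = connected-∪-prefix Pa pa Pb (connected v3) ch hd
      ; c4 = connected-∪-suffix Pa pa Pb (connected v4) ch ls ; c5 = connected v5
      ; d12 = Disjoint-sym (Disjoint-⁅⁆ (∨-false (X1 pa) (∉-Disjoint D21 paX2) pa∉R))
      ; d13 = Disjoint-∪ˡ (Disjoint-∪ʳ D13 (Disjoint-mono ⊆-refl subPa D12))
          (Disjoint-∪ʳ (Disjoint-mono R⊆X₂ ⊆-refl D23) (Disjoint-mono ⊆-refl subPaL R-disjoint-P))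
      ; d14 = Disjoint-∪ˡ (Disjoint-∪ʳ D14 (Disjoint-mono ⊆-refl subPb D12))
          (Disjoint-∪ʳ (Disjoint-mono R⊆X₂ ⊆-refl D24) (Disjoint-mono ⊆-refl subPbL R-disjoint-P))
      ; d15 = Disjoint-∪ˡ D15 (Disjoint-mono R⊆X₂ ⊆-refl D25)
      ; d23 = Disjoint-⁅⁆ (∨-false (X3 pa) (∉-Disjoint D23 paX2) (x∉prefix ndi))
      ; d24 = Disjoint-⁅⁆ (∨-false (X4 pa) (∉-Disjoint D24 paX2) (x∉suffix ndi))
      ; d25 = Disjoint-⁅⁆ (∉-Disjoint D25 paX2)
      ; d34 = Disjoint-∪ˡ (Disjoint-∪ʳ D34 (Disjoint-mono ⊆-refl subPb D32))
          (Disjoint-∪ʳ (Disjoint-mono subPa ⊆-refl D24) (prefix#suffix ndi))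
      ; d35 = Disjoint-∪ˡ D35 (Disjoint-mono subPa ⊆-refl D25)
      ; d45 = Disjoint-∪ˡ D45 (Disjoint-mono subPb ⊆-refl D25)
      ; t12 = h , pa , ∪-introʳ X1 {elems R} (elem-head h T) , x∈⁅x⁆ pa , ghpa
      ; t15 = Touches-mono (p⊆p∪q {f = X1} (elems R)) ⊆-refl T15
      ; t23 = middle-touches-prefix Pa pa Pb ch hd
      ; t24 = middle-touches-suffix Pa pa Pb ch ls
      ; t34 = Touches-mono (p⊆p∪q {f = X3} (elems Pa)) (p⊆p∪q {f = X4} (elems Pb)) T34
      ; t35 = Touches-mono (p⊆p∪q {f = X3} (elems Pa)) ⊆-refl T35
      ; t45 = Touches-mono (p⊆p∪q {f = X4} (elems Pb)) ⊆-refl T45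
      ; x13 = NoEdge-∪ˡ (NoEdge-∪ʳ N13 (NoEdge-mono ⊆-refl subPaL nXL))
          (NoEdge-∪ʳ (NoEdge-sym (None-NbrOf⇒NoEdge X3 R none3)) (nRQ Pa subPaL nPa))
      ; x14 = NoEdge-∪ˡ (NoEdge-∪ʳ N14 (NoEdge-mono ⊆-refl subPbL nXL))
          (NoEdge-∪ʳ (NoEdge-sym (None-NbrOf⇒NoEdge X4 R none4)) (nRQ Pb subPbL nPb))
      ; x25 = NoEdge-mono (⁅x⁆⊆p {f = X2} paX2) ⊆-refl N25
      }
    U : Within (family₅ (X1 ∪ elems R) ⁅ pa ⁆ (X3 ∪ elems Pa) (X4 ∪ elems Pb) X5) X
    U = ⋃-family₅-⊆ {X = X} (∪-least (⊆-⋃ X v1) (⊆-trans R⊆X₂ (⊆-⋃ X v2)))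
        (⊆-trans (⁅x⁆⊆p {f = X2} paX2) (⊆-⋃ X v2))
          (∪-least (⊆-⋃ X v3) (⊆-trans subPa (⊆-⋃ X v2))) (∪-least (⊆-⋃ X v4) (⊆-trans subPb (⊆-⋃ X v2)))
              (⊆-⋃ X v5)

  singleton-X₂-at-connector-head : ∀ {X : Fin 5 → FinPred n} → (M : F₂-Model X) →
    (W : PathIn (X v2) (NbrOf (X v3)) (NbrOf (X v4))) → None (NbrOf (X v1)) (PathIn.vertices W) →
    ∀ h T → Connector (X v1) (X v2) (PathIn.vertices W) (h ∷ T) → None (AdjTo (PathIn.vertices W)) T →
        None (NbrOf (X v3)) (h ∷ T) → None (NbrOf (X v4)) (h ∷ T) →
    ∀ Pa pa Pc pb Pd → PathIn.vertices W ≡ Pa ++ pa ∷ (Pc ++ pb ∷ Pd) → G h pa ≡ true → G h pb ≡ true →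
        WithSingletonX₂ X
  singleton-X₂-at-connector-head {X} M (mkPath L ch nd' sb hd ls) noneP h T
      (mkConnector R-path R-distinct R⊆X₂ R-disjoint-P R-head-adj R-last-nbr) noneT none3 none4 Pa pa Pc pb Pd
      refl ghpa ghpb =
    family₅ (X v1 ∪ elems T) ⁅ h ⁆ ((X v3 ∪ elems Pa) ∪ ⁅ pa ⁆) ((X v4 ∪ elems Pd) ∪ ⁅ pb ⁆) (X v5) , F₂-model
        cert , (h , ⁅⁆-IsSingleton h) , U
    where
    open Parts M
    L' : List (Fin n)
    L' = Pa ++ pa ∷ (Pc ++ pb ∷ Pd)
    Q : List (Fin n)
    Q = Pa ++ pa ∷ Pc
    eqQ : L' ≡ Q ++ pb ∷ Pd
    eqQ = sym (++-assoc Pa (pa ∷ Pc) (pb ∷ Pd))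
    ch' : IsPath (Q ++ pb ∷ Pd)
    ch' = subst IsPath eqQ ch
    nd'' : Distinct (Q ++ pb ∷ Pd)
    nd'' = subst Distinct eqQ nd'
    ls' : LastIn (NbrOf X4) (Q ++ pb ∷ Pd)
    ls' = subst (LastIn (NbrOf X4)) eqQ ls
    sQL : elems (Q ++ pb ∷ Pd) ⊆ elems L'
    sQL = subst (λ Z → elems (Q ++ pb ∷ Pd) ⊆ elems Z) (sym eqQ) ⊆-refl
    subPaL : elems Pa ⊆ elems L'
    subPaL = prefix-⊆ Pa pa (Pc ++ pb ∷ Pd)
    paL : elem pa L' ≡ true
    paL = elem-middle Pa pa (Pc ++ pb ∷ Pd)
    pbL : elem pb L' ≡ true
    pbL = sQL pb (elem-middle Q pb Pd)
    subPdL : elems Pd ⊆ elems L'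
    subPdL = ⊆-trans (suffix-⊆ Q pb Pd) sQL
    subQL : elems Q ⊆ elems L'
    subQL = ⊆-trans (⊆-++ˡ Q (pb ∷ Pd)) sQL
    subPa : elems Pa ⊆ X2
    subPa = ⊆-trans subPaL sb
    subPd : elems Pd ⊆ X2
    subPd = ⊆-trans subPdL sb
    subQ : elems Q ⊆ X2
    subQ = ⊆-trans subQL sb
    paX2 : X2 pa ≡ true
    paX2 = sb pa paL
    pbX2 : X2 pb ≡ true
    pbX2 = sb pb pbL
    hX2 : X2 h ≡ true
    hX2 = R⊆X₂ h (elem-head h T)
    h∉L : elem h L' ≡ false
    h∉L = ∉-Disjoint R-disjoint-P (elem-head h T)
    h∉T : elem h T ≡ false
    h∉T = proj₁ R-distinct
    subT : elems T ⊆ X2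
    subT = ⊆-trans (⊆-tail h T) R⊆X₂
    dTL : Disjoint (elems T) (elems L')
    dTL = Disjoint-mono (⊆-tail h T) ⊆-refl R-disjoint-P
    ndi2 : DistinctSplit Q pb Pd
    ndi2 = Distinct-split Q pb Pd nd''
    X3' : FinPred n
    X3' = (X3 ∪ elems Pa) ∪ ⁅ pa ⁆
    X4' : FinPred n
    X4' = (X4 ∪ elems Pd) ∪ ⁅ pb ⁆
    sX3 : X3' ⊆ X3 ∪ elems Q
    sX3 = ∪-least (∪-least (p⊆p∪q {f = X3} (elems Q)) (⊆-trans (⊆-++ˡ Pa (pa ∷ Pc)) (q⊆p∪q X3 {elems Q})))
        (⁅x⁆⊆p {f = X3 ∪ elems Q} (∪-introʳ X3 {elems Q} (elem-middle Pa pa Pc)))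
    sX4 : X4' ⊆ X4 ∪ elems (pb ∷ Pd)
    sX4 = ∪-least (∪-least (p⊆p∪q {f = X4} (elems (pb ∷ Pd)))
        (⊆-trans (⊆-tail pb Pd) (q⊆p∪q X4 {elems (pb ∷ Pd)})))
        (⁅x⁆⊆p {f = X4 ∪ elems (pb ∷ Pd)} (∪-introʳ X4 {elems (pb ∷ Pd)} (elem-head pb Pd)))
    sX3L : X3' ⊆ X3 ∪ elems L'
    sX3L = ⊆-trans sX3 (∪-least (p⊆p∪q {f = X3} (elems L')) (⊆-trans subQL (q⊆p∪q X3 {elems L'})))
    sX4L : X4' ⊆ X4 ∪ elems L'
    sX4L = ⊆-trans sX4 (∪-least (p⊆p∪q {f = X4} (elems L'))
        (⊆-trans (∷-⊆ pb Pd pbL subPdL) (q⊆p∪q X4 {elems L'})))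
    dQ4 : Disjoint (elems Q) (elems (pb ∷ Pd))
    dQ4 = Disjoint-∪ʳ {f = ⁅ pb ⁆} {g = elems Pd} (Disjoint-sym (Disjoint-⁅⁆ (x∉prefix ndi2)))
        (prefix#suffix ndi2)
    nXL : NoEdge X1 (elems L')
    nXL = None-NbrOf⇒NoEdge X1 L' noneP
    nTL : NoEdge (elems T) (elems L')
    nTL = None-AdjTo⇒NoEdge L' T noneT
    none3T : None (NbrOf X3) T
    none3T = None-⊆ (NbrOf X3) T (h ∷ T) (⊆-tail h T) none3
    none4T : None (NbrOf X4) T
    none4T = None-⊆ (NbrOf X4) T (h ∷ T) (⊆-tail h T) none4
    h∉X3' : X3' h ≡ false
    h∉X3' = ∨-false ((X3 ∪ elems Pa) h) (∨-false (X3 h) (∉-Disjoint D23 hX2) (∉-⊆ Pa h subPaL h∉L))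
        (x≢y⇒x∉⁅y⁆ (λ e → true≢false (subst (λ w → elem w L' ≡ true) (sym e) paL) h∉L))
    h∉X4' : X4' h ≡ false
    h∉X4' = ∨-false ((X4 ∪ elems Pd) h) (∨-false (X4 h) (∉-Disjoint D24 hX2) (∉-⊆ Pd h subPdL h∉L))
        (x≢y⇒x∉⁅y⁆ (λ e → true≢false (subst (λ w → elem w L' ≡ true) (sym e) pbL) h∉L))
    cert : F₂-Conditions (X1 ∪ elems T) ⁅ h ⁆ X3' X4' X5
    cert = record
      { n1 = proj₁ (nonempty v1) , ∪-introˡ {f = X1} (elems T) (proj₂ (nonempty v1)) ; n2 = h , x∈⁅x⁆ h
      ; n3 = pa , ∪-introʳ (X3 ∪ elems Pa) {⁅ pa ⁆} (x∈⁅x⁆ pa)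
      ; n4 = pb , ∪-introʳ (X4 ∪ elems Pd) {⁅ pb ⁆} (x∈⁅x⁆ pb) ; n5 = nonempty v5
      ; c1 = connected-∪-suffix [] h T (connected v1) R-path R-last-nbr
      ; c2 = connected-⁅⁆ h
      ; c3 = connected-∪ (connected-∪-prefix Pa pa (Pc ++ pb ∷ Pd) (connected v3) ch hd) (connected-⁅⁆ pa)
          (Touches-sym (middle-touches-prefix Pa pa (Pc ++ pb ∷ Pd) ch hd))
      ; c4 = connected-∪ (connected-∪-suffix Q pb Pd (connected v4) ch' ls') (connected-⁅⁆ pb)
          (Touches-sym (middle-touches-suffix Q pb Pd ch' ls'))
      ; c5 = connected v5
      ; d12 = Disjoint-∪ˡ {f = X1} {g = elems T} (Disjoint-sym (Disjoint-⁅⁆ (∉-Disjoint D21 hX2)))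
          (Disjoint-sym (Disjoint-⁅⁆ h∉T))
      ; d13 = Disjoint-mono (∪-least (p⊆p∪q {f = X1} (elems T)) (q⊆p∪q X1 {elems T})) sX3L
          (Disjoint-∪ˡ (Disjoint-∪ʳ D13 (Disjoint-mono ⊆-refl sb D12))
          (Disjoint-∪ʳ (Disjoint-mono subT ⊆-refl D23) dTL))
      ; d14 = Disjoint-mono (∪-least (p⊆p∪q {f = X1} (elems T)) (q⊆p∪q X1 {elems T})) sX4L
          (Disjoint-∪ˡ (Disjoint-∪ʳ D14 (Disjoint-mono ⊆-refl sb D12))
          (Disjoint-∪ʳ (Disjoint-mono subT ⊆-refl D24) dTL))
      ; d15 = Disjoint-∪ˡ D15 (Disjoint-mono subT ⊆-refl D25)
      ; d23 = Disjoint-⁅⁆ h∉X3'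
      ; d24 = Disjoint-⁅⁆ h∉X4'
      ; d25 = Disjoint-⁅⁆ (∉-Disjoint D25 hX2)
      ; d34 = Disjoint-mono sX3 sX4
          (Disjoint-∪ˡ (Disjoint-∪ʳ D34 (Disjoint-mono ⊆-refl (∷-⊆ pb Pd pbX2 subPd) D32))
          (Disjoint-∪ʳ (Disjoint-mono subQ ⊆-refl D24) dQ4))
      ; d35 = Disjoint-mono sX3 ⊆-refl (Disjoint-∪ˡ D35 (Disjoint-mono subQ ⊆-refl D25))
      ; d45 = Disjoint-mono sX4 ⊆-refl (Disjoint-∪ˡ D45 (Disjoint-mono (∷-⊆ pb Pd pbX2 subPd) ⊆-refl D25))
      ; t12 = Touches-sym (middle-touches-suffix [] h T R-path R-last-nbr)
      ; t15 = Touches-mono (p⊆p∪q {f = X1} (elems T)) ⊆-refl T15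
      ; t23 = h , pa , x∈⁅x⁆ h , ∪-introʳ (X3 ∪ elems Pa) {⁅ pa ⁆} (x∈⁅x⁆ pa) , ghpa
      ; t24 = h , pb , x∈⁅x⁆ h , ∪-introʳ (X4 ∪ elems Pd) {⁅ pb ⁆} (x∈⁅x⁆ pb) , ghpb
      ; t34 = Touches-mono (⊆-trans (p⊆p∪q {f = X3} (elems Pa)) (p⊆p∪q {f = X3 ∪ elems Pa} ⁅ pa ⁆))
          (⊆-trans (p⊆p∪q {f = X4} (elems Pd)) (p⊆p∪q {f = X4 ∪ elems Pd} ⁅ pb ⁆)) T34
      ; t35 = Touches-mono (⊆-trans (p⊆p∪q {f = X3} (elems Pa)) (p⊆p∪q {f = X3 ∪ elems Pa} ⁅ pa ⁆)) ⊆-refl T35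
      ; t45 = Touches-mono (⊆-trans (p⊆p∪q {f = X4} (elems Pd)) (p⊆p∪q {f = X4 ∪ elems Pd} ⁅ pb ⁆)) ⊆-refl T45
      ; x13 = NoEdge-mono (∪-least (p⊆p∪q {f = X1} (elems T)) (q⊆p∪q X1 {elems T})) sX3L
          (NoEdge-∪ˡ (NoEdge-∪ʳ N13 nXL) (NoEdge-∪ʳ (NoEdge-sym (None-NbrOf⇒NoEdge X3 T none3T)) nTL))
      ; x14 = NoEdge-mono (∪-least (p⊆p∪q {f = X1} (elems T)) (q⊆p∪q X1 {elems T})) sX4L
          (NoEdge-∪ˡ (NoEdge-∪ʳ N14 nXL) (NoEdge-∪ʳ (NoEdge-sym (None-NbrOf⇒NoEdge X4 T none4T)) nTL))
      ; x25 = NoEdge-mono (⁅x⁆⊆p {f = X2} hX2) ⊆-refl N25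
      }
    U : Within (family₅ (X1 ∪ elems T) ⁅ h ⁆ X3' X4' X5) X
    U = ⋃-family₅-⊆ {X = X} (∪-least (⊆-⋃ X v1) (⊆-trans subT (⊆-⋃ X v2)))
        (⊆-trans (⁅x⁆⊆p {f = X2} hX2) (⊆-⋃ X v2))
          (⊆-trans sX3L (∪-least (⊆-⋃ X v3) (⊆-trans sb (⊆-⋃ X v2))))
              (⊆-trans sX4L (∪-least (⊆-⋃ X v4) (⊆-trans sb (⊆-⋃ X v2)))) (⊆-⋃ X v5)

  Connector-prefix : ∀ {X1 X2 : FinPred n} {L} A w B → Connector X1 X2 L (A ++ w ∷ B) → NbrOf X1 w ≡ true →
    Connector X1 X2 L (A ++ w ∷ [])
  Connector-prefix {X1} {X2} {L} A w B (mkConnector R-path R-distinct R⊆X₂ R-disjoint-P R-head-adj R-last-nbr)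
      nbw =
    mkConnector (IsPath-snoc-prefix A w B R-path) (Distinct-snoc-prefix A w B R-distinct)
        (⊆-trans (snoc-prefix-⊆ A w B) R⊆X₂) (Disjoint-mono (snoc-prefix-⊆ A w B) ⊆-refl R-disjoint-P)
        (HeadIn-retail (AdjTo L) A w B [] R-head-adj) (LastIn-snoc (NbrOf X1) A w nbw)

  Connector-suffix : ∀ {X1 X2 : FinPred n} {L} A z D → Connector X1 X2 L (A ++ z ∷ D) → AdjTo L z ≡ true →
    Connector X1 X2 L (z ∷ D)
  Connector-suffix {X1} {X2} {L} A z D (mkConnector R-path R-distinct R⊆X₂ R-disjoint-P R-head-adj R-last-nbr)
      adj with Distinct-split A z D R-distinct
  ... | distinctSplit _ zD _ _ ndD =
    mkConnector (suffix-path (IsPath-split A z D R-path)) (zD , ndD) (⊆-trans (⊆-++ʳ A (z ∷ D)) R⊆X₂)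
        (Disjoint-mono (⊆-++ʳ A (z ∷ D)) ⊆-refl R-disjoint-P)
        adj (LastIn-++⁻ (NbrOf X1) A (z ∷ D) R-last-nbr (λ ()))

  ConnectorIH : ℕ → Set
  ConnectorIH k = ∀ {X : Fin 5 → FinPred n} (M : F₂-Model X)
      (W : PathIn (X v2) (NbrOf (X v3)) (NbrOf (X v4))) → None (NbrOf (X v1)) (PathIn.vertices W) →
    ∀ R → Connector (X v1) (X v2) (PathIn.vertices W) R → length R ≤ k → WithSingletonX₂ X

  connector-X₄-contact : ∀ k → ConnectorIH k →
    ∀ {X : Fin 5 → FinPred n} (M : F₂-Model X) (W : PathIn (X v2) (NbrOf (X v3)) (NbrOf (X v4))) →
    None (NbrOf (X v1)) (PathIn.vertices W) →
    ∀ R → Connector (X v1) (X v2) (PathIn.vertices W) R → None (NbrOf (X v1)) (init R) → ∀ E wm F →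
        R ≡ E ++ wm ∷ F → NbrOf (X v4) wm ≡ true → length R ≤ suc k → WithSingletonX₂ X
  connector-X₄-contact k ih {X} M W noneP R inv OL E wm [] refl nb4 len = singleton-X₂-at-X₄-contact M W
      noneP E wm inv (subst (None (NbrOf (X v1))) (init-snoc E wm) OL) nb4
  connector-X₄-contact k ih {X} M (mkPath L ch nd' sb hd ls) noneP R
      (mkConnector R-path R-distinct R⊆X₂ R-disjoint-P R-head-adj R-last-nbr) OL E wm (f ∷ F) refl nb4 len
    with uncons (E ++ wm ∷ []) (∷ʳ≢[] E wm)
  ... | hq , Q' , eqh with first-split (G hq) L
      (subst (HeadIn (AdjTo L)) eqh (HeadIn-retail (AdjTo L) E wm (f ∷ F) [] R-head-adj))
  ... | Pa , pa , Pb , refl , _ , ghq = ih M W' noneP' (f ∷ F) inv'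
      (≤-pred (≤-trans (length-tail< E wm (f ∷ F)) len))
    where
    X1 : FinPred n
    X1 = X v1
    X2 : FinPred n
    X2 = X v2
    Q1 : List (Fin n)
    Q1 = E ++ wm ∷ []
    R0 : List (Fin n)
    R0 = E ++ wm ∷ f ∷ F
    P' : List (Fin n)
    P' = Pa ++ pa ∷ Q1
    ndi : DistinctSplit Pa pa Pb
    ndi = Distinct-split Pa pa Pb nd'
    chs : PathSplit Pa pa Pb
    chs = IsPath-split Pa pa Pb ch
    chQ1 : IsPath Q1
    chQ1 = IsPath-snoc-prefix E wm (f ∷ F) R-path
    chpa : PathFrom pa Q1
    chpa = subst (PathFrom pa) (sym eqh) (trans (G-sym pa hq) ghq , subst IsPath eqh chQ1)
    paL : elem pa L ≡ true
    paL = elem-middle Pa pa Pb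
    subPaL : elems Pa ⊆ elems L
    subPaL = prefix-⊆ Pa pa Pb
    sQ1R : elems Q1 ⊆ elems R0
    sQ1R = snoc-prefix-⊆ E wm (f ∷ F)
    pa∉Q1 : elem pa Q1 ≡ false
    pa∉Q1 = ∉-⊆ Q1 pa sQ1R (∉-Disjoint (Disjoint-sym R-disjoint-P) paL)
    ndP' : Distinct P'
    ndP' = Distinct-++⁺ Pa (pa ∷ Q1) (prefix-distinct ndi)
        (pa∉Q1 , Distinct-snoc-prefix E wm (f ∷ F) R-distinct)
             (Disjoint-∪ʳ {f = ⁅ pa ⁆} {g = elems Q1} (Disjoint-sym (Disjoint-⁅⁆ (x∉prefix ndi)))
                 (Disjoint-mono subPaL sQ1R (Disjoint-sym R-disjoint-P)))
    W' : PathIn X2 (NbrOf (X v3)) (NbrOf (X v4))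
    W' = mkPath P' (IsPath-join Pa pa Q1 (prefix-path chs) (last-adj chs) chpa) ndP'
           (++-⊆ Pa (pa ∷ Q1) (⊆-trans subPaL sb) (∷-⊆ pa Q1 (sb pa paL) (⊆-trans sQ1R R⊆X₂)))
           (HeadIn-retail (NbrOf (X v3)) Pa pa Pb Q1 hd)
           (LastIn-++⁺ (NbrOf (X v4)) Pa (pa ∷ Q1) (LastIn-snoc (NbrOf (X v4)) (pa ∷ E) wm nb4))
    noneP' : None (NbrOf X1) P'
    noneP' = None-++ (NbrOf X1) Pa (pa ∷ Q1) (None-⊆ (NbrOf X1) Pa L subPaL noneP)
               (None-∷ (NbrOf X1) pa Q1 (noneP pa paL)
                   (None-⊆ (NbrOf X1) Q1 (init R0) (init-prefix-⊆ E wm (f ∷ F) (λ ())) OL))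
    ndR : DistinctSplit E wm (f ∷ F)
    ndR = Distinct-split E wm (f ∷ F) R-distinct
    chwF : PathFrom wm (f ∷ F)
    chwF = suffix-path (IsPath-split E wm (f ∷ F) R-path)
    sP' : elems P' ⊆ elems L ∪ elems Q1
    sP' = ++-⊆ Pa (pa ∷ Q1) (⊆-trans subPaL (p⊆p∪q {f = elems L} (elems Q1)))
        (∷-⊆ pa Q1 (∪-introˡ {f = elems L} (elems Q1) paL) (q⊆p∪q (elems L) {elems Q1}))
    dFQ1 : Disjoint (elems (f ∷ F)) (elems Q1)
    dFQ1 x p q with elem-++-elim x E (wm ∷ []) q
    ... | inj₁ r = prefix#suffix ndR x r p
    ... | inj₂ r with elem-∷-elim x wm [] r
    ... | inj₁ refl = true≢false p (x∉suffix ndR)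
    ... | inj₂ ()
    wmP' : elem wm P' ≡ true
    wmP' = elem-++ʳ wm Pa (pa ∷ Q1) (elem-tail wm pa Q1 (elem-middle E wm []))
    inv' : Connector X1 X2 P' (f ∷ F)
    inv' = mkConnector (proj₂ chwF) (suffix-distinct ndR) (⊆-trans (suffix-⊆ E wm (f ∷ F)) R⊆X₂)
             (Disjoint-mono ⊆-refl sP'
                 (Disjoint-∪ʳ (Disjoint-mono (suffix-⊆ E wm (f ∷ F)) ⊆-refl R-disjoint-P) dFQ1))
             (anyᴸ-intro (G f) wm P' wmP' (trans (G-sym f wm) (proj₁ chwF)))
             (LastIn-++⁻ (NbrOf X1) E (wm ∷ f ∷ F) R-last-nbr (λ ()))

  connector-attached-at-head : ∀ k → ConnectorIH k →
    ∀ {X : Fin 5 → FinPred n} (M : F₂-Model X) (W : PathIn (X v2) (NbrOf (X v3)) (NbrOf (X v4))) →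
    None (NbrOf (X v1)) (PathIn.vertices W) →
    ∀ h T → Connector (X v1) (X v2) (PathIn.vertices W) (h ∷ T) → None (NbrOf (X v1)) (init (h ∷ T)) →
        None (AdjTo (PathIn.vertices W)) T → length (h ∷ T) ≤ suc k → WithSingletonX₂ X
  connector-attached-at-head k ih {X} M (mkPath L ch nd' sb hd ls) noneP h T inv OL noneT len with true⊎false
      (anyᴸ (NbrOf (X v4)) (h ∷ T))
  ... | inj₁ q with first-split (NbrOf (X v4)) (h ∷ T) q
  ... | E , wm , F , eq , _ , nb4 = connector-X₄-contact k ih M (mkPath L ch nd' sb hd ls) noneP (h ∷ T) inv
      OL E wm F eq nb4 len
  connector-attached-at-head k ih {X} M (mkPath L ch nd' sb hd ls) noneP h T inv OL noneT len | inj₂ q4 with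
      true⊎false (anyᴸ (NbrOf (X v3)) (h ∷ T))
  ... | inj₁ q with first-split (NbrOf (X v3)) (h ∷ T) q
  ... | E , wm , F , eq , _ , nb3 with connector-X₄-contact k ih (model-swap₃₄ M)
      (PathIn-reverse (mkPath L ch nd' sb hd ls)) (λ x m → noneP x (elem-reverse⁻ x L m)) (h ∷ T) invR OL E wm
      F eq nb3 len
    where
    invR : Connector (X v1) (X v2) (reverse L) (h ∷ T)
    invR = mkConnector (Connector.R-path inv) (Connector.R-distinct inv) (Connector.R⊆X₂ inv)
        (λ x p q → Connector.R-disjoint-P inv x p (elem-reverse⁻ x L q))
             (HeadIn-mono (AdjTo L) (AdjTo (reverse L)) (h ∷ T) (λ z p → trans (anyᴸ-reverse (G z) L) p)
                 (Connector.R-head-adj inv)) (Connector.R-last-nbr inv)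
  ... | X' , M' , s , U = X' , M' , s , ⊆-trans U (reindex-⋃ X swap₃₄)
  connector-attached-at-head k ih {X} M (mkPath L ch nd' sb hd ls) noneP h T inv OL noneT len | inj₂ q4 | inj₂
      q3
    with first-split (G h) L (Connector.R-head-adj inv)
  ... | Pa , pa , Pb , eqL , nPa , ghpa with true⊎false (anyᴸ (G h) Pb)
  ... | inj₂ f = singleton-X₂-at-attachment M (mkPath L ch nd' sb hd ls) noneP h T inv noneT
      (anyᴸ-false _ (h ∷ T) q3) (anyᴸ-false _ (h ∷ T) q4) Pa pa Pb eqL nPa ghpa (anyᴸ-false _ Pb f)
  ... | inj₁ t with first-split (G h) Pb t
  ... | Pc , pb , Pd , eqb , _ , ghpb = singleton-X₂-at-connector-head M (mkPath L ch nd' sb hd ls) noneP h T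
      inv noneT (anyᴸ-false _ (h ∷ T) q3) (anyᴸ-false _ (h ∷ T) q4) Pa pa Pc pb Pd
      (trans eqL (cong (λ Z → Pa ++ pa ∷ Z) eqb)) ghpa ghpb

  connector-last-contact : ∀ k → ConnectorIH k →
    ∀ {X : Fin 5 → FinPred n} (M : F₂-Model X) (W : PathIn (X v2) (NbrOf (X v3)) (NbrOf (X v4))) →
    None (NbrOf (X v1)) (PathIn.vertices W) →
    ∀ R → Connector (X v1) (X v2) (PathIn.vertices W) R → None (NbrOf (X v1)) (init R) → length R ≤ suc k →
        WithSingletonX₂ X
  connector-last-contact k ih M W noneP [] inv OL len = ⊥-elim (Connector.R-head-adj inv)
  connector-last-contact k ih {X} M W noneP (h ∷ T) inv OL len with true⊎false
      (anyᴸ (AdjTo (PathIn.vertices W)) T)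
  ... | inj₁ q with first-split (AdjTo (PathIn.vertices W)) T q
  ... | C , z , D , refl , _ , adjz = ih M W noneP (z ∷ D) (Connector-suffix (h ∷ C) z D inv adjz)
      (≤-pred (≤-trans (length-suffix< (h ∷ C) z D (λ ())) len))
  connector-last-contact k ih {X} M W noneP (h ∷ T) inv OL len | inj₂ f = connector-attached-at-head k ih M W
      noneP h T inv OL (anyᴸ-false _ T f) len

  connector-induction : ∀ k → ConnectorIH k
  connector-induction zero M W noneP [] inv len = ⊥-elim (Connector.R-head-adj inv)
  connector-induction zero M W noneP (x ∷ R) inv ()
  connector-induction (suc k) {X} M W noneP R inv len with first-split (NbrOf (X v1)) R
      (anyᴸ-LastIn (NbrOf (X v1)) R (Connector.R-last-nbr inv))
  ... | A , w , b ∷ B , refl , noneA , nbw = connector-induction k M W noneP (A ++ w ∷ [])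
      (Connector-prefix A w (b ∷ B) inv nbw) (≤-pred (≤-trans (length-snoc-prefix< A w (b ∷ B) (λ ())) len))
  ... | A , w , [] , refl , noneA , nbw = connector-last-contact k (connector-induction k) M W noneP
      (A ++ w ∷ []) inv (subst (None (NbrOf (X v1))) (sym (init-snoc A w)) noneA) len

  singleton-X₂-no-contact : ∀ {X : Fin 5 → FinPred n} → (M : F₂-Model X) →
    (W : PathIn (X v2) (NbrOf (X v3)) (NbrOf (X v4))) → None (NbrOf (X v1)) (PathIn.vertices W) →
    WithSingletonX₂ X
  singleton-X₂-no-contact {X} M (mkPath [] ch nd' sb () ls) noneP
  singleton-X₂-no-contact {X} M (mkPath (p0 ∷ L') ch nd' sb hd ls) noneP with Touches⇒NbrOf (X v1) (X v2)
      (Parts.T12 M)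
  ... | z , zX2 , nbz with ReachIn⇒path (ModelOf.connected M v2 p0 z (sb p0 (elem-head p0 L')) zX2)
  ... | M' , chM , sM , lsM with last-split (elems (p0 ∷ L')) (p0 ∷ M')
      (anyᴸ-intro (elems (p0 ∷ L')) p0 (p0 ∷ M') (elem-head p0 M') (elem-head p0 L'))
  ... | A , y , B , eqM , yL , noneB = from-tail B refl
    where
    L = p0 ∷ L'
    z∉L : elem z L ≡ false
    z∉L = ≢true⇒false (λ m → true≢false nbz (noneP z m))
    chA : IsPath (A ++ y ∷ B)
    chA = subst IsPath eqM chM
    sA : elems (A ++ y ∷ B) ⊆ X v2
    sA = subst (λ Z → elems Z ⊆ X v2) eqM (∷-⊆ p0 M' (sb p0 (elem-head p0 L')) sM)
    lsA : LastIn ⁅ z ⁆ (A ++ y ∷ B)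
    lsA = subst (LastIn ⁅ z ⁆) eqM lsM
    from-tail : ∀ B' → B' ≡ B → WithSingletonX₂ X
    from-tail [] refl = ⊥-elim (true≢false
        (subst (λ w → elem w L ≡ true) (x∈⁅y⁆⇒x≡y {c = z} {y} (LastIn-++⁻ ⁅ z ⁆ A (y ∷ []) lsA (λ ()))) yL)
        z∉L)
    from-tail (b ∷ B') refl = connector-induction (length R0) M (mkPath L ch nd' sb hd ls) noneP R0 inv ≤-refl
      where
      R0 : List (Fin n)
      R0 = eraseLoops (b ∷ B')
      chs : PathSplit A y (b ∷ B')
      chs = IsPath-split A y (b ∷ B') chA
      inv : Connector (X v1) (X v2) L R0
      inv = mkConnector (eraseLoops-path (b ∷ B') (proj₂ (suffix-path chs))) (eraseLoops-distinct (b ∷ B'))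
              (⊆-trans (eraseLoops-⊆ (b ∷ B')) (⊆-trans (suffix-⊆ A y (b ∷ B')) sA))
              (λ x p q → true≢false q (noneB x (eraseLoops-⊆ (b ∷ B') x p)))
              (eraseLoops-head (AdjTo L) (b ∷ B')
                  (anyᴸ-intro (G b) y L yL (trans (G-sym b y) (proj₁ (suffix-path chs)))))
              (eraseLoops-last (NbrOf (X v1)) (b ∷ B')
                  (LastIn-mono ⁅ z ⁆ (NbrOf (X v1)) (b ∷ B') (⁅x⁆⊆p {c = z} {f = NbrOf (X v1)} nbz)
                  (LastIn-++⁻ ⁅ z ⁆ A (y ∷ b ∷ B') lsA (λ ()))))

  X₃-X₄-path-in-X₂ : ∀ {X : Fin 5 → FinPred n} → F₂-Model X → PathIn (X v2) (NbrOf (X v3)) (NbrOf (X v4))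
  X₃-X₄-path-in-X₂ {X} M with Touches⇒NbrOf (X v3) (X v2) (Parts.T32 M) | Touches⇒NbrOf (X v4) (X v2)
      (Parts.T42 M)
  ... | x , px , nx | y , py , ny = path-between (ModelOf.connected M v2) x y px py nx ny

  unswap₂₅ : ∀ {X : Fin 5 → FinPred n} → WithSingletonX₂ (λ y → X (swap₂₅ y)) → WithSingletonX₂ X
  unswap₂₅ {X} (X' , M' , s , U) = X' , M' , s , ⊆-trans U (reindex-⋃ X swap₂₅)

  singleton-X₂ : ∀ {X : Fin 5 → FinPred n} → F₂-Model X → Smaller X ⊎ WithSingletonX₂ X
  singleton-X₂ {X} M with X₃-X₄-path-in-X₂ M
  ... | W with true⊎false (anyᴸ (NbrOf (X v1)) (PathIn.vertices W))
  ... | inj₂ f = inj₂ (singleton-X₂-no-contact M W (anyᴸ-false _ (PathIn.vertices W) f))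
  ... | inj₁ t with first-split (NbrOf (X v1)) (PathIn.vertices W) t
  ... | A , x , R , eq , noneA , px with true⊎false (anyᴸ (NbrOf (X v1)) R)
  ... | inj₂ f = inj₂ (singleton-X₂-unique-contact M W A x R eq noneA px (anyᴸ-false _ R f))
  ... | inj₁ t2 with anyᴸ-elim (NbrOf (X v1)) R t2 | X₃-X₄-path-in-X₂ (model-swap₂₅ M)
  ... | y , yR , py | W5 with true⊎false (anyᴸ (NbrOf (X v1)) (PathIn.vertices W5))
  ... | inj₂ f = inj₂ (unswap₂₅ {X = X}
      (singleton-X₂-no-contact (model-swap₂₅ M) W5 (anyᴸ-false _ (PathIn.vertices W5) f)))
  ... | inj₁ t5 with last-split (NbrOf (X v1)) (PathIn.vertices W5) t5
  ... | A5 , y5 , B5 , eq5 , py5 , noneB5 with true⊎false (anyᴸ (NbrOf (X v1)) A5)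
  ... | inj₂ f = inj₂ (unswap₂₅ {X = X}
      (singleton-X₂-unique-contact (model-swap₂₅ M) W5 A5 y5 B5 eq5 (anyᴸ-false _ A5 f) py5 noneB5))
  ... | inj₁ t6 with anyᴸ-elim (NbrOf (X v1)) A5 t6
  ... | z , zA5 , pz = inj₁
      (smaller-two-X₁-contacts M W A x R eq noneA px y yR py W5 A5 y5 B5 eq5 py5 noneB5 z zA5 pz)

  singletons : ∀ {X : Fin 5 → FinPred n} → F₂-Model X → Smaller X ⊎ WithSingletons X
  singletons {X} M with singleton-X₂ M
  ... | inj₁ s = inj₁ s
  ... | inj₂ (X' , M' , (c , sc) , U) with singleton-X₁ M'
  ... | X'' , M'' , (u , su) , eq2 , U' = inj₂
      (X'' , M'' , (u , su) , (c , subst (λ S → IsSingleton S c) (sym eq2) sc) , ⊆-trans U' U)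

  -- Bounding the degrees of u and r
  shrink-many-nbrs : ∀ {X : Fin 5 → FinPred n} → F₂-Model X → ∀ i (Y : FinPred n) → Y ⊆ X i →
    (∃ λ a → Y a ≡ true) → IsConnected Y →
    (∀ z → z ≢ i → F₂ i z ≡ true → Touches Y (X z)) → ∀ v a b →
        (∀ w → Y w ≡ true → G v w ≡ true → (w ≡ a) ⊎ (w ≡ b)) →
    ¬ (degIn G v (toSubset (X i)) ≤ 2) → Smaller X
  shrink-many-nbrs {X} M i Y s neY cY tY v a b two big with true⊎false
      (anyᶠ (λ w → (X i w ∧ G v w) ∧ not (Y w)))
  ... | inj₁ t with anyᶠ-elim (λ w → (X i w ∧ G v w) ∧ not (Y w)) t
  ... | w , q = replace X i Y , replace-model F₂-sym M i Y s neY cY tY , replace-strictly-within M i Y s w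
      (∧-elimˡ (X i w) (∧-elimˡ (X i w ∧ G v w) q)) (notY (Y w) (∧-elimʳ (X i w ∧ G v w) q))
    where
    notY : ∀ c → not c ≡ true → c ≡ false
    notY false _ = refl
    notY true ()
  shrink-many-nbrs {X} M i Y s neY cY tY v a b two big | inj₂ f = ⊥-elim (big (degIn-≤2 G v (X i) a b lem))
    where
    lem : ∀ w → X i w ≡ true → G v w ≡ true → (w ≡ a) ⊎ (w ≡ b)
    lem w xw gw with true⊎false (Y w)
    ... | inj₁ yw = two w yw gw
    ... | inj₂ yw = ⊥-elim (true≢false (lem2 (X i w ∧ G v w) (Y w) (∧-intro xw gw) yw) (anyᶠ-false _ f w))
      where
      lem2 : ∀ c d → c ≡ true → d ≡ false → (c ∧ not d) ≡ true
      lem2 true false refl refl = refl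

  singletons-adjacent : ∀ {X : Fin 5 → FinPred n} → F₂-Model X → ∀ {u r} → IsSingleton (X v1) u →
    IsSingleton (X v2) r → G u r ≡ true
  singletons-adjacent M (h1 , _) (h2 , _) with Parts.T12 M
  ... | a , b , p , q , e with h1 a p | h2 b q
  ... | refl | refl = e

  module DegreeX₃ {X : Fin 5 → FinPred n} (M : F₂-Model X) {u r : Fin n} (su : IsSingleton (X v1) u)
      (sr : IsSingleton (X v2) r)
           (big : ¬ (degIn G r (toSubset (X v3)) ≤ 2)) where
    open Parts M
    uX1 : X1 u ≡ true
    uX1 = proj₂ su
    rX2 : X2 r ≡ true
    rX2 = proj₂ sr

    -- X₅, X₄, {r} and the two sides of the path take the roles 1–5; u is left unused.
    relabel : ∀ Pre y Post → IsPath (Pre ++ y ∷ Post) → Distinct (Pre ++ y ∷ Post) →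
      elems (Pre ++ y ∷ Post) ⊆ X3 →
      HeadIn (NbrOf X4) (Pre ++ y ∷ Post) → LastIn (NbrOf X5) (Pre ++ y ∷ Post) → None (NbrOf X5) Pre →
          None (NbrOf X4) (y ∷ Post) →
      G r y ≡ true → ∀ p → elem p Pre ≡ true → G r p ≡ true → Smaller X
    relabel Pre y Post ch nd' sb hd ls n5 n4 gry p pPre grp =
      family₅ X5 X4 ⁅ r ⁆ (elems Pre) (elems (y ∷ Post)) , F₂-model cert , U , u , ⋃-intro X v1 u uX1 , Uf
      where
      subPre : elems Pre ⊆ X3
      subPre = ⊆-trans (prefix-⊆ Pre y Post) sb
      subY : elems (y ∷ Post) ⊆ X3
      subY = ⊆-trans (⊆-++ʳ Pre (y ∷ Post)) sb
      ndi : DistinctSplit Pre y Post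
      ndi = Distinct-split Pre y Post nd'
      chs : PathSplit Pre y Post
      chs = IsPath-split Pre y Post ch
      nePre : Pre ≢ []
      nePre e = lem e pPre
        where
        lem : Pre ≡ [] → elem p Pre ≡ true → ⊥
        lem refl ()
      t24' : Touches X4 (elems Pre)
      t24' with prefix-touches {S = X4} Pre y Post hd
      ... | inj₁ e = ⊥-elim (nePre e)
      ... | inj₂ t = t
      t45' : Touches (elems Pre) (elems (y ∷ Post))
      t45' with LastAdj-elem Pre y (last-adj chs)
      ... | inj₁ e = ⊥-elim (nePre e)
      ... | inj₂ (z , mz , e) = z , y , mz , elem-head y Post , e
      cert : F₂-Conditions X5 X4 ⁅ r ⁆ (elems Pre) (elems (y ∷ Post))
      cert = record
        { n1 = nonempty v5 ; n2 = nonempty v4 ; n3 = r , x∈⁅x⁆ r ; n4 = p , pPre ; n5 = y , elem-head y Post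
        ; c1 = connected v5 ; c2 = connected v4 ; c3 = connected-⁅⁆ r
        ; c4 = path-connected Pre (prefix-path chs) nePre
        ; c5 = path-connected (y ∷ Post) (suffix-path chs) (λ ())
        ; d12 = D54 ; d13 = Disjoint-sym (Disjoint-⁅⁆ (∉-Disjoint D25 rX2))
        ; d14 = Disjoint-mono ⊆-refl subPre D53 ; d15 = Disjoint-mono ⊆-refl subY D53
        ; d23 = Disjoint-sym (Disjoint-⁅⁆ (∉-Disjoint D24 rX2)) ; d24 = Disjoint-mono ⊆-refl subPre D43
        ; d25 = Disjoint-mono ⊆-refl subY D43
        ; d34 = Disjoint-mono (⁅x⁆⊆p {f = X2} rX2) subPre D23
        ; d35 = Disjoint-mono (⁅x⁆⊆p {f = X2} rX2) subY D23
        ; d45 = Disjoint-∪ʳ {f = ⁅ y ⁆} {g = elems Post} (Disjoint-sym (Disjoint-⁅⁆ (x∉prefix ndi)))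
            (prefix#suffix ndi)
        ; t12 = T54
        ; t15 = elem-NbrOf⇒Touches X5 (y ∷ Post)
            (LastIn-elem (NbrOf X5) (y ∷ Post) (LastIn-++⁻ (NbrOf X5) Pre (y ∷ Post) ls (λ ())))
        ; t23 = Touches-sym (Touches-singleton sr T24)
        ; t24 = t24'
        ; t34 = r , p , x∈⁅x⁆ r , pPre , grp
        ; t35 = r , y , x∈⁅x⁆ r , elem-head y Post , gry
        ; t45 = t45'
        ; x13 = NoEdge-mono ⊆-refl (⁅x⁆⊆p {f = X2} rX2) N52
        ; x14 = None-NbrOf⇒NoEdge X5 Pre n5
        ; x25 = None-NbrOf⇒NoEdge X4 (y ∷ Post) n4
        }
      U : Within (family₅ X5 X4 ⁅ r ⁆ (elems Pre) (elems (y ∷ Post))) X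
      U = ⋃-family₅-⊆ {X = X} (⊆-⋃ X v5) (⊆-⋃ X v4) (⊆-trans (⁅x⁆⊆p {f = X2} rX2) (⊆-⋃ X v2))
          (⊆-trans subPre (⊆-⋃ X v3)) (⊆-trans subY (⊆-⋃ X v3))
      Uf : ⋃ (family₅ X5 X4 ⁅ r ⁆ (elems Pre) (elems (y ∷ Post))) u ≡ false
      Uf = ∉-⋃-family₅ {A = X5} {B = X4} {C = ⁅ r ⁆} {D = elems Pre} {E = elems (y ∷ Post)} u
          (∉-Disjoint D15 uX1) (∉-Disjoint D14 uX1)
             (∉-Disjoint (Disjoint-mono ⊆-refl (⁅x⁆⊆p {f = X2} rX2) D12) uX1)
                 (∉-⊆ Pre u subPre (∉-Disjoint D13 uX1)) (∉-⊆ (y ∷ Post) u subY (∉-Disjoint D13 uX1))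

    touches-F₂-nbrs-of-v3 : ∀ (Y : FinPred n) → Touches Y X2 → Touches Y X4 → Touches Y X5 → ∀ z → z ≢ v3 →
      F₂ v3 z ≡ true → Touches Y (X z)
    touches-F₂-nbrs-of-v3 Y a b c zero h ()
    touches-F₂-nbrs-of-v3 Y a b c (suc zero) h e = a
    touches-F₂-nbrs-of-v3 Y a b c (suc (suc zero)) h e = ⊥-elim (h refl)
    touches-F₂-nbrs-of-v3 Y a b c (suc (suc (suc zero))) h e = b
    touches-F₂-nbrs-of-v3 Y a b c (suc (suc (suc (suc zero)))) h e = c

    r-has-nbr-in-X₃ : ∃ λ b → (X3 b ≡ true) × (G r b ≡ true)
    r-has-nbr-in-X₃ with Touches-singleton sr T23
    ... | a , b , p , q , e with x∈⁅y⁆⇒x≡y {c = r} {a} p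
    ... | refl = b , q , e

    shrink-along-path : ∀ x B → IsPath (x ∷ B) → Distinct (x ∷ B) → elems (x ∷ B) ⊆ X3 →
      HeadIn (NbrOf X4) (x ∷ B) → LastIn (NbrOf X5) (x ∷ B) →
      None (NbrOf X4) B → None (NbrOf X5) (init (x ∷ B)) → Smaller X
    shrink-along-path x B ch nd' sb hd ls n4 n5 with true⊎false (anyᴸ (G r) (x ∷ B))
    ... | inj₂ f with r-has-nbr-in-X₃
    ... | b , bX3 , grb with ReachIn⇒path (connected v3 x b (sb x (elem-head x B)) bX3)
    ... | M' , chM , sM , lsM with LastIn-elem ⁅ b ⁆ (x ∷ M') lsM
    ... | b' , mb' , eb' with x∈⁅y⁆⇒x≡y {c = b} {b'} eb'
    ... | refl with first-split (G r) (x ∷ M') (anyᴸ-intro (G r) b' (x ∷ M') mb' grb)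
    ... | A2 , c , B2 , eq2 , noneA2 , grc =
      shrink-many-nbrs M v3 Y subY (x , ∪-introˡ {f = elems (x ∷ B)} (elems R) (elem-head x B)) cY
        (touches-F₂-nbrs-of-v3 Y t2 t4 t5) r c c two big
      where
      R : List (Fin n)
      R = A2 ++ c ∷ []
      Y : FinPred n
      Y = elems (x ∷ B) ∪ elems R
      chR : IsPath R
      chR = IsPath-snoc-prefix A2 c B2 (subst IsPath eq2 chM)
      subR : elems R ⊆ X3
      subR = ⊆-trans (snoc-prefix-⊆ A2 c B2)
          (subst (λ Z → elems Z ⊆ X3) eq2 (∷-⊆ x M' (sb x (elem-head x B)) sM))
      subY : Y ⊆ X3
      subY = ∪-least sb subR
      cY : IsConnected Y
      cY = connected-∪-overlap (path-connected (x ∷ B) ch (λ ())) (path-connected R chR (∷ʳ≢[] A2 c))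
          (x , elem-head x B , head-elem-snoc-prefix x M' A2 c B2 eq2)
      two : ∀ w → Y w ≡ true → G r w ≡ true → (w ≡ c) ⊎ (w ≡ c)
      two w p q with ∪-elim (elems (x ∷ B)) (elems R) w p
      ... | inj₁ m = ⊥-elim (true≢false q (anyᴸ-false (G r) (x ∷ B) f w m))
      ... | inj₂ m with elem-++-elim w A2 (c ∷ []) m
      ... | inj₁ m' = ⊥-elim (true≢false q (noneA2 w m'))
      ... | inj₂ m' with elem-∷-elim w c [] m'
      ... | inj₁ e = inj₁ e
      ... | inj₂ ()
      t2 : Touches Y X2
      t2 = c , r , ∪-introʳ (elems (x ∷ B)) {elems R} (elem-middle A2 c []) , rX2 , trans (G-sym c r) grc
      t4 : Touches Y X4
      t4 = Touches-mono (p⊆p∪q {f = elems (x ∷ B)} (elems R)) ⊆-refl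
          (Touches-sym (elem-NbrOf⇒Touches X4 (x ∷ B) (x , elem-head x B , hd)))
      t5 : Touches Y X5
      t5 = Touches-mono (p⊆p∪q {f = elems (x ∷ B)} (elems R)) ⊆-refl
          (Touches-sym (elem-NbrOf⇒Touches X5 (x ∷ B) (LastIn-elem (NbrOf X5) (x ∷ B) ls)))
    shrink-along-path x B ch nd' sb hd ls n4 n5 | inj₁ t with last-split (G r) (x ∷ B) t
    ... | Pre , y , Post , eqy , gry , nonePost with true⊎false (anyᴸ (G r) Pre)
    ... | inj₂ f = shrink-many-nbrs M v3 (elems (x ∷ B)) sb (x , elem-head x B)
        (path-connected (x ∷ B) ch (λ ())) (touches-F₂-nbrs-of-v3 (elems (x ∷ B)) t2 t4 t5) r y y two big
      where
      two : ∀ w → elem w (x ∷ B) ≡ true → G r w ≡ true → (w ≡ y) ⊎ (w ≡ y)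
      two w p q with elem-++-elim w Pre (y ∷ Post) (subst (λ Z → elem w Z ≡ true) eqy p)
      ... | inj₁ m = ⊥-elim (true≢false q (anyᴸ-false (G r) Pre f w m))
      ... | inj₂ m with elem-∷-elim w y Post m
      ... | inj₁ e = inj₁ e
      ... | inj₂ m' = ⊥-elim (true≢false q (nonePost w m'))
      t2 : Touches (elems (x ∷ B)) X2
      t2 = y , r , subst (λ Z → elem y Z ≡ true) (sym eqy) (elem-middle Pre y Post) , rX2 , trans (G-sym y r)
          gry
      t4 : Touches (elems (x ∷ B)) X4
      t4 = Touches-sym (elem-NbrOf⇒Touches X4 (x ∷ B) (x , elem-head x B , hd))
      t5 : Touches (elems (x ∷ B)) X5
      t5 = Touches-sym (elem-NbrOf⇒Touches X5 (x ∷ B) (LastIn-elem (NbrOf X5) (x ∷ B) ls))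
    ... | inj₁ t' with anyᴸ-elim (G r) Pre t'
    ... | p , pPre , grp =
      relabel Pre y Post (subst IsPath eqy ch) (subst Distinct eqy nd') (subst (λ Z → elems Z ⊆ X3) eqy sb)
        (subst (HeadIn (NbrOf X4)) eqy hd) (subst (LastIn (NbrOf X5)) eqy ls)
        (None-⊆ (NbrOf X5) Pre (init (Pre ++ y ∷ Post)) (pre-init Pre y Post)
          (subst (λ Z → None (NbrOf X5) (init Z)) eqy n5))
        (n4' Pre eqy pPre) gry p pPre grp
      where
      n4' : ∀ Pre → x ∷ B ≡ Pre ++ y ∷ Post → elem p Pre ≡ true → None (NbrOf X4) (y ∷ Post)
      n4' [] e ()
      n4' (p0 ∷ Pre') e _ with ∷-injective e
      ... | _ , eB = None-⊆ (NbrOf X4) (y ∷ Post) B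
          (subst (λ Z → elems (y ∷ Post) ⊆ elems Z) (sym eB) (⊆-++ʳ Pre' (y ∷ Post))) n4

    trim-path : ∀ k L → IsPath L → Distinct L → elems L ⊆ X3 → HeadIn (NbrOf X4) L → LastIn (NbrOf X5) L →
      length L ≤ k → Smaller X
    trim-path zero [] ch nd' sb () ls len
    trim-path zero (x ∷ L) ch nd' sb hd ls ()
    trim-path (suc k) L ch nd' sb hd ls len with last-split (NbrOf X4) L (anyᴸ-HeadIn (NbrOf X4) L hd)
    ... | a ∷ A , x , B , refl , nb4 , noneB with Distinct-split (a ∷ A) x B nd'
    ... | distinctSplit _ xB _ _ ndB =
      trim-path k (x ∷ B) (suffix-path (IsPath-split (a ∷ A) x B ch)) (xB , ndB)
        (⊆-trans (⊆-++ʳ (a ∷ A) (x ∷ B)) sb) nb4 (LastIn-++⁻ (NbrOf X5) (a ∷ A) (x ∷ B) ls (λ ()))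
        (≤-pred (≤-trans (length-suffix< (a ∷ A) x B (λ ())) len))
    trim-path (suc k) L ch nd' sb hd ls len | [] , x , B , refl , nb4 , noneB with first-split (NbrOf X5)
        (x ∷ B) (anyᴸ-LastIn (NbrOf X5) (x ∷ B) ls)
    ... | A' , x' , [] , eq' , noneA' , nb5 = shrink-along-path x B ch nd' sb hd ls noneB
        (subst (λ Z → None (NbrOf X5) (init Z)) (sym eq')
            (subst (None (NbrOf X5)) (sym (init-snoc A' x')) noneA'))
    ... | A' , x' , b ∷ B' , eq' , noneA' , nb5 =
      trim-path k (A' ++ x' ∷ []) (IsPath-snoc-prefix A' x' (b ∷ B') (subst IsPath eq' ch))
        (Distinct-snoc-prefix A' x' (b ∷ B') (subst Distinct eq' nd'))
        (⊆-trans (snoc-prefix-⊆ A' x' (b ∷ B')) (subst (λ Z → elems Z ⊆ X3) eq' sb))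
        (HeadIn-retail (NbrOf X4) A' x' (b ∷ B') [] (subst (HeadIn (NbrOf X4)) eq' hd))
        (LastIn-snoc (NbrOf X5) A' x' nb5)
        (≤-pred (≤-trans (length-snoc-prefix< A' x' (b ∷ B') (λ ()))
          (≤-trans (≤-reflexive (cong length (sym eq'))) len)))

    smaller : Smaller X
    smaller with Touches⇒NbrOf X4 X3 T43 | Touches⇒NbrOf X5 X3 T53
    ... | x , px , nx | y , py , ny with path-between {S = X3} {P = NbrOf X4} {Q = NbrOf X5} (connected v3) x
        y px py nx ny
    ... | mkPath L ch nd' sb hd ls = trim-path (length L) L ch nd' sb hd ls ≤-refl

  module DegreeX₅ {X : Fin 5 → FinPred n} (M : F₂-Model X) {u r : Fin n} (su : IsSingleton (X v1) u)
      (sr : IsSingleton (X v2) r)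
           (big : ¬ (degIn G u (toSubset (X v5)) ≤ 2)) where
    open Parts M
    uX1 : X1 u ≡ true
    uX1 = proj₂ su
    rX2 : X2 r ≡ true
    rX2 = proj₂ sr
    gur : G u r ≡ true
    gur = singletons-adjacent M su sr

    touches-F₂-nbrs-of-v5 : ∀ (Y : FinPred n) → Touches Y X1 → Touches Y X3 → Touches Y X4 → ∀ z → z ≢ v5 →
      F₂ v5 z ≡ true → Touches Y (X z)
    touches-F₂-nbrs-of-v5 Y a b c zero h e = a
    touches-F₂-nbrs-of-v5 Y a b c (suc zero) h ()
    touches-F₂-nbrs-of-v5 Y a b c (suc (suc zero)) h e = b
    touches-F₂-nbrs-of-v5 Y a b c (suc (suc (suc zero))) h e = c
    touches-F₂-nbrs-of-v5 Y a b c (suc (suc (suc (suc zero)))) h e = ⊥-elim (h refl)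

    u-has-nbr-in-X₅ : ∃ λ b → (X5 b ≡ true) × (G u b ≡ true)
    u-has-nbr-in-X₅ with Touches-singleton su T15
    ... | a , b , p , q , e with x∈⁅y⁆⇒x≡y {c = u} {a} p
    ... | refl = b , q , e

    -- x, u, r, X₄ ∪ Rest and X₃ ∪ Pre take the roles 1–5; y is left unused.
    relabel : ∀ Pre x y Rest → IsPath (Pre ++ x ∷ y ∷ Rest) → Distinct (Pre ++ x ∷ y ∷ Rest) →
      elems (Pre ++ x ∷ y ∷ Rest) ⊆ X5 →
      HeadIn (NbrOf X3) (Pre ++ x ∷ y ∷ Rest) → LastIn (NbrOf X4) (Pre ++ x ∷ y ∷ Rest) → NbrOf X4 x ≡ false →
      None (G u) Pre → G u x ≡ true → ∀ q → elem q Rest ≡ true → G u q ≡ true → None (G x) Rest → Smaller X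
    relabel Pre x y Rest ch nd' sb hd ls nb4x nPre gux q qR guq nxR =
      family₅ ⁅ x ⁆ ⁅ u ⁆ ⁅ r ⁆ (X4 ∪ elems Rest) (X3 ∪ elems Pre) , F₂-model cert , U , y , ⋃-intro X v5 y
          yX5 , Uf
      where
      L : List (Fin n)
      L = Pre ++ x ∷ y ∷ Rest
      xX5 : X5 x ≡ true
      xX5 = sb x (elem-middle Pre x (y ∷ Rest))
      yX5 : X5 y ≡ true
      yX5 = sb y (suffix-⊆ Pre x (y ∷ Rest) y (elem-head y Rest))
      subPre : elems Pre ⊆ X5
      subPre = ⊆-trans (prefix-⊆ Pre x (y ∷ Rest)) sb
      subRest : elems Rest ⊆ X5
      subRest = ⊆-trans (⊆-trans (⊆-tail y Rest) (suffix-⊆ Pre x (y ∷ Rest))) sb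
      ndi : DistinctSplit Pre x (y ∷ Rest)
      ndi = Distinct-split Pre x (y ∷ Rest) nd'
      x∉Pre : elem x Pre ≡ false
      x∉Pre = x∉prefix ndi
      x∉Rest : elem x Rest ≡ false
      x∉Rest = ∉-⊆ Rest x (⊆-tail y Rest) (x∉suffix ndi)
      y∉Rest : elem y Rest ≡ false
      y∉Rest = proj₁ (suffix-distinct ndi)
      dPreR : Disjoint (elems Pre) (elems (y ∷ Rest))
      dPreR = prefix#suffix ndi
      chs : PathSplit Pre x (y ∷ Rest)
      chs = IsPath-split Pre x (y ∷ Rest) ch
      neRest : Rest ≢ []
      neRest e = lem e qR
        where
        lem : Rest ≡ [] → elem q Rest ≡ true → ⊥
        lem refl ()
      tRest : Touches X4 (elems Rest)
      tRest with LastIn-∷⁻ (NbrOf X4) y Rest (LastIn-++⁻ (NbrOf X4) Pre (x ∷ y ∷ Rest) ls (λ ()))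
      ... | inj₁ (e , _) = ⊥-elim (neRest e)
      ... | inj₂ l = elem-NbrOf⇒Touches X4 Rest (LastIn-elem (NbrOf X4) Rest l)
      s45 : X4 ∪ elems Rest ⊆ X4 ∪ X5
      s45 = ∪-least (p⊆p∪q {f = X4} X5) (⊆-trans subRest (q⊆p∪q X4 {X5}))
      s35 : X3 ∪ elems Pre ⊆ X3 ∪ X5
      s35 = ∪-least (p⊆p∪q {f = X3} X5) (⊆-trans subPre (q⊆p∪q X3 {X5}))
      nx4 : NoEdge ⁅ x ⁆ X4
      nx4 a b p q e with x∈⁅y⁆⇒x≡y {c = x} {a} p
      ... | refl = true≢false (NbrOf-intro X4 b a q (trans (G-sym b a) e)) nb4x
      cert : F₂-Conditions ⁅ x ⁆ ⁅ u ⁆ ⁅ r ⁆ (X4 ∪ elems Rest) (X3 ∪ elems Pre)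
      cert = record
        { n1 = x , x∈⁅x⁆ x ; n2 = u , x∈⁅x⁆ u ; n3 = r , x∈⁅x⁆ r
        ; n4 = q , ∪-introʳ X4 {elems Rest} qR
        ; n5 = proj₁ (nonempty v3) , ∪-introˡ {f = X3} (elems Pre) (proj₂ (nonempty v3))
        ; c1 = connected-⁅⁆ x ; c2 = connected-⁅⁆ u ; c3 = connected-⁅⁆ r
        ; c4 = connected-∪-path Rest (connected v4) (PathFrom⇒IsPath y Rest (proj₂ (suffix-path chs)))
            (inj₂ tRest)
        ; c5 = connected-∪-prefix Pre x (y ∷ Rest) (connected v3) ch hd
        ; d12 = Disjoint-mono (⁅x⁆⊆p {f = X5} xX5) (⁅x⁆⊆p {f = X1} uX1) D51
        ; d13 = Disjoint-mono (⁅x⁆⊆p {f = X5} xX5) (⁅x⁆⊆p {f = X2} rX2) D52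
        ; d14 = Disjoint-⁅⁆ (∨-false (X4 x) (∉-Disjoint D54 xX5) x∉Rest)
        ; d15 = Disjoint-⁅⁆ (∨-false (X3 x) (∉-Disjoint D53 xX5) x∉Pre)
        ; d23 = Disjoint-mono (⁅x⁆⊆p {f = X1} uX1) (⁅x⁆⊆p {f = X2} rX2) D12
        ; d24 = Disjoint-mono (⁅x⁆⊆p {f = X1} uX1) s45 (Disjoint-∪ʳ D14 D15)
        ; d25 = Disjoint-mono (⁅x⁆⊆p {f = X1} uX1) s35 (Disjoint-∪ʳ D13 D15)
        ; d34 = Disjoint-mono (⁅x⁆⊆p {f = X2} rX2) s45 (Disjoint-∪ʳ D24 D25)
        ; d35 = Disjoint-mono (⁅x⁆⊆p {f = X2} rX2) s35 (Disjoint-∪ʳ D23 D25)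
        ; d45 = Disjoint-∪ˡ (Disjoint-∪ʳ D43 (Disjoint-mono ⊆-refl subPre D45))
            (Disjoint-∪ʳ (Disjoint-mono subRest ⊆-refl D53)
            (Disjoint-sym (Disjoint-mono ⊆-refl (⊆-tail y Rest) dPreR)))
        ; t12 = x , u , x∈⁅x⁆ x , x∈⁅x⁆ u , trans (G-sym x u) gux
        ; t15 = middle-touches-prefix Pre x (y ∷ Rest) ch hd
        ; t23 = u , r , x∈⁅x⁆ u , x∈⁅x⁆ r , gur
        ; t24 = u , q , x∈⁅x⁆ u , ∪-introʳ X4 {elems Rest} qR , guq
        ; t34 = Touches-mono ⊆-refl (p⊆p∪q {f = X4} (elems Rest)) (Touches-singleton sr T24)
        ; t35 = Touches-mono ⊆-refl (p⊆p∪q {f = X3} (elems Pre)) (Touches-singleton sr T23)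
        ; t45 = Touches-mono (p⊆p∪q {f = X4} (elems Rest)) (p⊆p∪q {f = X3} (elems Pre)) T43
        ; x13 = NoEdge-mono (⁅x⁆⊆p {f = X5} xX5) (⁅x⁆⊆p {f = X2} rX2) N52
        ; x14 = NoEdge-∪ʳ nx4 (None-adj⇒NoEdge x Rest nxR)
        ; x25 = NoEdge-∪ʳ (NoEdge-mono (⁅x⁆⊆p {f = X1} uX1) ⊆-refl N13) (None-adj⇒NoEdge u Pre nPre)
        }
      U : Within (family₅ ⁅ x ⁆ ⁅ u ⁆ ⁅ r ⁆ (X4 ∪ elems Rest) (X3 ∪ elems Pre)) X
      U = ⋃-family₅-⊆ {X = X} (⊆-trans (⁅x⁆⊆p {f = X5} xX5) (⊆-⋃ X v5))
          (⊆-trans (⁅x⁆⊆p {f = X1} uX1) (⊆-⋃ X v1))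
            (⊆-trans (⁅x⁆⊆p {f = X2} rX2) (⊆-⋃ X v2)) (∪-least (⊆-⋃ X v4) (⊆-trans subRest (⊆-⋃ X v5)))
                (∪-least (⊆-⋃ X v3) (⊆-trans subPre (⊆-⋃ X v5)))
      Uf : ⋃ (family₅ ⁅ x ⁆ ⁅ u ⁆ ⁅ r ⁆ (X4 ∪ elems Rest) (X3 ∪ elems Pre)) y ≡ false
      Uf = ∉-⋃-family₅ {A = ⁅ x ⁆} {B = ⁅ u ⁆} {C = ⁅ r ⁆} {D = X4 ∪ elems Rest} {E = X3 ∪ elems Pre} y
             (x≢y⇒x∉⁅y⁆ (λ e → true≢false (subst (λ w → elem w (y ∷ Rest) ≡ true) e (elem-head y Rest))
                 (x∉suffix ndi)))
             (∉-Disjoint (Disjoint-mono ⊆-refl (⁅x⁆⊆p {f = X1} uX1) D51) yX5)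
                 (∉-Disjoint (Disjoint-mono ⊆-refl (⁅x⁆⊆p {f = X2} rX2) D52) yX5)
             (∨-false (X4 y) (∉-Disjoint D54 yX5) y∉Rest)
                 (∨-false (X3 y) (∉-Disjoint D53 yX5) (∉-Disjoint (Disjoint-sym dPreR) (elem-head y Rest)))

    X₃-X₄-PathIn-X₅ : List (Fin n) → Set
    X₃-X₄-PathIn-X₅ L = IsPath L × Distinct L × elems L ⊆ X5 × HeadIn (NbrOf X3) L × LastIn (NbrOf X4) L

    shrink-no-nbr-on-path : ∀ L → X₃-X₄-PathIn-X₅ L → None (G u) L → Smaller X
    shrink-no-nbr-on-path [] (ch , nd' , sb , () , ls) nu
    shrink-no-nbr-on-path (x ∷ B) (ch , nd' , sb , hd , ls) nu with u-has-nbr-in-X₅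
    ... | b , bX5 , gub with ReachIn⇒path (connected v5 x b (sb x (elem-head x B)) bX5)
    ... | M' , chM , sM , lsM with LastIn-elem ⁅ b ⁆ (x ∷ M') lsM
    ... | b' , mb' , eb' with x∈⁅y⁆⇒x≡y {c = b} {b'} eb'
    ... | refl with first-split (G u) (x ∷ M') (anyᴸ-intro (G u) b' (x ∷ M') mb' gub)
    ... | A2 , c , B2 , eq2 , noneA2 , guc =
      shrink-many-nbrs M v5 Y subY (x , ∪-introˡ {f = elems (x ∷ B)} (elems R) (elem-head x B)) cY
        (touches-F₂-nbrs-of-v5 Y t1 t3 t4) u c c two big
      where
      R : List (Fin n)
      R = A2 ++ c ∷ []
      Y : FinPred n
      Y = elems (x ∷ B) ∪ elems R
      chR : IsPath R
      chR = IsPath-snoc-prefix A2 c B2 (subst IsPath eq2 chM)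
      subR : elems R ⊆ X5
      subR = ⊆-trans (snoc-prefix-⊆ A2 c B2)
          (subst (λ Z → elems Z ⊆ X5) eq2 (∷-⊆ x M' (sb x (elem-head x B)) sM))
      subY : Y ⊆ X5
      subY = ∪-least sb subR
      cY : IsConnected Y
      cY = connected-∪-overlap (path-connected (x ∷ B) ch (λ ())) (path-connected R chR (∷ʳ≢[] A2 c))
          (x , elem-head x B , head-elem-snoc-prefix x M' A2 c B2 eq2)
      two : ∀ w → Y w ≡ true → G u w ≡ true → (w ≡ c) ⊎ (w ≡ c)
      two w p q with ∪-elim (elems (x ∷ B)) (elems R) w p
      ... | inj₁ m = ⊥-elim (true≢false q (nu w m))
      ... | inj₂ m with elem-++-elim w A2 (c ∷ []) m
      ... | inj₁ m' = ⊥-elim (true≢false q (noneA2 w m'))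
      ... | inj₂ m' with elem-∷-elim w c [] m'
      ... | inj₁ e = inj₁ e
      ... | inj₂ ()
      t1 : Touches Y X1
      t1 = c , u , ∪-introʳ (elems (x ∷ B)) {elems R} (elem-middle A2 c []) , uX1 , trans (G-sym c u) guc
      t3 : Touches Y X3
      t3 = Touches-mono (p⊆p∪q {f = elems (x ∷ B)} (elems R)) ⊆-refl
          (Touches-sym (elem-NbrOf⇒Touches X3 (x ∷ B) (x , elem-head x B , hd)))
      t4 : Touches Y X4
      t4 = Touches-mono (p⊆p∪q {f = elems (x ∷ B)} (elems R)) ⊆-refl
          (Touches-sym (elem-NbrOf⇒Touches X4 (x ∷ B) (LastIn-elem (NbrOf X4) (x ∷ B) ls)))

    shrink-few-nbrs-on-path : ∀ L → X₃-X₄-PathIn-X₅ L → ∀ a b →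
      (∀ w → elem w L ≡ true → G u w ≡ true → (w ≡ a) ⊎ (w ≡ b)) → ∀ c → elem c L ≡ true → G u c ≡ true →
      Smaller X
    shrink-few-nbrs-on-path [] (ch , nd' , sb , () , ls) a b two c mc guc
    shrink-few-nbrs-on-path (x ∷ B) (ch , nd' , sb , hd , ls) a b two c mc guc =
      shrink-many-nbrs M v5 (elems (x ∷ B)) sb (x , elem-head x B) (path-connected (x ∷ B) ch (λ ()))
          (touches-F₂-nbrs-of-v5 (elems (x ∷ B)) t1 t3 t4) u a b two big
      where
      t1 : Touches (elems (x ∷ B)) X1
      t1 = c , u , mc , uX1 , trans (G-sym c u) guc
      t3 : Touches (elems (x ∷ B)) X3
      t3 = Touches-sym (elem-NbrOf⇒Touches X3 (x ∷ B) (x , elem-head x B , hd))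
      t4 : Touches (elems (x ∷ B)) X4
      t4 = Touches-sym (elem-NbrOf⇒Touches X4 (x ∷ B) (LastIn-elem (NbrOf X4) (x ∷ B) ls))

    shrink-along-path : ∀ k → (∀ L → X₃-X₄-PathIn-X₅ L → length L ≤ k → Smaller X) → ∀ L → X₃-X₄-PathIn-X₅ L →
      None (NbrOf X4) (init L) → length L ≤ suc k → Smaller X
    shrink-along-path k ih L wi@(ch , nd' , sb , hd , ls) n4 len with true⊎false (anyᴸ (G u) L)
    ... | inj₂ f = shrink-no-nbr-on-path L wi (anyᴸ-false (G u) L f)
    ... | inj₁ t with first-split (G u) L t
    ... | Pre , x , [] , refl , nPre , gux = shrink-few-nbrs-on-path (Pre ++ x ∷ []) wi x x two x
        (elem-middle Pre x []) gux
      where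
      two : ∀ w → elem w (Pre ++ x ∷ []) ≡ true → G u w ≡ true → (w ≡ x) ⊎ (w ≡ x)
      two w m q with elem-++-elim w Pre (x ∷ []) m
      ... | inj₁ m' = ⊥-elim (true≢false q (nPre w m'))
      ... | inj₂ m' with elem-∷-elim w x [] m'
      ... | inj₁ e = inj₁ e
      ... | inj₂ ()
    ... | Pre , x , y ∷ Rest , refl , nPre , gux with true⊎false (anyᴸ (G u) Rest)
    ... | inj₂ f = shrink-few-nbrs-on-path (Pre ++ x ∷ y ∷ Rest) wi x y two x (elem-middle Pre x (y ∷ Rest))
        gux
      where
      two : ∀ w → elem w (Pre ++ x ∷ y ∷ Rest) ≡ true → G u w ≡ true → (w ≡ x) ⊎ (w ≡ y)
      two w m q with elem-++-elim w Pre (x ∷ y ∷ Rest) m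
      ... | inj₁ m' = ⊥-elim (true≢false q (nPre w m'))
      ... | inj₂ m' with elem-∷-elim w x (y ∷ Rest) m'
      ... | inj₁ e = inj₁ e
      ... | inj₂ m'' with elem-∷-elim w y Rest m''
      ... | inj₁ e = inj₂ e
      ... | inj₂ m3 = ⊥-elim (true≢false q (anyᴸ-false (G u) Rest f w m3))
    ... | inj₁ t2 with anyᴸ-elim (G u) Rest t2 | true⊎false (anyᴸ (G x) Rest)
    ... | q , qR , guq | inj₂ f = relabel Pre x y Rest ch nd' sb hd ls nb4x nPre gux q qR guq
        (anyᴸ-false (G x) Rest f)
      where
      nb4x : NbrOf X4 x ≡ false
      nb4x = n4 x (subst (λ Z → elem x Z ≡ true) (sym (init-app Pre x y Rest))
          (elem-middle Pre x (init (y ∷ Rest))))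
    ... | q , qR , guq | inj₁ t3 with last-split (G x) Rest t3
    ... | m1 , z , m2 , refl , gxz , _ = ih (Pre ++ x ∷ z ∷ m2) wi'
        (≤-pred (≤-trans (length-shortcut< Pre x y m1 z m2) len))
      where
      rest : List (Fin n)
      rest = m1 ++ z ∷ m2
      chs : PathSplit Pre x (y ∷ rest)
      chs = IsPath-split Pre x (y ∷ rest) ch
      chz : PathFrom z m2
      chz = suffix-path (IsPath-split (y ∷ m1) z m2 (proj₂ (suffix-path chs)))
      ndi : DistinctSplit Pre x (y ∷ rest)
      ndi = Distinct-split Pre x (y ∷ rest) nd'
      ndr : DistinctSplit (y ∷ m1) z m2
      ndr = Distinct-split (y ∷ m1) z m2 (suffix-distinct ndi)
      sZ : elems (z ∷ m2) ⊆ elems (y ∷ rest)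
      sZ = ⊆-++ʳ (y ∷ m1) (z ∷ m2)
      ndX : Distinct (x ∷ z ∷ m2)
      ndX = ∉-⊆ (z ∷ m2) x sZ (x∉suffix ndi) , x∉suffix ndr , suffix-distinct ndr
      sX : elems (x ∷ z ∷ m2) ⊆ elems (x ∷ y ∷ rest)
      sX = ∷-⊆ x (z ∷ m2) (elem-head x (y ∷ rest)) (⊆-trans sZ (⊆-tail x (y ∷ rest)))
      dP : Disjoint (elems Pre) (elems (x ∷ y ∷ rest))
      dP = Disjoint-∪ʳ {f = ⁅ x ⁆} {g = elems (y ∷ rest)} (Disjoint-sym (Disjoint-⁅⁆ (x∉prefix ndi)))
          (prefix#suffix ndi)
      lsz : LastIn (NbrOf X4) (z ∷ m2)
      lsz = LastIn-++⁻ (NbrOf X4) (y ∷ m1) (z ∷ m2) (LastIn-++⁻ (NbrOf X4) Pre (x ∷ y ∷ rest) ls (λ ()))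
          (λ ())
      wi' : X₃-X₄-PathIn-X₅ (Pre ++ x ∷ z ∷ m2)
      wi' = IsPath-join Pre x (z ∷ m2) (prefix-path chs) (last-adj chs) (gxz , chz)
          , Distinct-++⁺ Pre (x ∷ z ∷ m2) (prefix-distinct ndi) ndX (Disjoint-mono ⊆-refl sX dP)
          , ⊆-trans (++-⊆ Pre (x ∷ z ∷ m2) (⊆-++ˡ Pre (x ∷ y ∷ rest)) (⊆-trans sX (⊆-++ʳ Pre (x ∷ y ∷ rest))))
              sb
          , HeadIn-retail (NbrOf X3) Pre x (y ∷ rest) (z ∷ m2) hd
          , LastIn-++⁺ (NbrOf X4) Pre (x ∷ z ∷ m2) lsz

    trim-path : ∀ k L → X₃-X₄-PathIn-X₅ L → length L ≤ k → Smaller X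
    trim-path zero [] (ch , nd' , sb , () , ls) len
    trim-path zero (x ∷ L) wi ()
    trim-path (suc k) L wi@(ch , nd' , sb , hd , ls) len with first-split (NbrOf X4) L
        (anyᴸ-LastIn (NbrOf X4) L ls)
    ... | A , x , b ∷ B , refl , noneA , nb4 =
      trim-path k (A ++ x ∷ [])
        ( IsPath-snoc-prefix A x (b ∷ B) ch
        , Distinct-snoc-prefix A x (b ∷ B) nd'
        , ⊆-trans (snoc-prefix-⊆ A x (b ∷ B)) sb
        , HeadIn-retail (NbrOf X3) A x (b ∷ B) [] hd
        , LastIn-snoc (NbrOf X4) A x nb4)
        (≤-pred (≤-trans (length-snoc-prefix< A x (b ∷ B) (λ ())) len))
    ... | A , x , [] , refl , noneA , nb4 = shrink-along-path k (trim-path k) (A ++ x ∷ []) wi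
        (subst (None (NbrOf X4)) (sym (init-snoc A x)) noneA) len

    smaller : Smaller X
    smaller with Touches⇒NbrOf X3 X5 T35 | Touches⇒NbrOf X4 X5 T45
    ... | x , px , nx | y , py , ny with path-between {S = X5} {P = NbrOf X3} {Q = NbrOf X4} (connected v5) x
        y px py nx ny
    ... | mkPath L ch nd' sb hd ls = trim-path (length L) L (ch , nd' , sb , hd , ls) ≤-refl

  -- Induction on the number of vertices used
  Good : (Fin 5 → FinPred n) → Set
  Good X = F₂-Model X × (∃ λ u → ∃ λ r → IsSingleton (X v1) u × IsSingleton (X v2) r ×
    degIn G u (toSubset (X v5)) ≤ 2 × degIn G r (toSubset (X v3)) ≤ 2 × degIn G r (toSubset (X v4)) ≤ 2)

  size : (Fin 5 → FinPred n) → ℕ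
  size X = ∣ toSubset (⋃ X) ∣

  size-StrictlyWithin : ∀ {X' X : Fin 5 → FinPred n} → StrictlyWithin X' X → size X' < size X
  size-StrictlyWithin (s , x , p , q) = ∣toSubset∣-strict-mono s x p q

  Smaller-Within : ∀ {X′ X : Fin 5 → FinPred n} → Smaller X′ → Within X′ X → Smaller X
  Smaller-Within {X′} {X} (X″ , M″ , X″⊂X′) X′⊆X = X″ , M″ , StrictlyWithin-Within {X″ = X″} {X′} {X} X″⊂X′
      X′⊆X

  smaller-or-good : ∀ {X : Fin 5 → FinPred n} → F₂-Model X → Smaller X ⊎ Σ (Fin 5 → FinPred n) Good
  smaller-or-good {X} M with singletons M
  ... | inj₁ smaller = inj₁ smaller
  ... | inj₂ (X′ , M′ , (u , su) , (r , sr) , X′⊆X)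
    with degIn G u (toSubset (X′ v5)) ≤? 2 | degIn G r (toSubset (X′ v3)) ≤? 2 | degIn G r (toSubset (X′ v4))
        ≤? 2
  ... | yes d₅ | yes d₃ | yes d₄ = inj₂ (X′ , M′ , u , r , su , sr , d₅ , d₃ , d₄)
  ... | no d₅ | _ | _ = inj₁ (Smaller-Within {X′} {X} (DegreeX₅.smaller M′ su sr d₅) X′⊆X)
  ... | yes _ | no d₃ | _ = inj₁ (Smaller-Within {X′} {X} (DegreeX₃.smaller M′ su sr d₃) X′⊆X)
  ... | yes _ | yes _ | no d₄ = inj₁ (Smaller-Within {X′} {X} (Smaller-Within {λ y → X′ (swap₃₄ y)} {X′}
    (DegreeX₃.smaller (model-swap₃₄ M′) su sr d₄) (reindex-⋃ X′ swap₃₄)) X′⊆X)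

  good-model-below : ∀ k {X : Fin 5 → FinPred n} → F₂-Model X → size X < k → Σ (Fin 5 → FinPred n) Good
  good-model-below (suc k) {X} M size<k with smaller-or-good M
  ... | inj₂ good = good
  ... | inj₁ (X′ , M′ , X′⊂X) =
    good-model-below k M′ (≤-trans (size-StrictlyWithin {X′} {X} X′⊂X) (≤-pred size<k))

  good-model : ∀ {X : Fin 5 → FinPred n} → F₂-Model X → Σ (Fin 5 → FinPred n) Good
  good-model {X} M = good-model-below (suc (size X)) M ≤-refl

lemma10 : ∀ {n} (G : Graph n) → IsSimple G → IsInducedMinor F₂ G →
    Σ (Fin 5 → Subset n) λ X → IsModel F₂ G X ×
      (∃ λ u → ∃ λ r →
        (∀ w → (w ∈ X v1 → w ≡ u) × (w ≡ u → w ∈ X v1)) ×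
        (∀ w → (w ∈ X v2 → w ≡ r) × (w ≡ r → w ∈ X v2)) ×
        degIn G u (X v5) ≤ 2 ×
        degIn G r (X v3) ≤ 2 × degIn G r (X v4) ≤ 2)
lemma10 G sG D with minor-model sG D
... | _ , M₀ with F₂-Models.good-model G (IsSimple.sym sG) M₀
... | X , M , u , r , X₁≡⁅u⁆ , X₂≡⁅r⁆ , deg₅ , deg₃ , deg₄ =
  (λ y → toSubset (X y)) , ToSubsets.toIsModel G sG M , u , r ,
  IsSingleton-toSubset X₁≡⁅u⁆ , IsSingleton-toSubset X₂≡⁅r⁆ , deg₅ , deg₃ , deg₄
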